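{- A gain signed graph $\Upsilon=(\Gamma,\sigma,\varphi)$ (with orientation $\tau$) is hyperbalanced if and only if there is a gain switcher $\theta:V\to\mathbb{K}$ such that $\varphi^\theta(e)=0$ for every edge $e\in E$.
   Context: Let $\mathbb{K}$ be a field of characteristic $\ne2$. A graph $\Gamma=(V,E)$ has vertex set $V=\{v_1,\dots,v_n\}$ and finite edge set $E$; edges are links (two ends at distinct vertices), loops (two ends at one vertex), half edges (one end) or loose edges (no ends); parallel edges allowed. A gain signed graph $\Upsilon=(\Gamma,\sigma,\varphi)$: $\sigma:E\to\{\pm1\}$ (half edges negative, loose edges positive); with an orientation $\tau$ (signs $\tau(v,e)\in\{\pm1\}$ on edge ends, $\tau(v,e)\tau(w,e)=-\sigma(e)$ for a link or loop with ends $v,w$) each edge has gain $\varphi(e)\in\mathbb{K}$, negated on reorientation. Neutral = gain $0$. Walk gain of $W=u_0e_1\cdots e_lu_l$: $\varphi(W)=-\sum_i\varphi(e_i)\sigma(W_{0,i-1})\tau(u_{i-1},e_i)$, $\sigma(W_{0,j})=\prod_{i\le j}\sigma(e_i)$. Ultrawalks may begin with a half edge $e_0$ at $u_0$ and/or end with a half edge $e_{l+1}$ at $u_l$; their gain adds $\tau(u_0,e_0)\varphi(e_0)$ and/or $-\varphi(e_{l+1})\sigma(W_{0,l})\tau(u_l,e_{l+1})$ to $\varphi(W_{0,l})$. Circles: connected 2-regular subgraphs, sign = product of edge signs; a negative figure is a negative circle or a half edge. A sign circuit is a positive circle, a loose edge, or a handcuff (two negative figures with exactly one common vertex, or two disjoint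 negative figures plus a path joining them meeting them only at its ends). Its gain: the edge gain for a loose edge; else $\varphi(W)$ for a circuit walk (once around a positive circle; for a handcuff with figures $C_1,C_2$, connecting path $P$ of length $\ge0$: around $C_1$, along $P$, around $C_2$, back along $P$ if both circles; from half edge $C_1$ along $P$, around $C_2$, back, ending with $C_1$ if $C_1$ half edge and $C_2$ circle; from one half edge along $P$ to the other if both half edges); well defined up to sign; neutral if $0$. $\Upsilon$ is hyperbalanced if every sign circuit in $E$ is neutral. Gain switching by $\theta:V\to\mathbb{K}$: $\varphi^\theta(e)=\tau(v,e)\theta(v)+\varphi(e)+\tau(w,e)\theta(w)$ for a link or loop with ends $v,w$; $\varphi^\theta(e)=\tau(v,e)\theta(v)+\varphi(e)$ for a half edge at $v$; $\varphi^\theta(e)=\varphi(e)$ for a loose edge. -}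

module Defs where

open import Level using (Level; _⊔_) renaming (suc to lsuc)
open import Algebra.Bundles using (CommutativeRing)
open import Data.Fin using (Fin)
open import Data.Nat using (ℕ)
open import Data.Bool using (Bool; true; false)
open import Data.Sign using (Sign; opposite) renaming (_*_ to _*ₛ_; + to pos; - to neg)
open import Data.List using (List; []; _∷_; map; reverse; _++_)
open import Data.List.Membership.Propositional using (_∈_; _∉_)
open import Data.List.Relation.Unary.Unique.Propositional using (Unique)
open import Data.Maybe using (Maybe; just; nothing)
open import Data.Product using (Σ; _×_; _,_; proj₁)
open import Data.Unit using (⊤)
open import Relation.Binary.PropositionalEquality using (_≡_; _≢_)
open import Relation.Nullary using (¬_)

record Field (c ℓ : Level) : Set (lsuc (c ⊔ ℓ)) where
  field
    commutativeRing : CommutativeRing c ℓ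
  open CommutativeRing commutativeRing public
  field
    0≉1     : ¬ (0# ≈ 1#)
    inverse : ∀ x → ¬ (x ≈ 0#) → Σ Carrier λ y → (x * y) ≈ 1#

-- Every edge carries its ends together with the orientation sign τ(v,e)
-- of each end:
--   two v s w t : a link (v ≢ w) or a loop (v ≡ w) with ends v, w and
--                 τ(v,e) = s, τ(w,e) = t (for a loop: the two ends);
--   half v s    : a half edge at v with τ(v,e) = s;
--   loose       : a loose edge.

data Ends (n : ℕ) : Set where
  two   : Fin n → Sign → Fin n → Sign → Ends n
  half  : Fin n → Sign → Ends n
  loose : Ends n

-- The sign σ(e).  For a link/loop the condition τ(v,e)τ(w,e) = -σ(e)
-- determines σ(e) = -τ(v,e)τ(w,e); half edges are negative, loose edges
-- positive.
edgeSign : ∀ {n} → Ends n → Sign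
edgeSign (two _ s _ t) = opposite (s *ₛ t)
edgeSign (half _ _)    = neg
edgeSign loose         = pos

-- Direction in which a link/loop is traversed: fwd leaves from its first
-- end, bwd from its second end.
data Dir : Set where
  fwd bwd : Dir

flipDir : Dir → Dir
flipDir fwd = bwd
flipDir bwd = fwd

-- (departure vertex, τ at the departure end, arrival vertex)
stepFrom : ∀ {n} → Ends n → Dir → Maybe (Fin n × Sign × Fin n)
stepFrom (two v s w t) fwd = just (v , s , w)
stepFrom (two v s w t) bwd = just (w , t , v)
stepFrom (half _ _)    _   = nothing
stepFrom loose         _   = nothing

module GainGraph {c ℓ} (K : Field c ℓ) {n m : ℕ}
                 (ends : Fin m → Ends n) (φ : Fin m → Field.Carrier K) where

  open Field K

  ⟦_⟧ : Sign → Carrier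
  ⟦ pos ⟧ = 1#
  ⟦ neg ⟧ = - 1#

  σ : Fin m → Sign
  σ e = edgeSign (ends e)

  -- A walk u₀ e₁ u₁ ⋯ e_l u_l is given by its start vertex and its list
  -- of steps (edge, direction).
  Steps : Set
  Steps = List (Fin m × Dir)

  IsWalk : Fin n → Steps → Fin n → Set
  IsWalk u []            x = u ≡ x
  IsWalk u ((e , d) ∷ r) x =
    Σ Sign λ s → Σ (Fin n) λ w → (stepFrom (ends e) d ≡ just (u , s , w)) × IsWalk w r x

  -- τ at the departure end of a step (junk value + for non-steps)
  τdep : Fin m → Dir → Sign
  τdep e d with stepFrom (ends e) d
  ... | just (_ , s , _) = s
  ... | nothing          = pos

  -- arrival vertex of a step (junk value u for non-steps)
  next : Fin n → Fin m → Dir → Fin n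
  next u e d with stepFrom (ends e) d
  ... | just (_ , _ , w) = w
  ... | nothing          = u

  -- vertices u₁ … u_l of a walk starting at u
  vsTail : Fin n → Steps → List (Fin n)
  vsTail u []            = []
  vsTail u ((e , d) ∷ r) = next u e d ∷ vsTail (next u e d) r

  edgesOf : Steps → List (Fin m)
  edgesOf = map proj₁

  revSteps : Steps → Steps
  revSteps P = reverse (map (λ { (e , d) → (e , flipDir d) }) P)

  walkSign : Steps → Sign
  walkSign []            = pos
  walkSign ((e , _) ∷ r) = σ e *ₛ walkSign r

  -- φ(W) = - Σ_i φ(e_i) σ(W_{0,i-1}) τ(u_{i-1}, e_i)
  walkGain : Steps → Carrier
  walkGain []            = 0#
  walkGain ((e , d) ∷ r) = (- (φ e * ⟦ τdep e d ⟧)) + (⟦ σ e ⟧ * walkGain r)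

  -- τ(v,e) of a half edge (junk + otherwise)
  halfτ : Fin m → Sign
  halfτ e with ends e
  ... | half _ s = s
  ... | _        = pos

  -- gain of an ultrawalk: optional initial half edge, walk W, optional
  -- final half edge
  ultraGain : Maybe (Fin m) → Steps → Maybe (Fin m) → Carrier
  ultraGain e₀ W eₗ = startPart e₀ + (walkGain W + endPart eₗ)
    where
      startPart : Maybe (Fin m) → Carrier
      startPart nothing  = 0#
      startPart (just e) = ⟦ halfτ e ⟧ * φ e
      endPart : Maybe (Fin m) → Carrier
      endPart nothing  = 0#
      endPart (just e) = - ((φ e * ⟦ walkSign W ⟧) * ⟦ halfτ e ⟧)

  -- Circles: a circle is traversed by a closed walk u₀ e₁ ⋯ e_l u₀ with
  -- l ≥ 1, distinct edges and distinct vertices u₁,…,u_l (= u₀).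
  IsCircle : Fin n → Steps → Set
  IsCircle u W = IsWalk u W u × (W ≢ []) × Unique (edgesOf W) × Unique (vsTail u W)

  IsPath : Fin n → Steps → Fin n → Set
  IsPath a P b = IsWalk a P b × Unique (a ∷ vsTail a P)

  data NegFig (a : Fin n) : Set where
    halfF : (e : Fin m) → Σ Sign (λ s → ends e ≡ half a s) → NegFig a
    circF : (W : Steps) → IsCircle a W → walkSign W ≡ neg → NegFig a

  figEdges : ∀ {a} → NegFig a → List (Fin m)
  figEdges (halfF e _)   = e ∷ []
  figEdges (circF W _ _) = edgesOf W

  figVerts : ∀ {a} → NegFig a → List (Fin n)
  figVerts {a} (halfF _ _)   = a ∷ []
  figVerts {a} (circF W _ _) = vsTail a W

  -- A handcuff: negative figures F₁ (at a₁), F₂ (at a₂) and a path P from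
  -- a₁ to a₂ (length ≥ 0) meeting F₁ only in a₁ and F₂ only in a₂; the
  -- figures are edge-disjoint and meet only in vertices of P (so if P has
  -- length 0 they have exactly the one common vertex a₁ = a₂, otherwise
  -- they are disjoint).
  IsHandcuff : ∀ {a₁ a₂} → NegFig a₁ → Steps → NegFig a₂ → Set
  IsHandcuff {a₁} {a₂} F₁ P F₂ =
    IsPath a₁ P a₂ ×
    (∀ e → e ∈ figEdges F₁ → e ∉ figEdges F₂) ×
    (∀ v → v ∈ figVerts F₁ → v ∈ (a₁ ∷ vsTail a₁ P) → v ≡ a₁) ×
    (∀ v → v ∈ figVerts F₂ → v ∈ (a₁ ∷ vsTail a₁ P) → v ≡ a₂) ×
    (∀ v → v ∈ figVerts F₁ → v ∈ figVerts F₂ → v ∈ (a₁ ∷ vsTail a₁ P))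

  handcuffGain : ∀ {a₁ a₂} → NegFig a₁ → Steps → NegFig a₂ → Carrier
  handcuffGain (circF W₁ _ _) P (circF W₂ _ _) =
    walkGain (W₁ ++ (P ++ (W₂ ++ revSteps P)))
  handcuffGain (halfF e₁ _)   P (circF W₂ _ _) =
    ultraGain (just e₁) (P ++ (W₂ ++ revSteps P)) (just e₁)
  handcuffGain (circF W₁ _ _) P (halfF e₂ _) =
    ultraGain (just e₂) (revSteps P ++ (W₁ ++ P)) (just e₂)
  handcuffGain (halfF e₁ _)   P (halfF e₂ _) =
    ultraGain (just e₁) P (just e₂)

  -- Hyperbalance: every sign circuit (loose edge, positive circle,
  -- handcuff) is neutral, i.e. its gain (computed from any circuit walk)
  -- is 0.
  Hyperbalanced : Set ℓ
  Hyperbalanced =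
    (∀ e → ends e ≡ loose → φ e ≈ 0#) ×
    (∀ u W → IsCircle u W → walkSign W ≡ pos → walkGain W ≈ 0#) ×
    (∀ a₁ a₂ (F₁ : NegFig a₁) (P : Steps) (F₂ : NegFig a₂) →
       IsHandcuff F₁ P F₂ → handcuffGain F₁ P F₂ ≈ 0#)

  switched : (Fin n → Carrier) → Fin m → Carrier
  switched θ e with ends e
  ... | two v s w t = ((⟦ s ⟧ * θ v) + φ e) + (⟦ t ⟧ * θ w)
  ... | half v s    = (⟦ s ⟧ * θ v) + φ e
  ... | loose       = φ e

-- Switching by θ changes the gain of a walk from u to z only by - θ(u) + σ(W) θ(z). These boundary
-- terms cancel on every circuit walk (a closed positive walk, or one bracketed by half edges), so a
-- switcher neutralising every edge makes every sign circuit neutral.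
-- Conversely, induct on the number of non-loose edges. For a link f = vw, switch at v to neutralise f
-- and contract f: every sign circuit of the contraction lifts, by reinserting f where it passes
-- through w, to a sign circuit with the same gain up to sign, so the contraction is hyperbalanced and
-- its switcher pulls back. Without links each vertex carries only loops and half edges; θ(v) is read
-- off one negative figure there (halving for a loop), and every other edge at v forms with it a
-- positive loop or a tight handcuff, so it is neutral as well.

module Submission where

open import Defs
open import Algebra.Bundles using (Ring)
import Algebra.Properties.Ring as RingProperties
open import Data.Empty using (⊥; ⊥-elim)
open import Data.Fin using (Fin)
import Data.Fin as Fin
open import Data.Fin.Properties using (_≟_; any?; suc-injective)
open import Data.List using (List; []; _∷_; map; reverse; _++_; [_])
import Data.List.Properties as List
open import Data.List.Membership.Propositional using (_∈_; _∉_)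
open import Data.List.Membership.Propositional.Properties using (∈-++⁺ʳ; ∈-++⁺ˡ; ∈-++⁻)
open import Data.List.Relation.Unary.All.Properties using (¬Any⇒All¬)
open import Data.List.Relation.Unary.Any using (here; there)
open import Data.List.Relation.Unary.Unique.Propositional using (Unique; []; _∷_)
open import Data.List.Relation.Unary.Unique.Propositional.Properties using (Unique[x∷xs]⇒x∉xs)
import Data.List.Relation.Unary.Unique.Propositional.Properties as UP
open import Data.List.Relation.Binary.Permutation.Propositional using (_↭_; ↭-sym; ↭⇒↭ₛ)
import Data.List.Relation.Binary.Permutation.Propositional.Properties as Perm
import Data.List.Relation.Binary.Permutation.Setoid.Properties as PermSetoid
open import Data.Maybe using (Maybe; just; nothing)
open import Data.Nat using (ℕ; zero; suc; _≤_; _<_) renaming (_+_ to _+ℕ_)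
import Data.Nat.Properties as ℕ
open import Data.Product using (Σ; ∃; _×_; _,_; proj₁; proj₂)
open import Data.Sign using (Sign; opposite) renaming (_*_ to _*ₛ_; + to pos; - to neg)
import Data.Sign.Properties as Sign
open import Data.Sum using (_⊎_; inj₁; inj₂)
open import Data.Unit using (⊤; tt)
open import Function using (_∘_; _⟨_⟩_; _$_)
open import Function.Bundles using (Equivalence; _⇔_; mk⇔)
import Level
open import Relation.Binary.PropositionalEquality as ≡ using (_≡_; _≢_; refl; cong; cong₂)
import Relation.Binary.Reasoning.Setoid as SetoidReasoning
open import Relation.Nullary using (¬_; Dec; yes; no)
open import Relation.Nullary.Decidable using (True; toWitness)
open import Tactic.RingSolver.Core.AlmostCommutativeRing using (fromCommutativeRing)
import Tactic.RingSolver.NonReflective as RingSolver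

module SignAction {c ℓ} (R : Ring c ℓ) where
  open Ring R renaming (refl to ≈-refl; sym to ≈-sym; trans to ≈-trans; reflexive to ≈-reflexive)
  open RingProperties R using (-0#≈0#; -‿involutive; -‿+-comm)

  infixr 7 _⊙_
  _⊙_ : Sign → Carrier → Carrier
  pos ⊙ x = x
  neg ⊙ x = - x

  ⊙-cong : ∀ s {x y} → x ≈ y → s ⊙ x ≈ s ⊙ y
  ⊙-cong pos x≈y = x≈y
  ⊙-cong neg x≈y = -‿cong x≈y

  ⊙-distrib-+ : ∀ s x y → s ⊙ (x + y) ≈ s ⊙ x + s ⊙ y
  ⊙-distrib-+ pos x y = ≈-refl
  ⊙-distrib-+ neg x y = ≈-sym (-‿+-comm x y)

  ⊙-⊙ : ∀ s t x → s ⊙ t ⊙ x ≈ (s *ₛ t) ⊙ x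
  ⊙-⊙ pos t   x = ≈-refl
  ⊙-⊙ neg pos x = ≈-refl
  ⊙-⊙ neg neg x = -‿involutive x

  ⊙-zero : ∀ s → s ⊙ 0# ≈ 0#
  ⊙-zero pos = ≈-refl
  ⊙-zero neg = -0#≈0#

  ⊙-involutive : ∀ s x → s ⊙ s ⊙ x ≈ x
  ⊙-involutive s x = ≈-trans (⊙-⊙ s s x) (≈-reflexive (cong (_⊙ x) (Sign.s*s≡+ s)))

  ⊙-opposite : ∀ s x → opposite s ⊙ x ≈ - (s ⊙ x)
  ⊙-opposite pos x = ≈-refl
  ⊙-opposite neg x = ≈-sym (-‿involutive x)

  ⊙-‿comm : ∀ s x → s ⊙ (- x) ≈ - (s ⊙ x)
  ⊙-‿comm pos x = ≈-refl
  ⊙-‿comm neg x = ≈-refl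

  ⊙≈0⇒≈0 : ∀ s {x} → s ⊙ x ≈ 0# → x ≈ 0#
  ⊙≈0⇒≈0 s {x} eq = ≈-trans (≈-sym (⊙-involutive s x)) (≈-trans (⊙-cong s eq) (⊙-zero s))

  ≈0⇒⊙≈0 : ∀ s {x} → x ≈ 0# → s ⊙ x ≈ 0#
  ≈0⇒⊙≈0 s eq = ≈-trans (⊙-cong s eq) (⊙-zero s)

  ‿≈0 : ∀ {x} → x ≈ 0# → - x ≈ 0#
  ‿≈0 = ≈0⇒⊙≈0 neg

-- An identity in k sign variables is checked by evaluating both sides at all 2^k assignments.
SignFun : ℕ → Set
SignFun zero    = Sign
SignFun (suc k) = Sign → SignFun k

Pointwise : ∀ k → SignFun k → SignFun k → Set
Pointwise zero    x y = x ≡ y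
Pointwise (suc k) f g = ∀ s → Pointwise k (f s) (g s)

pointwise? : ∀ k f g → Dec (Pointwise k f g)
pointwise? zero    x y = x Sign.≟ y
pointwise? (suc k) f g with pointwise? k (f pos) (g pos) | pointwise? k (f neg) (g neg)
... | yes p | yes q = yes λ { pos → p ; neg → q }
... | no ¬p | _     = no λ h → ¬p (h pos)
... | _     | no ¬q = no λ h → ¬q (h neg)

signIdentity : ∀ k {f g : SignFun k} → {True (pointwise? k f g)} → Pointwise k f g
signIdentity k {f} {g} {t} = toWitness t

[a*b]*c≡b*[a*c] : ∀ a b c → (a *ₛ b) *ₛ c ≡ b *ₛ (a *ₛ c)
[a*b]*c≡b*[a*c] = signIdentity 3

[a*b]*a≡b : ∀ a b → (a *ₛ b) *ₛ a ≡ b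
[a*b]*a≡b = signIdentity 2

a*[b*a]≡b : ∀ a b → a *ₛ (b *ₛ a) ≡ b
a*[b*a]≡b = signIdentity 2

[a*[b*c]]*c≡a*b : ∀ a b c → (a *ₛ (b *ₛ c)) *ₛ c ≡ a *ₛ b
[a*[b*c]]*c≡a*b = signIdentity 3

halfτ-of : ∀ {n} → Ends n → Sign
halfτ-of (half _ s)    = s
halfτ-of (two _ _ _ _) = pos
halfτ-of loose         = pos

stepFrom-flip : ∀ {n} (E : Ends n) d {u s w} → stepFrom E d ≡ just (u , s , w) →
                stepFrom E (flipDir d) ≡ just (w , opposite (edgeSign E *ₛ s) , u)
stepFrom-flip (two v s w t) fwd refl = cong (λ z → just (w , z , v)) (far-end s t)
  where far-end : ∀ s t → t ≡ opposite (opposite (s *ₛ t) *ₛ s)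
        far-end = signIdentity 2
stepFrom-flip (two v s w t) bwd refl = cong (λ z → just (v , z , w)) (far-end s t)
  where far-end : ∀ s t → s ≡ opposite (opposite (s *ₛ t) *ₛ t)
        far-end = signIdentity 2

stepFrom-meets : ∀ {n} (E : Ends n) d d' {a s b p s' q} → stepFrom E d ≡ just (a , s , b) →
                 stepFrom E d' ≡ just (p , s' , q) → p ≡ b ⊎ q ≡ b
stepFrom-meets (two v s w t) fwd fwd refl refl = inj₂ refl
stepFrom-meets (two v s w t) fwd bwd refl refl = inj₁ refl
stepFrom-meets (two v s w t) bwd fwd refl refl = inj₁ refl
stepFrom-meets (two v s w t) bwd bwd refl refl = inj₂ refl

stepFrom-back : ∀ {n} (E : Ends n) d d' {a s b c s'} → stepFrom E d ≡ just (a , s , b) →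
                stepFrom E d' ≡ just (b , s' , c) → c ≡ a
stepFrom-back (two v s w t) fwd fwd refl refl = refl
stepFrom-back (two v s w t) fwd bwd refl refl = refl
stepFrom-back (two v s w t) bwd fwd refl refl = refl
stepFrom-back (two v s w t) bwd bwd refl refl = refl

Unique-resp-↭ : ∀ {A : Set} {xs ys : List A} → xs ↭ ys → Unique xs → Unique ys
Unique-resp-↭ p = PermSetoid.Unique-resp-↭ (≡.setoid _) (↭⇒↭ₛ p)

Unique-∷ : ∀ {A : Set} {x : A} {xs} → x ∉ xs → Unique xs → Unique (x ∷ xs)
Unique-∷ x∉xs u = ¬Any⇒All¬ _ x∉xs ∷ u

Unique-tail : ∀ {A : Set} {x : A} {xs} → Unique (x ∷ xs) → Unique xs
Unique-tail (_ ∷ u) = u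

Unique-∷ʳ⇒∉ : ∀ {A : Set} (xs : List A) {x} → Unique (xs ++ [ x ]) → x ∉ xs
Unique-∷ʳ⇒∉ (y ∷ xs) u (here refl) = Unique[x∷xs]⇒x∉xs u (∈-++⁺ʳ xs (here refl))
Unique-∷ʳ⇒∉ (y ∷ xs) u (there x∈xs) = Unique-∷ʳ⇒∉ xs (Unique-tail u) x∈xs

-- Walks, gains and switching

module Walks {c ℓ} (K : Field c ℓ) {n m : ℕ} (ends : Fin m → Ends n) (φ : Fin m → Field.Carrier K) where
  open Field K renaming (refl to ≈-refl; sym to ≈-sym; trans to ≈-trans; reflexive to ≈-reflexive)
  open SignAction ring public
  open SetoidReasoning setoid
  open RingProperties ring using (-0#≈0#; -‿involutive; -‿+-comm; -1*x≈-x)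
  open RingSolver (fromCommutativeRing commutativeRing (λ _ → nothing)) using (solve; _⊜_; _⊕_)
  open GainGraph K ends φ public

  ⟦⟧*≈⊙ : ∀ s x → ⟦ s ⟧ * x ≈ s ⊙ x
  ⟦⟧*≈⊙ pos x = *-identityˡ x
  ⟦⟧*≈⊙ neg x = -1*x≈-x x

  -- The module's gains φ only fix the types; gain computes the walk gain for any edge gains ψ.
  gain : (Fin m → Carrier) → Steps → Carrier
  gain ψ []            = 0#
  gain ψ ((e , d) ∷ r) = - (τdep e d ⊙ ψ e) + σ e ⊙ gain ψ r

  walkGain≈gain : ∀ W → walkGain W ≈ gain φ W
  walkGain≈gain []            = ≈-refl
  walkGain≈gain ((e , d) ∷ r) =
    +-cong (-‿cong (≈-trans (*-comm (φ e) _) (⟦⟧*≈⊙ (τdep e d) (φ e))))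
           (≈-trans (⟦⟧*≈⊙ (σ e) _) (⊙-cong (σ e) (walkGain≈gain r)))

  walkEnd : Fin n → Steps → Fin n
  walkEnd u []            = u
  walkEnd u ((e , d) ∷ r) = walkEnd (next u e d) r

  next-step : ∀ {u' e d u s w} → stepFrom (ends e) d ≡ just (u , s , w) → next u' e d ≡ w
  next-step {u'} {e} {d} eq rewrite eq = refl

  τdep-step : ∀ {e d u s w} → stepFrom (ends e) d ≡ just (u , s , w) → τdep e d ≡ s
  τdep-step {e} {d} eq rewrite eq = refl

  walk-end : ∀ {u W x} → IsWalk u W x → walkEnd u W ≡ x
  walk-end {W = []}                   u≡x                = u≡x
  walk-end {u} {W = (e , d) ∷ r} (s , w , eq , walk) rewrite next-step {u} eq = walk-end walk

  walk-++ : ∀ {u A y B x} → IsWalk u A y → IsWalk y B x → IsWalk u (A ++ B) x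
  walk-++ {A = []}          refl                 q = q
  walk-++ {A = (e , d) ∷ A} (s , w , eq , p) q = s , w , eq , walk-++ p q

  vsTail-++ : ∀ u A B → vsTail u (A ++ B) ≡ vsTail u A ++ vsTail (walkEnd u A) B
  vsTail-++ u []            B = refl
  vsTail-++ u ((e , d) ∷ A) B = cong (next u e d ∷_) (vsTail-++ (next u e d) A B)

  edgesOf-++ : ∀ A B → edgesOf (A ++ B) ≡ edgesOf A ++ edgesOf B
  edgesOf-++ A B = List.map-++ proj₁ A B

  walkSign-++ : ∀ A B → walkSign (A ++ B) ≡ walkSign A *ₛ walkSign B
  walkSign-++ []            B = refl
  walkSign-++ ((e , d) ∷ A) B =
    ≡.trans (cong (σ e *ₛ_) (walkSign-++ A B)) (≡.sym (Sign.*-assoc (σ e) (walkSign A) (walkSign B)))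

  gain-++ : ∀ ψ A B → gain ψ (A ++ B) ≈ gain ψ A + walkSign A ⊙ gain ψ B
  gain-++ ψ []            B = ≈-sym (+-identityˡ _)
  gain-++ ψ ((e , d) ∷ A) B = begin
    - (τdep e d ⊙ ψ e) + σ e ⊙ gain ψ (A ++ B)
      ≈⟨ +-congˡ (⊙-cong (σ e) (gain-++ ψ A B)) ⟩
    - (τdep e d ⊙ ψ e) + σ e ⊙ (gain ψ A + walkSign A ⊙ gain ψ B)
      ≈⟨ +-congˡ (⊙-distrib-+ (σ e) _ _) ⟩
    - (τdep e d ⊙ ψ e) + (σ e ⊙ gain ψ A + σ e ⊙ walkSign A ⊙ gain ψ B)
      ≈⟨ +-assoc _ _ _ ⟨
    (- (τdep e d ⊙ ψ e) + σ e ⊙ gain ψ A) + σ e ⊙ walkSign A ⊙ gain ψ B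
      ≈⟨ +-congˡ (⊙-⊙ (σ e) (walkSign A) _) ⟩
    (- (τdep e d ⊙ ψ e) + σ e ⊙ gain ψ A) + (σ e *ₛ walkSign A) ⊙ gain ψ B ∎

  revSteps-∷ : ∀ e d R → revSteps ((e , d) ∷ R) ≡ revSteps R ++ [ (e , flipDir d) ]
  revSteps-∷ e d R = List.unfold-reverse (e , flipDir d) (map (λ { (e , d) → (e , flipDir d) }) R)

  walk-rev : ∀ {u W x} → IsWalk u W x → IsWalk x (revSteps W) u
  walk-rev {W = []}            refl                 = refl
  walk-rev {u} {(e , d) ∷ R} (s , w , eq , p) =
    ≡.subst (λ L → IsWalk _ L u) (≡.sym (revSteps-∷ e d R))
      (walk-++ (walk-rev p) (opposite (σ e *ₛ s) , u , stepFrom-flip (ends e) d eq , refl))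

  walkSign-rev : ∀ W → walkSign (revSteps W) ≡ walkSign W
  walkSign-rev []            = refl
  walkSign-rev ((e , d) ∷ R) rewrite revSteps-∷ e d R | walkSign-++ (revSteps R) [ (e , flipDir d) ]
    | walkSign-rev R | Sign.*-identityʳ (σ e) = Sign.*-comm (walkSign R) (σ e)

  edgesOf-rev : ∀ W → edgesOf (revSteps W) ≡ reverse (edgesOf W)
  edgesOf-rev []            = refl
  edgesOf-rev ((e , d) ∷ R) rewrite revSteps-∷ e d R | List.map-++ proj₁ (revSteps R) [ (e , flipDir d) ]
    | edgesOf-rev R = ≡.sym (List.unfold-reverse e (edgesOf R))

  vsTail-rev : ∀ {u W x} → IsWalk u W x → x ∷ vsTail x (revSteps W) ≡ reverse (u ∷ vsTail u W)
  vsTail-rev {W = []} refl = refl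
  vsTail-rev {u} {(e , d) ∷ R} {x} (s , w , eq , p)
    rewrite revSteps-∷ e d R | vsTail-++ x (revSteps R) [ (e , flipDir d) ]
      | walk-end (walk-rev p) | next-step {u} eq | next-step {w} (stepFrom-flip (ends e) d eq) =
    ≡.trans (cong (_++ [ u ]) (vsTail-rev p)) (≡.sym (List.unfold-reverse u (w ∷ vsTail w R)))

  ∈-vsTail-rev : ∀ {u W x z} → IsWalk u W x → z ∈ vsTail x (revSteps W) → z ∈ u ∷ vsTail u W
  ∈-vsTail-rev walk z∈ = Perm.∈-resp-↭ (Perm.↭-reverse _) (≡.subst (_ ∈_) (vsTail-rev walk) (there z∈))

  path-rev : ∀ {u W x} → IsWalk u W x → Unique (u ∷ vsTail u W) → Unique (x ∷ vsTail x (revSteps W))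
  path-rev walk u = ≡.subst Unique (≡.sym (vsTail-rev walk)) (Unique-resp-↭ (↭-sym (Perm.↭-reverse _)) u)

  ∈-edgesOf-rev : ∀ {e} W → e ∈ edgesOf (revSteps W) → e ∈ edgesOf W
  ∈-edgesOf-rev W e∈ = Perm.∈-resp-↭ (Perm.↭-reverse _) (≡.subst (_ ∈_) (edgesOf-rev W) e∈)

  edgesOf-rev-unique : ∀ W → Unique (edgesOf W) → Unique (edgesOf (revSteps W))
  edgesOf-rev-unique W u = ≡.subst Unique (≡.sym (edgesOf-rev W)) (Unique-resp-↭ (↭-sym (Perm.↭-reverse _)) u)

  gain-rev : ∀ ψ {u W x} → IsWalk u W x → gain ψ (revSteps W) ≈ - (walkSign W ⊙ gain ψ W)
  gain-rev ψ {W = []} refl = ≈-sym -0#≈0#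
  gain-rev ψ {u} {(e , d) ∷ R} (s , w , eq , p) = ≈-trans reversed (≈-sym original)
    where
      σR = walkSign R
      g = gain ψ R
      middle = (σR *ₛ (σ e *ₛ s)) ⊙ ψ e + - (σR ⊙ g)
      reversed : gain ψ (revSteps ((e , d) ∷ R)) ≈ middle
      reversed = begin
        gain ψ (revSteps ((e , d) ∷ R))
          ≡⟨ cong (gain ψ) (revSteps-∷ e d R) ⟩
        gain ψ (revSteps R ++ [ (e , flipDir d) ])
          ≈⟨ gain-++ ψ (revSteps R) _ ⟩
        gain ψ (revSteps R) + walkSign (revSteps R) ⊙ (- (τdep e (flipDir d) ⊙ ψ e) + σ e ⊙ 0#)
          ≡⟨ cong₂ (λ z y → gain ψ (revSteps R) + z ⊙ (- (y ⊙ ψ e) + σ e ⊙ 0#))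
                   (walkSign-rev R) (τdep-step (stepFrom-flip (ends e) d eq)) ⟩
        gain ψ (revSteps R) + σR ⊙ (- (opposite (σ e *ₛ s) ⊙ ψ e) + σ e ⊙ 0#)
          ≈⟨ +-cong (gain-rev ψ p) (⊙-cong σR (+-cong (-‿cong (⊙-opposite (σ e *ₛ s) (ψ e))) (⊙-zero (σ e)))) ⟩
        - (σR ⊙ g) + σR ⊙ (- - ((σ e *ₛ s) ⊙ ψ e) + 0#)
          ≈⟨ +-congˡ (⊙-cong σR (≈-trans (+-identityʳ _) (-‿involutive _))) ⟩
        - (σR ⊙ g) + σR ⊙ (σ e *ₛ s) ⊙ ψ e
          ≈⟨ +-comm _ _ ⟩
        σR ⊙ (σ e *ₛ s) ⊙ ψ e + - (σR ⊙ g)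
          ≈⟨ +-congʳ (⊙-⊙ σR _ _) ⟩
        middle ∎
      original : - ((σ e *ₛ σR) ⊙ gain ψ ((e , d) ∷ R)) ≈ middle
      original = begin
        - ((σ e *ₛ σR) ⊙ (- (τdep e d ⊙ ψ e) + σ e ⊙ g))
          ≡⟨ cong (λ y → - ((σ e *ₛ σR) ⊙ (- (y ⊙ ψ e) + σ e ⊙ g))) (τdep-step eq) ⟩
        - ((σ e *ₛ σR) ⊙ (- (s ⊙ ψ e) + σ e ⊙ g))
          ≈⟨ -‿cong (⊙-distrib-+ (σ e *ₛ σR) (- (s ⊙ ψ e)) (σ e ⊙ g)) ⟩
        - ((σ e *ₛ σR) ⊙ - (s ⊙ ψ e) + (σ e *ₛ σR) ⊙ σ e ⊙ g)
          ≈⟨ -‿+-comm _ _ ⟨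
        - ((σ e *ₛ σR) ⊙ - (s ⊙ ψ e)) + - ((σ e *ₛ σR) ⊙ σ e ⊙ g)
          ≈⟨ +-cong (≈-trans (-‿cong (⊙-‿comm (σ e *ₛ σR) (s ⊙ ψ e)))
                              (≈-trans (-‿involutive _) (⊙-⊙ (σ e *ₛ σR) s (ψ e))))
                    (-‿cong (⊙-⊙ (σ e *ₛ σR) (σ e) g)) ⟩
        ((σ e *ₛ σR) *ₛ s) ⊙ ψ e + - (((σ e *ₛ σR) *ₛ σ e) ⊙ g)
          ≡⟨ cong₂ (λ a b → a ⊙ ψ e + - (b ⊙ g)) ([a*b]*c≡b*[a*c] (σ e) σR s) ([a*b]*a≡b (σ e) σR) ⟩
        middle ∎

  NoInitialBacktrack : Steps → Set
  NoInitialBacktrack ((e , _) ∷ (e' , _) ∷ _) = e ≢ e'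
  NoInitialBacktrack _                        = ⊤

  HeadEdge≢ : Fin m → Steps → Set
  HeadEdge≢ e []             = ⊤
  HeadEdge≢ e ((e' , _) ∷ _) = e ≢ e'

  edge-not-reused : ∀ e d {a s b} → stepFrom (ends e) d ≡ just (a , s , b) →
                    ∀ p R {z} → IsWalk p R z → b ∉ vsTail p R → (p ≡ b → HeadEdge≢ e R) → e ∉ edgesOf R
  edge-not-reused e d eq p ((e₁ , d₁) ∷ R) (s₁ , p₁ , eq₁ , walk) b∉ head≢ (here refl)
    with stepFrom-meets (ends e) d d₁ eq eq₁
  ... | inj₁ p≡b  = head≢ p≡b refl
  ... | inj₂ p₁≡b = b∉ (here (≡.sym (≡.trans (next-step {p} eq₁) p₁≡b)))
  edge-not-reused e d eq p ((e₁ , d₁) ∷ R) (s₁ , p₁ , eq₁ , walk) b∉ head≢ (there e∈R) =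
    edge-not-reused e d eq p₁ R walk
      (λ b∈ → b∉ (there (≡.subst (λ q → _ ∈ vsTail q R) (≡.sym (next-step {p} eq₁)) b∈)))
      (λ p₁≡b → ⊥-elim (b∉ (here (≡.sym (≡.trans (next-step {p} eq₁) p₁≡b))))) e∈R

  distinctVertices⇒distinctEdges : ∀ {x L z} → IsWalk x L z → Unique (vsTail x L) →
                                   NoInitialBacktrack L → Unique (edgesOf L)
  distinctVertices⇒distinctEdges {L = []} _ _ _ = []
  distinctVertices⇒distinctEdges {x} {(e , d) ∷ R} (s , y , eq , walk) u nb rewrite next-step {x} eq =
    Unique-∷ (edge-not-reused e d eq y R walk (Unique[x∷xs]⇒x∉xs u) (λ _ → head≢ R nb))
             (distinctVertices⇒distinctEdges walk (Unique-tail u) (tail-nb R walk u))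
    where
      head≢ : ∀ R → NoInitialBacktrack ((e , d) ∷ R) → HeadEdge≢ e R
      head≢ []      _  = tt
      head≢ (_ ∷ _) nb = nb
      tail-nb : ∀ R {z} → IsWalk y R z → Unique (y ∷ vsTail y R) → NoInitialBacktrack R
      tail-nb []                      _ _ = tt
      tail-nb ((e₁ , d₁) ∷ [])        _ _ = tt
      tail-nb ((e₁ , d₁) ∷ (e₂ , d₂) ∷ R) (s₁ , y₁ , eq₁ , s₂ , y₂ , eq₂ , _) u e₁≡e₂
        rewrite next-step {y} eq₁ | e₁≡e₂ | next-step {y₁} eq₂ =
        Unique[x∷xs]⇒x∉xs u (there (here (≡.sym (stepFrom-back (ends e₂) d₁ d₂ eq₁ eq₂))))

  switchEnds : Carrier → (Fin n → Carrier) → Ends n → Carrier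
  switchEnds x θ (two v s w t) = (s ⊙ θ v + x) + t ⊙ θ w
  switchEnds x θ (half v s)    = s ⊙ θ v + x
  switchEnds x θ loose         = x

  switch : (Fin m → Carrier) → (Fin n → Carrier) → Fin m → Carrier
  switch ψ θ e = switchEnds (ψ e) θ (ends e)

  switched≈switch : ∀ θ e → switched θ e ≈ switch φ θ e
  switched≈switch θ e with ends e
  ... | two v s w t = +-cong (+-congʳ (⟦⟧*≈⊙ s (θ v))) (⟦⟧*≈⊙ t (θ w))
  ... | half v s    = +-congʳ (⟦⟧*≈⊙ s (θ v))
  ... | loose       = ≈-refl

  switchEnds-+ : ∀ x θ₀ θ₁ E → switchEnds (switchEnds x θ₀ E) θ₁ E ≈ switchEnds x (λ z → θ₀ z + θ₁ z) E
  switchEnds-+ x θ₀ θ₁ (two v s w t) = begin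
    (s ⊙ θ₁ v + ((s ⊙ θ₀ v + x) + t ⊙ θ₀ w)) + t ⊙ θ₁ w
      ≈⟨ solve 5 (λ A₁ A₀ X B₀ B₁ → ((A₁ ⊕ ((A₀ ⊕ X) ⊕ B₀)) ⊕ B₁) ⊜ (((A₀ ⊕ A₁) ⊕ X) ⊕ (B₀ ⊕ B₁))) ≈-refl
                 (s ⊙ θ₁ v) (s ⊙ θ₀ v) x (t ⊙ θ₀ w) (t ⊙ θ₁ w) ⟩
    ((s ⊙ θ₀ v + s ⊙ θ₁ v) + x) + (t ⊙ θ₀ w + t ⊙ θ₁ w)
      ≈⟨ +-cong (+-congʳ (≈-sym (⊙-distrib-+ s (θ₀ v) (θ₁ v)))) (≈-sym (⊙-distrib-+ t (θ₀ w) (θ₁ w))) ⟩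
    (s ⊙ (θ₀ v + θ₁ v) + x) + t ⊙ (θ₀ w + θ₁ w) ∎
  switchEnds-+ x θ₀ θ₁ (half v s) = begin
    s ⊙ θ₁ v + (s ⊙ θ₀ v + x)
      ≈⟨ solve 3 (λ A₁ A₀ X → (A₁ ⊕ (A₀ ⊕ X)) ⊜ ((A₀ ⊕ A₁) ⊕ X)) ≈-refl (s ⊙ θ₁ v) (s ⊙ θ₀ v) x ⟩
    (s ⊙ θ₀ v + s ⊙ θ₁ v) + x
      ≈⟨ +-congʳ (≈-sym (⊙-distrib-+ s (θ₀ v) (θ₁ v))) ⟩
    s ⊙ (θ₀ v + θ₁ v) + x ∎
  switchEnds-+ x θ₀ θ₁ loose = ≈-refl

  switchEnds-step : ∀ E d x θ {u s w} → stepFrom E d ≡ just (u , s , w) →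
                    s ⊙ switchEnds x θ E ≈ (θ u + s ⊙ x) + - (edgeSign E ⊙ θ w)
  switchEnds-step (two v s w t) fwd x θ refl = begin
    s ⊙ ((s ⊙ θ v + x) + t ⊙ θ w)
      ≈⟨ ≈-trans (⊙-distrib-+ s _ _) (+-congʳ (⊙-distrib-+ s _ _)) ⟩
    (s ⊙ s ⊙ θ v + s ⊙ x) + s ⊙ t ⊙ θ w
      ≈⟨ +-cong (+-congʳ (⊙-involutive s (θ v))) (⊙-⊙ s t (θ w)) ⟩
    (θ v + s ⊙ x) + (s *ₛ t) ⊙ θ w
      ≈⟨ +-congˡ (≈-trans (-‿cong (⊙-opposite (s *ₛ t) (θ w))) (-‿involutive _)) ⟨
    (θ v + s ⊙ x) + - (opposite (s *ₛ t) ⊙ θ w) ∎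
  switchEnds-step (two v s w t) bwd x θ refl = begin
    t ⊙ ((s ⊙ θ v + x) + t ⊙ θ w)
      ≈⟨ ≈-trans (⊙-distrib-+ t _ _) (+-congʳ (⊙-distrib-+ t _ _)) ⟩
    (t ⊙ s ⊙ θ v + t ⊙ x) + t ⊙ t ⊙ θ w
      ≈⟨ +-cong (+-congʳ (≈-trans (⊙-⊙ t s (θ v)) (≈-reflexive (cong (_⊙ θ v) (Sign.*-comm t s)))))
                (⊙-involutive t (θ w)) ⟩
    ((s *ₛ t) ⊙ θ v + t ⊙ x) + θ w
      ≈⟨ solve 3 (λ A B C → ((A ⊕ B) ⊕ C) ⊜ ((C ⊕ B) ⊕ A)) ≈-refl _ _ _ ⟩
    (θ w + t ⊙ x) + (s *ₛ t) ⊙ θ v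
      ≈⟨ +-congˡ (≈-trans (-‿cong (⊙-opposite (s *ₛ t) (θ v))) (-‿involutive _)) ⟨
    (θ w + t ⊙ x) + - (opposite (s *ₛ t) ⊙ θ v) ∎

  gain-switch : ∀ ψ θ {u W z} → IsWalk u W z → gain (switch ψ θ) W ≈ (gain ψ W + - θ u) + walkSign W ⊙ θ z
  gain-switch ψ θ {u} {[]} refl = ≈-sym (≈-trans (+-congʳ (+-identityˡ _)) (-‿inverseˡ (θ u)))
  gain-switch ψ θ {u} {(e , d) ∷ R} {z} (s , w , eq , p) rewrite τdep-step eq = begin
    - (s ⊙ switch ψ θ e) + σ e ⊙ gain (switch ψ θ) R
      ≈⟨ +-cong (-‿cong (switchEnds-step (ends e) d (ψ e) θ eq)) (⊙-cong (σ e) (gain-switch ψ θ p)) ⟩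
    - ((θ u + s ⊙ ψ e) + - (σ e ⊙ θ w)) + σ e ⊙ ((gain ψ R + - θ w) + walkSign R ⊙ θ z)
      ≈⟨ +-cong (≈-trans (≈-sym (-‿+-comm _ _)) (+-cong (≈-sym (-‿+-comm _ _)) (-‿involutive _)))
                (≈-trans (⊙-distrib-+ (σ e) _ _)
                         (+-cong (≈-trans (⊙-distrib-+ (σ e) _ _) (+-congˡ (⊙-‿comm (σ e) (θ w))))
                                 (⊙-⊙ (σ e) _ _))) ⟩
    ((- θ u + - (s ⊙ ψ e)) + σ e ⊙ θ w) + ((σ e ⊙ gain ψ R + - (σ e ⊙ θ w)) + (σ e *ₛ walkSign R) ⊙ θ z)
      ≈⟨ cancel _ _ _ _ _ _ (-‿inverseʳ _) ⟩
    ((- (s ⊙ ψ e) + σ e ⊙ gain ψ R) + - θ u) + (σ e *ₛ walkSign R) ⊙ θ z ∎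
    where
      cancel : ∀ T A C C' B Z → C + C' ≈ 0# → ((T + A) + C) + ((B + C') + Z) ≈ ((A + B) + T) + Z
      cancel T A C C' B Z C+C'≈0 = begin
        ((T + A) + C) + ((B + C') + Z)
          ≈⟨ solve 6 (λ T A C C' B Z → (((T ⊕ A) ⊕ C) ⊕ ((B ⊕ C') ⊕ Z)) ⊜ ((((A ⊕ B) ⊕ T) ⊕ Z) ⊕ (C ⊕ C')))
                     ≈-refl T A C C' B Z ⟩
        (((A + B) + T) + Z) + (C + C')
          ≈⟨ +-congˡ C+C'≈0 ⟩
        (((A + B) + T) + Z) + 0#
          ≈⟨ +-identityʳ _ ⟩
        ((A + B) + T) + Z ∎

  gain-switch-closed : ∀ ψ θ {u W} → IsWalk u W u → walkSign W ≡ pos → gain (switch ψ θ) W ≈ gain ψ W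
  gain-switch-closed ψ θ {u} {W} walk positive = begin
    gain (switch ψ θ) W                    ≈⟨ gain-switch ψ θ walk ⟩
    (gain ψ W + - θ u) + walkSign W ⊙ θ u  ≡⟨ cong (λ s → (gain ψ W + - θ u) + s ⊙ θ u) positive ⟩
    (gain ψ W + - θ u) + θ u               ≈⟨ +-assoc _ _ _ ⟩
    gain ψ W + (- θ u + θ u)               ≈⟨ +-congˡ (-‿inverseˡ _) ⟩
    gain ψ W + 0#                          ≈⟨ +-identityʳ _ ⟩
    gain ψ W                               ∎

  halfτ≡halfτ-of : ∀ e → halfτ e ≡ halfτ-of (ends e)
  halfτ≡halfτ-of e with ends e
  ... | two _ _ _ _ = refl
  ... | half _ _    = refl
  ... | loose       = refl

  ultragain : (Fin m → Carrier) → Fin m → Steps → Fin m → Carrier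
  ultragain ψ e₀ W e₁ = halfτ-of (ends e₀) ⊙ ψ e₀ + (gain ψ W + - (halfτ-of (ends e₁) ⊙ walkSign W ⊙ ψ e₁))

  ultraGain≈ultragain : ∀ e₀ W e₁ → ultraGain (just e₀) W (just e₁) ≈ ultragain φ e₀ W e₁
  ultraGain≈ultragain e₀ W e₁ rewrite halfτ≡halfτ-of e₀ | halfτ≡halfτ-of e₁ =
    +-cong (⟦⟧*≈⊙ (halfτ-of (ends e₀)) (φ e₀)) (+-cong (walkGain≈gain W) (-‿cong (begin
      (φ e₁ * ⟦ walkSign W ⟧) * ⟦ halfτ-of (ends e₁) ⟧  ≈⟨ *-comm _ _ ⟩
      ⟦ halfτ-of (ends e₁) ⟧ * (φ e₁ * ⟦ walkSign W ⟧)  ≈⟨ ⟦⟧*≈⊙ (halfτ-of (ends e₁)) _ ⟩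
      halfτ-of (ends e₁) ⊙ (φ e₁ * ⟦ walkSign W ⟧)
        ≈⟨ ⊙-cong (halfτ-of (ends e₁)) (≈-trans (*-comm (φ e₁) _) (⟦⟧*≈⊙ (walkSign W) (φ e₁))) ⟩
      halfτ-of (ends e₁) ⊙ walkSign W ⊙ φ e₁            ∎)))

  ultragain-switch : ∀ ψ θ {e₀ e₁ u W z r₀ r₁} → ends e₀ ≡ half u r₀ → ends e₁ ≡ half z r₁ → IsWalk u W z →
                     ultragain (switch ψ θ) e₀ W e₁ ≈ ultragain ψ e₀ W e₁
  ultragain-switch ψ θ {e₀} {e₁} {u} {W} {z} {r₀} {r₁} h₀ h₁ walk = begin
    halfτ-of (ends e₀) ⊙ switchEnds (ψ e₀) θ (ends e₀)
      + (gain (switch ψ θ) W + - (halfτ-of (ends e₁) ⊙ walkSign W ⊙ switchEnds (ψ e₁) θ (ends e₁)))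
      ≡⟨ cong₂ (λ E₀ E₁ → halfτ-of E₀ ⊙ switchEnds (ψ e₀) θ E₀
                            + (gain (switch ψ θ) W + - (halfτ-of E₁ ⊙ walkSign W ⊙ switchEnds (ψ e₁) θ E₁))) h₀ h₁ ⟩
    r₀ ⊙ (r₀ ⊙ θ u + ψ e₀) + (gain (switch ψ θ) W + - (r₁ ⊙ walkSign W ⊙ (r₁ ⊙ θ z + ψ e₁)))
      ≈⟨ +-cong (≈-trans (⊙-distrib-+ r₀ _ _) (+-congʳ (⊙-involutive r₀ _)))
                (+-cong (gain-switch ψ θ walk) (-‿cong end)) ⟩
    (θ u + r₀ ⊙ ψ e₀) + (((gain ψ W + - θ u) + walkSign W ⊙ θ z) + - (walkSign W ⊙ θ z + r₁ ⊙ walkSign W ⊙ ψ e₁))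
      ≈⟨ +-congˡ (+-congˡ (≈-sym (-‿+-comm _ _))) ⟩
    (θ u + r₀ ⊙ ψ e₀) + (((gain ψ W + - θ u) + walkSign W ⊙ θ z) + (- (walkSign W ⊙ θ z) + - (r₁ ⊙ walkSign W ⊙ ψ e₁)))
      ≈⟨ cancel _ _ _ _ _ _ _ (-‿inverseʳ _) (-‿inverseʳ _) ⟩
    r₀ ⊙ ψ e₀ + (gain ψ W + - (r₁ ⊙ walkSign W ⊙ ψ e₁))
      ≡⟨ cong₂ (λ E₀ E₁ → halfτ-of E₀ ⊙ ψ e₀ + (gain ψ W + - (halfτ-of E₁ ⊙ walkSign W ⊙ ψ e₁)))
               (≡.sym h₀) (≡.sym h₁) ⟩
    ultragain ψ e₀ W e₁ ∎
    where
      end : r₁ ⊙ walkSign W ⊙ (r₁ ⊙ θ z + ψ e₁) ≈ walkSign W ⊙ θ z + r₁ ⊙ walkSign W ⊙ ψ e₁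
      end = begin
        r₁ ⊙ walkSign W ⊙ (r₁ ⊙ θ z + ψ e₁)
          ≈⟨ ⊙-cong r₁ (⊙-distrib-+ (walkSign W) (r₁ ⊙ θ z) (ψ e₁)) ⟩
        r₁ ⊙ (walkSign W ⊙ r₁ ⊙ θ z + walkSign W ⊙ ψ e₁)
          ≈⟨ ⊙-distrib-+ r₁ _ _ ⟩
        r₁ ⊙ walkSign W ⊙ r₁ ⊙ θ z + r₁ ⊙ walkSign W ⊙ ψ e₁
          ≈⟨ +-congʳ (≈-trans (⊙-⊙ r₁ (walkSign W) _) (≈-trans (⊙-⊙ (r₁ *ₛ walkSign W) r₁ (θ z))
                       (≈-reflexive (cong (_⊙ θ z) ([a*b]*a≡b r₁ (walkSign W)))))) ⟩
        walkSign W ⊙ θ z + r₁ ⊙ walkSign W ⊙ ψ e₁ ∎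
      cancel : ∀ T A g T' Z Z' B → T + T' ≈ 0# → Z + Z' ≈ 0# → (T + A) + (((g + T') + Z) + (Z' + B)) ≈ A + (g + B)
      cancel T A g T' Z Z' B T+T'≈0 Z+Z'≈0 = begin
        (T + A) + (((g + T') + Z) + (Z' + B))
          ≈⟨ solve 7 (λ T A g T' Z Z' B → ((T ⊕ A) ⊕ (((g ⊕ T') ⊕ Z) ⊕ (Z' ⊕ B))) ⊜ ((A ⊕ (g ⊕ B)) ⊕ ((T ⊕ T') ⊕ (Z ⊕ Z'))))
                     ≈-refl T A g T' Z Z' B ⟩
        (A + (g + B)) + ((T + T') + (Z + Z'))
          ≈⟨ +-congˡ (≈-trans (+-cong T+T'≈0 Z+Z'≈0) (+-identityˡ 0#)) ⟩
        (A + (g + B)) + 0#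
          ≈⟨ +-identityʳ _ ⟩
        A + (g + B) ∎

  cuffgain : (Fin m → Carrier) → ∀ {a₁ a₂} → NegFig a₁ → Steps → NegFig a₂ → Carrier
  cuffgain ψ (circF W₁ _ _) P (circF W₂ _ _) = gain ψ (W₁ ++ (P ++ (W₂ ++ revSteps P)))
  cuffgain ψ (halfF e₁ _)   P (circF W₂ _ _) = ultragain ψ e₁ (P ++ (W₂ ++ revSteps P)) e₁
  cuffgain ψ (circF W₁ _ _) P (halfF e₂ _)   = ultragain ψ e₂ (revSteps P ++ (W₁ ++ P)) e₂
  cuffgain ψ (halfF e₁ _)   P (halfF e₂ _)   = ultragain ψ e₁ P e₂

  handcuffGain≈cuffgain : ∀ {a₁ a₂} (F₁ : NegFig a₁) P (F₂ : NegFig a₂) → handcuffGain F₁ P F₂ ≈ cuffgain φ F₁ P F₂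
  handcuffGain≈cuffgain (circF W₁ _ _) P (circF W₂ _ _) = walkGain≈gain (W₁ ++ (P ++ (W₂ ++ revSteps P)))
  handcuffGain≈cuffgain (halfF e₁ _)   P (circF W₂ _ _) = ultraGain≈ultragain e₁ (P ++ (W₂ ++ revSteps P)) e₁
  handcuffGain≈cuffgain (circF W₁ _ _) P (halfF e₂ _)   = ultraGain≈ultragain e₂ (revSteps P ++ (W₁ ++ P)) e₂
  handcuffGain≈cuffgain (halfF e₁ _)   P (halfF e₂ _)   = ultraGain≈ultragain e₁ P e₂

  cuffgain-switch : ∀ ψ θ {a₁ a₂} (F₁ : NegFig a₁) P (F₂ : NegFig a₂) → IsPath a₁ P a₂ →
                    cuffgain (switch ψ θ) F₁ P F₂ ≈ cuffgain ψ F₁ P F₂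
  cuffgain-switch ψ θ (circF W₁ c₁ s₁) P (circF W₂ c₂ s₂) (path , _) =
    gain-switch-closed ψ θ (walk-++ (proj₁ c₁) (walk-++ path (walk-++ (proj₁ c₂) (walk-rev path)))) positive
    where
      positive : walkSign (W₁ ++ (P ++ (W₂ ++ revSteps P))) ≡ pos
      positive rewrite walkSign-++ W₁ (P ++ (W₂ ++ revSteps P)) | walkSign-++ P (W₂ ++ revSteps P)
        | walkSign-++ W₂ (revSteps P) | walkSign-rev P | s₁ | s₂ = cancelled (walkSign P)
        where cancelled : ∀ p → neg *ₛ (p *ₛ (neg *ₛ p)) ≡ pos
              cancelled = signIdentity 1
  cuffgain-switch ψ θ (halfF e₁ (r₁ , h₁)) P (circF W₂ c₂ s₂) (path , _) =
    ultragain-switch ψ θ h₁ h₁ (walk-++ path (walk-++ (proj₁ c₂) (walk-rev path)))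
  cuffgain-switch ψ θ (circF W₁ c₁ s₁) P (halfF e₂ (r₂ , h₂)) (path , _) =
    ultragain-switch ψ θ h₂ h₂ (walk-++ (walk-rev path) (walk-++ (proj₁ c₁) path))
  cuffgain-switch ψ θ (halfF e₁ (r₁ , h₁)) P (halfF e₂ (r₂ , h₂)) (path , _) = ultragain-switch ψ θ h₁ h₂ path

  gain-zero : ∀ ψ → (∀ e → ψ e ≈ 0#) → ∀ W → gain ψ W ≈ 0#
  gain-zero ψ ψ≈0 []            = ≈-refl
  gain-zero ψ ψ≈0 ((e , d) ∷ W) =
    ≈-trans (+-cong (‿≈0 (≈0⇒⊙≈0 (τdep e d) (ψ≈0 e))) (≈0⇒⊙≈0 (σ e) (gain-zero ψ ψ≈0 W))) (+-identityˡ 0#)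

  ultragain-zero : ∀ ψ → (∀ e → ψ e ≈ 0#) → ∀ e₀ W e₁ → ultragain ψ e₀ W e₁ ≈ 0#
  ultragain-zero ψ ψ≈0 e₀ W e₁ =
    ≈-trans (+-cong (≈0⇒⊙≈0 (halfτ-of (ends e₀)) (ψ≈0 e₀))
                    (≈-trans (+-cong (gain-zero ψ ψ≈0 W) (‿≈0 (≈0⇒⊙≈0 (halfτ-of (ends e₁)) (≈0⇒⊙≈0 (walkSign W) (ψ≈0 e₁)))))
                             (+-identityˡ 0#)))
            (+-identityˡ 0#)

  cuffgain-zero : ∀ ψ → (∀ e → ψ e ≈ 0#) → ∀ {a₁ a₂} (F₁ : NegFig a₁) P (F₂ : NegFig a₂) → cuffgain ψ F₁ P F₂ ≈ 0#
  cuffgain-zero ψ ψ≈0 (circF W₁ _ _) P (circF W₂ _ _) = gain-zero ψ ψ≈0 (W₁ ++ (P ++ (W₂ ++ revSteps P)))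
  cuffgain-zero ψ ψ≈0 (halfF e₁ _)   P (circF W₂ _ _) = ultragain-zero ψ ψ≈0 e₁ (P ++ (W₂ ++ revSteps P)) e₁
  cuffgain-zero ψ ψ≈0 (circF W₁ _ _) P (halfF e₂ _)   = ultragain-zero ψ ψ≈0 e₂ (revSteps P ++ (W₁ ++ P)) e₂
  cuffgain-zero ψ ψ≈0 (halfF e₁ _)   P (halfF e₂ _)   = ultragain-zero ψ ψ≈0 e₁ P e₂

  CircuitsNeutral : (Fin m → Carrier) → Set ℓ
  CircuitsNeutral ψ =
    (∀ e → ends e ≡ loose → ψ e ≈ 0#) ×
    (∀ u W → IsCircle u W → walkSign W ≡ pos → gain ψ W ≈ 0#) ×
    (∀ a₁ a₂ (F₁ : NegFig a₁) P (F₂ : NegFig a₂) → IsHandcuff F₁ P F₂ → cuffgain ψ F₁ P F₂ ≈ 0#)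

  hyperbalanced⇔neutral : Hyperbalanced ⇔ CircuitsNeutral φ
  hyperbalanced⇔neutral = mk⇔
    (λ (loose0 , circle0 , cuff0) →
       loose0 ,
       (λ u W c p → ≈-trans (≈-sym (walkGain≈gain W)) (circle0 u W c p)) ,
       (λ a₁ a₂ F₁ P F₂ h → ≈-trans (≈-sym (handcuffGain≈cuffgain F₁ P F₂)) (cuff0 a₁ a₂ F₁ P F₂ h)))
    (λ (loose0 , circle0 , cuff0) →
       loose0 ,
       (λ u W c p → ≈-trans (walkGain≈gain W) (circle0 u W c p)) ,
       (λ a₁ a₂ F₁ P F₂ h → ≈-trans (handcuffGain≈cuffgain F₁ P F₂) (cuff0 a₁ a₂ F₁ P F₂ h)))

  neutral⇔neutral-switch : ∀ ψ θ → CircuitsNeutral ψ ⇔ CircuitsNeutral (switch ψ θ)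
  neutral⇔neutral-switch ψ θ = mk⇔
    (λ (loose0 , circle0 , cuff0) →
       (λ e l → ≡.subst (λ E → switchEnds (ψ e) θ E ≈ 0#) (≡.sym l) (loose0 e l)) ,
       (λ u W c p → ≈-trans (gain-switch-closed ψ θ (proj₁ c) p) (circle0 u W c p)) ,
       (λ a₁ a₂ F₁ P F₂ h → ≈-trans (cuffgain-switch ψ θ F₁ P F₂ (proj₁ h)) (cuff0 a₁ a₂ F₁ P F₂ h)))
    (λ (loose0 , circle0 , cuff0) →
       (λ e l → ≡.subst (λ E → switchEnds (ψ e) θ E ≈ 0#) l (loose0 e l)) ,
       (λ u W c p → ≈-trans (≈-sym (gain-switch-closed ψ θ (proj₁ c) p)) (circle0 u W c p)) ,
       (λ a₁ a₂ F₁ P F₂ h → ≈-trans (≈-sym (cuffgain-switch ψ θ F₁ P F₂ (proj₁ h))) (cuff0 a₁ a₂ F₁ P F₂ h)))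

  zero⇒neutral : ∀ ψ → (∀ e → ψ e ≈ 0#) → CircuitsNeutral ψ
  zero⇒neutral ψ ψ≈0 = (λ e _ → ψ≈0 e) , (λ _ W _ _ → gain-zero ψ ψ≈0 W) ,
                        (λ _ _ F₁ P F₂ _ → cuffgain-zero ψ ψ≈0 F₁ P F₂)

-- Contracting a link

module Contraction {c ℓ} (K : Field c ℓ) {n m : ℕ} (ends : Fin m → Ends n) (φ ψ : Fin m → Field.Carrier K)
                   (f : Fin m) (v w : Fin n) (s t : Sign) (hf : ends f ≡ two v s w t) (v≢w : v ≢ w)
                   (ψf≈0 : Field._≈_ K (ψ f) (Field.0# K))
                   (neutral : Walks.CircuitsNeutral K ends φ ψ) where
  open Field K renaming (refl to ≈-refl; sym to ≈-sym; trans to ≈-trans; reflexive to ≈-reflexive)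
  open SignAction ring
  open SetoidReasoning setoid
  open RingProperties ring using (-0#≈0#; -‿involutive; -‿+-comm)

  module G = Walks K ends φ

  loose≈0 : ∀ e → ends e ≡ loose → ψ e ≈ 0#
  loose≈0 = proj₁ neutral

  positive-circle≈0 : ∀ u W → G.IsCircle u W → G.walkSign W ≡ pos → G.gain ψ W ≈ 0#
  positive-circle≈0 = proj₁ (proj₂ neutral)

  handcuff≈0 : ∀ a₁ a₂ (F₁ : G.NegFig a₁) P (F₂ : G.NegFig a₂) → G.IsHandcuff F₁ P F₂ → G.cuffgain ψ F₁ P F₂ ≈ 0#
  handcuff≈0 = proj₂ (proj₂ neutral)

  -- Contracting f re-attaches the ends at v to w, with τ multiplied by ε = σ(f), and makes f loose;
  -- v stays a (now isolated) vertex.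
  ε : Sign
  ε = opposite (s *ₛ t)

  merge : Fin n → Fin n
  merge x with x ≟ v
  ... | yes _ = w
  ... | no _ = x

  twist : Fin n → Sign
  twist x with x ≟ v
  ... | yes _ = ε
  ... | no _ = pos

  merge-v : merge v ≡ w
  merge-v with v ≟ v
  ... | yes _ = refl
  ... | no ne = ⊥-elim (ne refl)

  merge-≢v : ∀ {x} → x ≢ v → merge x ≡ x
  merge-≢v {x} ne with x ≟ v
  ... | yes e = ⊥-elim (ne e)
  ... | no _ = refl

  twist-v : twist v ≡ ε
  twist-v with v ≟ v
  ... | yes _ = refl
  ... | no ne = ⊥-elim (ne refl)

  twist-≢v : ∀ {x} → x ≢ v → twist x ≡ pos
  twist-≢v {x} ne with x ≟ v
  ... | yes e = ⊥-elim (ne e)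
  ... | no _ = refl

  w≢v : w ≢ v
  w≢v e = v≢w (≡.sym e)

  merge-w : merge w ≡ w
  merge-w = merge-≢v w≢v

  twist-w : twist w ≡ pos
  twist-w = twist-≢v w≢v

  merge≡w : ∀ {x} → merge x ≡ w → x ≡ v ⊎ x ≡ w
  merge≡w {x} e with x ≟ v
  ... | yes e' = inj₁ e'
  ... | no _ = inj₂ e

  merge-injective : ∀ {x y} → merge x ≡ merge y → merge x ≢ w → x ≡ y
  merge-injective {x} {y} e nw with x ≟ v | y ≟ v
  ... | yes _ | _ = ⊥-elim (nw refl)
  ... | no _ | yes _ = ⊥-elim (nw e)
  ... | no _ | no _ = e

  merge-collapse : ∀ {x y} → merge x ≡ merge y → x ≢ y → merge x ≡ w
  merge-collapse {x} {y} e ne with x ≟ v | y ≟ v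
  ... | yes _ | _ = refl
  ... | no _ | yes _ = e
  ... | no _ | no _ = ⊥-elim (ne e)

  third-over-w : ∀ {x y z} → merge x ≡ w → merge y ≡ w → merge z ≡ w → x ≢ y → z ≡ x ⊎ z ≡ y
  third-over-w {x} {y} {z} hx hy hz ne with merge≡w hx | merge≡w hy | merge≡w hz
  ... | inj₁ a | inj₁ b | _ = ⊥-elim (ne (≡.trans a (≡.sym b)))
  ... | inj₂ a | inj₂ b | _ = ⊥-elim (ne (≡.trans a (≡.sym b)))
  ... | inj₁ a | inj₂ b | inj₁ c = inj₁ (≡.trans c (≡.sym a))
  ... | inj₁ a | inj₂ b | inj₂ c = inj₂ (≡.trans c (≡.sym b))
  ... | inj₂ a | inj₁ b | inj₁ c = inj₂ (≡.trans c (≡.sym b))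
  ... | inj₂ a | inj₁ b | inj₂ c = inj₁ (≡.trans c (≡.sym a))

  reattach : Ends n → Ends n
  reattach (two x r y q) = two (merge x) (twist x *ₛ r) (merge y) (twist y *ₛ q)
  reattach (half x r) = half (merge x) (twist x *ₛ r)
  reattach loose = loose

  contracted : Fin m → Ends n
  contracted e with e ≟ f
  ... | yes _ = loose
  ... | no _ = reattach (ends e)

  contracted-f : contracted f ≡ loose
  contracted-f with f ≟ f
  ... | yes _ = refl
  ... | no ne = ⊥-elim (ne refl)

  contracted-≢f : ∀ {e} → e ≢ f → contracted e ≡ reattach (ends e)
  contracted-≢f {e} ne with e ≟ f
  ... | yes e' = ⊥-elim (ne e')
  ... | no _ = refl

  module C = Walks K contracted ψ

  reattach-step : ∀ E d {x r y} → stepFrom E d ≡ just (x , r , y) →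
            stepFrom (reattach E) d ≡ just (merge x , twist x *ₛ r , merge y)
  reattach-step (two _ _ _ _) fwd refl = refl
  reattach-step (two _ _ _ _) bwd refl = refl

  reattach-step⁻¹ : ∀ E d {u r' y'} → stepFrom (reattach E) d ≡ just (u , r' , y') →
              Σ (Fin n) λ x → Σ Sign λ r → Σ (Fin n) λ y →
                (stepFrom E d ≡ just (x , r , y)) × (merge x ≡ u) × (twist x *ₛ r ≡ r') × (merge y ≡ y')
  reattach-step⁻¹ (two a r b q) fwd refl = a , r , b , refl , refl , refl , refl
  reattach-step⁻¹ (two a r b q) bwd refl = b , q , a , refl , refl , refl , refl
  reattach-step⁻¹ (half _ _) fwd ()
  reattach-step⁻¹ (half _ _) bwd ()
  reattach-step⁻¹ loose fwd ()
  reattach-step⁻¹ loose bwd ()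

  edgeSign-reattach : ∀ E d {x r y} → stepFrom E d ≡ just (x , r , y) →
         edgeSign (reattach E) ≡ twist x *ₛ (edgeSign E *ₛ twist y)
  edgeSign-reattach (two a r b q) fwd refl = twisted (twist a) (twist b) r q
    where twisted : ∀ a b r q → opposite ((a *ₛ r) *ₛ (b *ₛ q)) ≡ a *ₛ (opposite (r *ₛ q) *ₛ b)
          twisted = signIdentity 4
  edgeSign-reattach (two a r b q) bwd refl = twisted (twist a) (twist b) r q
    where twisted : ∀ a b r q → opposite ((a *ₛ r) *ₛ (b *ₛ q)) ≡ b *ₛ (opposite (r *ₛ q) *ₛ a)
          twisted = signIdentity 4

  contracted-step⇒≢f : ∀ {e d u r y} → stepFrom (contracted e) d ≡ just (u , r , y) → e ≢ f
  contracted-step⇒≢f {e} {fwd} eq refl rewrite contracted-f with eq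
  ... | ()
  contracted-step⇒≢f {e} {bwd} eq refl rewrite contracted-f with eq
  ... | ()

  contracted-step⁻¹ : ∀ {g d u r' y'} → stepFrom (contracted g) d ≡ just (u , r' , y') →
           (g ≢ f) × (Σ (Fin n) λ x → Σ Sign λ r → Σ (Fin n) λ y →
             (stepFrom (ends g) d ≡ just (x , r , y)) × (merge x ≡ u) × (twist x *ₛ r ≡ r') × (merge y ≡ y'))
  contracted-step⁻¹ {g} {d} eq = ne , reattach-step⁻¹ (ends g) d (≡.trans (≡.sym (cong (λ E → stepFrom E d) (contracted-≢f ne))) eq)
    where ne = contracted-step⇒≢f eq

  contracted-step : ∀ {g d xs r y} → g ≢ f → stepFrom (ends g) d ≡ just (xs , r , y) →
             stepFrom (contracted g) d ≡ just (merge xs , twist xs *ₛ r , merge y)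
  contracted-step {g} {d} ne eq = ≡.trans (cong (λ E → stepFrom E d) (contracted-≢f ne)) (reattach-step (ends g) d eq)

  departure : Fin m → Dir → Fin n → Fin n
  departure g d x with stepFrom (ends g) d
  ... | just (a , _ , _) = a
  ... | nothing = x

  departure-step : ∀ {g d x a r b} → stepFrom (ends g) d ≡ just (a , r , b) → departure g d x ≡ a
  departure-step {g} {d} eq rewrite eq = refl

  bridge : Fin n → Fin n → G.Steps
  bridge x y with x ≟ y
  ... | yes _ = []
  ... | no _ with x ≟ v
  ...   | yes _ = [ (f , fwd) ]
  ...   | no _ = [ (f , bwd) ]

  bridge-refl : ∀ x → bridge x x ≡ []
  bridge-refl x with x ≟ x
  ... | yes _ = refl
  ... | no ne = ⊥-elim (ne refl)

  data BridgeView (x y : Fin n) : G.Steps → Set where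
    bv-same : x ≡ y → BridgeView x y []
    bv-fwd : x ≡ v → y ≡ w → BridgeView x y [ (f , fwd) ]
    bv-bwd : x ≡ w → y ≡ v → BridgeView x y [ (f , bwd) ]

  bridgeView : ∀ {x y} → merge x ≡ merge y → BridgeView x y (bridge x y)
  bridgeView {x} {y} h with x ≟ y
  ... | yes e = bv-same e
  ... | no ne with x ≟ v
  ...   | yes xv = bv-fwd xv (yw (merge≡w (≡.sym h)))
    where yw : y ≡ v ⊎ y ≡ w → y ≡ w
          yw (inj₁ yv) = ⊥-elim (ne (≡.trans xv (≡.sym yv)))
          yw (inj₂ e) = e
  ...   | no xnv = bv-bwd xw (yv (merge≡w (≡.trans (≡.sym h) xw)))
    where xw : x ≡ w
          xw = ≡.trans (≡.sym (merge-≢v xnv)) (merge-collapse (≡.trans (merge-≢v xnv) h) ne)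
          yv : y ≡ v ⊎ y ≡ w → y ≡ v
          yv (inj₁ e) = e
          yv (inj₂ yw) = ⊥-elim (ne (≡.trans xw (≡.sym yw)))

  f-forward : G.IsWalk v [ (f , fwd) ] w
  f-forward = s , w , cong (λ E → stepFrom E fwd) hf , refl

  f-backward : G.IsWalk w [ (f , bwd) ] v
  f-backward = t , v , cong (λ E → stepFrom E bwd) hf , refl

  bridge-walk : ∀ {x y} → merge x ≡ merge y → G.IsWalk x (bridge x y) y
  bridge-walk {x} {y} h with bridge x y | bridgeView {x} {y} h
  ... | _ | bv-same refl = refl
  ... | _ | bv-fwd refl refl = f-forward
  ... | _ | bv-bwd refl refl = f-backward

  edgeSign-f : G.σ f ≡ ε
  edgeSign-f rewrite hf = refl

  bridge-sign : ∀ {x y} → merge x ≡ merge y → G.walkSign (bridge x y) ≡ twist x *ₛ twist y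
  bridge-sign {x} {y} h with bridge x y | bridgeView {x} {y} h
  ... | _ | bv-same refl = ≡.sym (Sign.s*s≡+ (twist x))
  ... | _ | bv-fwd refl refl rewrite edgeSign-f | twist-v | twist-w = refl
  ... | _ | bv-bwd refl refl rewrite edgeSign-f | twist-v | twist-w = Sign.*-identityʳ ε

  bridge-gain : ∀ {x y} → merge x ≡ merge y → G.gain ψ (bridge x y) ≈ 0#
  bridge-gain {x} {y} h with bridge x y | bridgeView {x} {y} h
  ... | _ | bv-same refl = ≈-refl
  ... | _ | bv-fwd refl refl = ≈-trans (+-cong (≈-trans (-‿cong (≈0⇒⊙≈0 (G.τdep f fwd) ψf≈0)) -0#≈0#) (⊙-zero (G.σ f))) (+-identityˡ 0#)
  ... | _ | bv-bwd refl refl = ≈-trans (+-cong (≈-trans (-‿cong (≈0⇒⊙≈0 (G.τdep f bwd) ψf≈0)) -0#≈0#) (⊙-zero (G.σ f))) (+-identityˡ 0#)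

  bridge-vertices : ∀ {x y} → merge x ≡ merge y → (x ≡ y × G.vsTail x (bridge x y) ≡ []) ⊎ (x ≢ y × G.vsTail x (bridge x y) ≡ [ y ])
  bridge-vertices {x} {y} h with bridge x y | bridgeView {x} {y} h
  ... | _ | bv-same e = inj₁ (e , refl)
  ... | _ | bv-fwd refl refl = inj₂ (v≢w , cong [_] (G.next-step {v} (cong (λ E → stepFrom E fwd) hf)))
  ... | _ | bv-bwd refl refl = inj₂ (w≢v , cong [_] (G.next-step {w} (cong (λ E → stepFrom E bwd) hf)))

  bridge-end : ∀ {x y} → merge x ≡ merge y → G.walkEnd x (bridge x y) ≡ y
  bridge-end {x} {y} h = G.walk-end {x} {bridge x y} {y} (bridge-walk h)

  bridge-edges : ∀ {x y e} → e ∈ G.edgesOf (bridge x y) → (e ≡ f) × (x ≢ y)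
  bridge-edges {x} {y} i with x ≟ y
  bridge-edges {x} {y} () | yes _
  ... | no ne with x ≟ v
  bridge-edges {x} {y} (here refl) | no ne | yes _ = refl , ne
  bridge-edges {x} {y} (here refl) | no ne | no _ = refl , ne

  -- The vertex list of a lift: each vertex of the contracted walk is replaced by one or two of its preimages.
  data Expands : List (Fin n) → List (Fin n) → Set where
    exp[] : Expands [] []
    exp1 : ∀ {x xs y ys} → merge x ≡ y → Expands xs ys → Expands (x ∷ xs) (y ∷ ys)
    exp2 : ∀ {x x' xs y ys} → merge x ≡ y → merge x' ≡ y → x ≢ x' → Expands xs ys → Expands (x ∷ x' ∷ xs) (y ∷ ys)

  Expands-∈ : ∀ {xs ys z} → Expands xs ys → z ∈ xs → merge z ∈ ys
  Expands-∈ (exp1 h E) (here refl) = here h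
  Expands-∈ (exp1 h E) (there i) = there (Expands-∈ E i)
  Expands-∈ (exp2 h h' ne E) (here refl) = here h
  Expands-∈ (exp2 h h' ne E) (there (here refl)) = here h'
  Expands-∈ (exp2 h h' ne E) (there (there i)) = there (Expands-∈ E i)

  Expands-unique : ∀ {xs ys} → Expands xs ys → Unique ys → Unique xs
  Expands-unique exp[] u = []
  Expands-unique (exp1 {x} h E) u = Unique-∷ (λ i → Unique[x∷xs]⇒x∉xs u (≡.subst (_∈ _) h (Expands-∈ E i))) (Expands-unique E (Unique-tail u))
  Expands-unique (exp2 {x} {x'} h h' ne E) u =
    Unique-∷ (λ { (here e) → ne e ; (there i) → Unique[x∷xs]⇒x∉xs u (≡.subst (_∈ _) h (Expands-∈ E i)) })
      (Unique-∷ (λ i → Unique[x∷xs]⇒x∉xs u (≡.subst (_∈ _) h' (Expands-∈ E i))) (Expands-unique E (Unique-tail u)))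

  -- A walk of the contraction lifts to G by inserting a step along f wherever consecutive ends are v and w.
  lift : Fin n → G.Steps → Fin n → G.Steps
  lift x [] x' = bridge x x'
  lift x ((g , d) ∷ R) x' = bridge x (departure g d x) ++ ((g , d) ∷ lift (G.next x g d) R x')

  liftStart : Fin n → G.Steps → Fin n
  liftStart x [] = x
  liftStart x ((g , d) ∷ _) = departure g d x

  liftEnd : Fin n → G.Steps → Fin n
  liftEnd x [] = x
  liftEnd x ((g , d) ∷ R) = liftEnd (G.next x g d) R

  interior : Fin n → G.Steps → List (Fin n)
  interior u [] = []
  interior u (_ ∷ []) = []
  interior u ((g , d) ∷ R@(_ ∷ _)) = C.next u g d ∷ interior (C.next u g d) R

  vsTail≡interior∷ʳend : ∀ u g d R → C.vsTail u ((g , d) ∷ R) ≡ interior u ((g , d) ∷ R) ++ [ C.walkEnd u ((g , d) ∷ R) ]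
  vsTail≡interior∷ʳend u g d [] = refl
  vsTail≡interior∷ʳend u g d ((g2 , d2) ∷ R) = cong (C.next u g d ∷_) (vsTail≡interior∷ʳend (C.next u g d) g2 d2 R)

  lift-∷ : ∀ {g d xs r y} x R x' → stepFrom (ends g) d ≡ just (xs , r , y) →
               lift x ((g , d) ∷ R) x' ≡ bridge x xs ++ ((g , d) ∷ lift y R x')
  lift-∷ {g} {d} x R x' eq = cong₂ (λ a b → bridge x a ++ ((g , d) ∷ lift b R x')) (departure-step {x = x} eq) (G.next-step {x} eq)

  lift-walk : ∀ W' {u z'} → C.IsWalk u W' z' → ∀ {x x'} → merge x ≡ u → merge x' ≡ z' → G.IsWalk x (lift x W' x') x'
  lift-walk [] refl hx hx' = bridge-walk (≡.trans hx (≡.sym hx'))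
  lift-walk ((g , d) ∷ R) (r' , y' , step' , walk') {x} {x'} hx hx' with contracted-step⁻¹ step'
  ... | ne , xs , r , y , step , hxs , hr , hy =
    ≡.subst (λ L → G.IsWalk x L x') (≡.sym (lift-∷ x R x' step))
      (G.walk-++ (bridge-walk (≡.trans hx (≡.sym hxs))) (r , y , step , lift-walk R walk' hy hx'))

  merge-liftStart : ∀ W' {u z'} → C.IsWalk u W' z' → ∀ {x} → merge x ≡ u → merge (liftStart x W') ≡ u
  merge-liftStart [] walk hx = hx
  merge-liftStart ((g , d) ∷ R) (r' , y' , step' , walk') {x} hx with contracted-step⁻¹ step'
  ... | ne , xs , r , y , step , hxs , hr , hy = ≡.trans (cong merge (departure-step {x = x} step)) hxs

  merge-liftEnd : ∀ W' {u z'} → C.IsWalk u W' z' → ∀ {x} → merge x ≡ u → merge (liftEnd x W') ≡ z'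
  merge-liftEnd [] refl hx = hx
  merge-liftEnd ((g , d) ∷ R) (r' , y' , step' , walk') {x} hx with contracted-step⁻¹ step'
  ... | ne , xs , r , y , step , hxs , hr , hy = ≡.subst (λ q → merge (liftEnd q R) ≡ _) (≡.sym (G.next-step {x} step)) (merge-liftEnd R walk' hy)

  lift-expands : ∀ W' {u z'} → C.IsWalk u W' z' → ∀ {x x'} → merge x ≡ u → merge x' ≡ z' →
             Expands (x ∷ G.vsTail x (lift x W' x')) (u ∷ C.vsTail u W')
  lift-expands [] refl {x} {x'} hx hx' with bridge-vertices {x} {x'} (≡.trans hx (≡.sym hx'))
  ... | inj₁ (_ , e) rewrite e = exp1 hx exp[]
  ... | inj₂ (ne , e) rewrite e = exp2 hx hx' ne exp[]
  lift-expands ((g , d) ∷ R) {u} (r' , y' , step' , walk') {x} {x'} hx hx' with contracted-step⁻¹ step'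
  ... | ne , xs , r , y , step , hxs , hr , hy =
    ≡.subst (λ L → Expands (x ∷ G.vsTail x L) _) (≡.sym (lift-∷ x R x' step))
      (≡.subst (λ q → Expands _ (_ ∷ q ∷ C.vsTail q R)) (≡.sym (C.next-step {u} {g} {d} step')) main)
    where
      hc : merge x ≡ merge xs
      hc = ≡.trans hx (≡.sym hxs)
      vs≡ : G.vsTail x (bridge x xs ++ ((g , d) ∷ lift y R x')) ≡ G.vsTail x (bridge x xs) ++ (y ∷ G.vsTail y (lift y R x'))
      vs≡ = ≡.trans (G.vsTail-++ x (bridge x xs) ((g , d) ∷ lift y R x'))
              (≡.trans (cong (λ q → G.vsTail x (bridge x xs) ++ G.vsTail q ((g , d) ∷ lift y R x')) (bridge-end {x} {xs} hc))
                (cong (λ q → G.vsTail x (bridge x xs) ++ (q ∷ G.vsTail q (lift y R x'))) (G.next-step {xs} step)))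
      main : Expands (x ∷ G.vsTail x (bridge x xs ++ ((g , d) ∷ lift y R x'))) (u ∷ y' ∷ C.vsTail y' R)
      main rewrite vs≡ with bridge-vertices {x} {xs} hc
      ... | inj₁ (_ , e) rewrite e = exp1 hx (lift-expands R walk' hy hx')
      ... | inj₂ (ne' , e) rewrite e = exp2 hx hxs ne' (lift-expands R walk' hy hx')

  edgeSign-contracted : ∀ {g d xs r y} → g ≢ f → stepFrom (ends g) d ≡ just (xs , r , y) → C.σ g ≡ twist xs *ₛ (G.σ g *ₛ twist y)
  edgeSign-contracted {g} {d} ne eq = ≡.trans (cong edgeSign (contracted-≢f ne)) (edgeSign-reattach (ends g) d eq)

  record Lifts (x : Fin n) (L W' : G.Steps) (x' : Fin n) : Set ℓ where
    constructor lifts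
    field
      gain≈ : C.gain ψ W' ≈ twist x ⊙ G.gain ψ L
      sign≡ : C.walkSign W' ≡ twist x *ₛ (G.walkSign L *ₛ twist x')

  lifts-++ : ∀ {x L1 W1 y L2 W2 z} → Lifts x L1 W1 y → Lifts y L2 W2 z → Lifts x (L1 ++ L2) (W1 ++ W2) z
  lifts-++ {x} {L1} {W1} {y} {L2} {W2} {z} (lifts g1 s1) (lifts g2 s2) = lifts gain sign
    where
      gain : C.gain ψ (W1 ++ W2) ≈ twist x ⊙ G.gain ψ (L1 ++ L2)
      gain = begin
        C.gain ψ (W1 ++ W2) ≈⟨ C.gain-++ ψ W1 W2 ⟩
        C.gain ψ W1 + C.walkSign W1 ⊙ C.gain ψ W2
          ≈⟨ +-cong g1 (≈-trans (≈-reflexive (cong (_⊙ C.gain ψ W2) s1)) (⊙-cong (twist x *ₛ (G.walkSign L1 *ₛ twist y)) g2)) ⟩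
        twist x ⊙ G.gain ψ L1 + (twist x *ₛ (G.walkSign L1 *ₛ twist y)) ⊙ (twist y ⊙ G.gain ψ L2)
          ≈⟨ +-congˡ (≈-trans (⊙-⊙ (twist x *ₛ (G.walkSign L1 *ₛ twist y)) (twist y) (G.gain ψ L2)) (≈-trans (≈-reflexive (cong (_⊙ G.gain ψ L2) ([a*[b*c]]*c≡a*b (twist x) (G.walkSign L1) (twist y)))) (≈-sym (⊙-⊙ (twist x) (G.walkSign L1) (G.gain ψ L2))))) ⟩
        twist x ⊙ G.gain ψ L1 + twist x ⊙ (G.walkSign L1 ⊙ G.gain ψ L2)
          ≈⟨ ≈-sym (⊙-distrib-+ (twist x) (G.gain ψ L1) (G.walkSign L1 ⊙ G.gain ψ L2)) ⟩
        twist x ⊙ (G.gain ψ L1 + G.walkSign L1 ⊙ G.gain ψ L2)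
          ≈⟨ ⊙-cong (twist x) (≈-sym (G.gain-++ ψ L1 L2)) ⟩
        twist x ⊙ G.gain ψ (L1 ++ L2) ∎
      sign : C.walkSign (W1 ++ W2) ≡ twist x *ₛ (G.walkSign (L1 ++ L2) *ₛ twist z)
      sign = ≡.trans (C.walkSign-++ W1 W2) (≡.trans (cong₂ _*ₛ_ s1 s2)
               (≡.trans (regroup (twist x) (G.walkSign L1) (twist y) (G.walkSign L2) (twist z))
                 (cong (λ q → twist x *ₛ (q *ₛ twist z)) (≡.sym (G.walkSign-++ L1 L2)))))
        where regroup : ∀ a b c d e → (a *ₛ (b *ₛ c)) *ₛ (c *ₛ (d *ₛ e)) ≡ a *ₛ ((b *ₛ d) *ₛ e)
              regroup = signIdentity 5

  lifts-bridge : ∀ {x y} → merge x ≡ merge y → Lifts x (bridge x y) [] y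
  lifts-bridge {x} {y} same =
    lifts (≈-sym (≈0⇒⊙≈0 (twist x) (bridge-gain {x} {y} same)))
          (≡.trans (cancelled (twist x) (twist y)) (cong (λ q → twist x *ₛ (q *ₛ twist y)) (≡.sym (bridge-sign {x} {y} same))))
    where cancelled : ∀ a b → pos ≡ a *ₛ ((a *ₛ b) *ₛ b)
          cancelled = signIdentity 2

  lifts-step : ∀ {g d xs r y} → g ≢ f → stepFrom (ends g) d ≡ just (xs , r , y) → Lifts xs [ (g , d) ] [ (g , d) ] y
  lifts-step {g} {d} {xs} {r} {y} g≢f step = lifts gain≈ sign≡
    where
      gain≈ : C.gain ψ [ (g , d) ] ≈ twist xs ⊙ G.gain ψ [ (g , d) ]
      gain≈ = begin
        - (C.τdep g d ⊙ ψ g) + C.σ g ⊙ 0#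
          ≡⟨ cong (λ q → - (q ⊙ ψ g) + C.σ g ⊙ 0#) (C.τdep-step {g} {d} (contracted-step g≢f step)) ⟩
        - ((twist xs *ₛ r) ⊙ ψ g) + C.σ g ⊙ 0#
          ≈⟨ +-cong (-‿cong (⊙-⊙ (twist xs) r (ψ g))) (≈-trans (⊙-zero (twist xs)) (≈-sym (⊙-zero (C.σ g)))) ⟨
        - (twist xs ⊙ r ⊙ ψ g) + twist xs ⊙ 0#
          ≈⟨ +-cong (⊙-‿comm (twist xs) (r ⊙ ψ g)) (⊙-cong (twist xs) (⊙-zero (G.σ g))) ⟨
        twist xs ⊙ - (r ⊙ ψ g) + twist xs ⊙ G.σ g ⊙ 0#
          ≈⟨ ⊙-distrib-+ (twist xs) _ _ ⟨
        twist xs ⊙ (- (r ⊙ ψ g) + G.σ g ⊙ 0#)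
          ≡⟨ cong (λ q → twist xs ⊙ (- (q ⊙ ψ g) + G.σ g ⊙ 0#)) (≡.sym (G.τdep-step {g} {d} step)) ⟩
        twist xs ⊙ G.gain ψ [ (g , d) ] ∎
      sign≡ : C.σ g *ₛ pos ≡ twist xs *ₛ ((G.σ g *ₛ pos) *ₛ twist y)
      sign≡ = ≡.trans (cong (_*ₛ pos) (edgeSign-contracted g≢f step)) (regroup (twist xs) (G.σ g) (twist y))
        where regroup : ∀ a b c → (a *ₛ (b *ₛ c)) *ₛ pos ≡ a *ₛ ((b *ₛ pos) *ₛ c)
              regroup = signIdentity 3

  lift-lifts : ∀ W' {u z'} → C.IsWalk u W' z' → ∀ {x x'} → merge x ≡ u → merge x' ≡ z' → Lifts x (lift x W' x') W' x'
  lift-lifts []            refl hx hx' = lifts-bridge (≡.trans hx (≡.sym hx'))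
  lift-lifts ((g , d) ∷ R) (_ , _ , step' , walk) {x} {x'} hx hx' with contracted-step⁻¹ step'
  ... | g≢f , xs , _ , y , step , hxs , _ , hy =
    ≡.subst (λ L → Lifts x L ((g , d) ∷ R) x') (≡.sym (lift-∷ x R x' step))
      (lifts-++ (lifts-bridge (≡.trans hx (≡.sym hxs))) (lifts-++ (lifts-step g≢f step) (lift-lifts R walk hy hx')))

  lifts-rev : ∀ {x L W' x'} → G.IsWalk x L x' → C.IsWalk (merge x) W' (merge x') → Lifts x L W' x' →
           Lifts x' (G.revSteps L) (C.revSteps W') x
  lifts-rev {x} {L} {W'} {x'} walk walk' (lifts g1 s1) = lifts gain sign
    where
      gain : C.gain ψ (C.revSteps W') ≈ twist x' ⊙ G.gain ψ (G.revSteps L)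
      gain = begin
        C.gain ψ (C.revSteps W') ≈⟨ C.gain-rev ψ walk' ⟩
        - (C.walkSign W' ⊙ C.gain ψ W')
          ≈⟨ -‿cong (≈-trans (≈-reflexive (cong (_⊙ C.gain ψ W') s1)) (⊙-cong (twist x *ₛ (G.walkSign L *ₛ twist x')) g1)) ⟩
        - ((twist x *ₛ (G.walkSign L *ₛ twist x')) ⊙ (twist x ⊙ G.gain ψ L))
          ≈⟨ -‿cong (≈-trans (⊙-⊙ (twist x *ₛ (G.walkSign L *ₛ twist x')) (twist x) (G.gain ψ L)) (≈-trans (≈-reflexive (cong (_⊙ G.gain ψ L) (regroup (twist x) (G.walkSign L) (twist x')))) (≈-sym (⊙-⊙ (twist x') (G.walkSign L) (G.gain ψ L))))) ⟩
        - (twist x' ⊙ (G.walkSign L ⊙ G.gain ψ L))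
          ≈⟨ ≈-sym (⊙-‿comm (twist x') (G.walkSign L ⊙ G.gain ψ L)) ⟩
        twist x' ⊙ (- (G.walkSign L ⊙ G.gain ψ L))
          ≈⟨ ⊙-cong (twist x') (≈-sym (G.gain-rev ψ walk)) ⟩
        twist x' ⊙ G.gain ψ (G.revSteps L) ∎
        where regroup : ∀ a b c → (a *ₛ (b *ₛ c)) *ₛ a ≡ c *ₛ b
              regroup = signIdentity 3
      sign : C.walkSign (C.revSteps W') ≡ twist x' *ₛ (G.walkSign (G.revSteps L) *ₛ twist x)
      sign = ≡.trans (C.walkSign-rev W') (≡.trans s1 (≡.trans (reversed (twist x) (G.walkSign L) (twist x'))
               (cong (λ q → twist x' *ₛ (q *ₛ twist x)) (≡.sym (G.walkSign-rev L)))))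
        where reversed : ∀ a b c → a *ₛ (b *ₛ c) ≡ c *ₛ (b *ₛ a)
              reversed = signIdentity 3

  lift-edges : ∀ W' x x' {e} → e ∈ G.edgesOf (lift x W' x') → e ≡ f ⊎ e ∈ G.edgesOf W'
  lift-edges [] x x' i = inj₁ (proj₁ (bridge-edges {x} {x'} i))
  lift-edges ((g , d) ∷ R) x x' i
    with ∈-++⁻ (G.edgesOf (bridge x (departure g d x))) (≡.subst (_ ∈_) (G.edgesOf-++ (bridge x (departure g d x)) ((g , d) ∷ lift (G.next x g d) R x')) i)
  ... | inj₁ j = inj₁ (proj₁ (bridge-edges {x} {departure g d x} j))
  ... | inj₂ (here refl) = inj₂ (here refl)
  ... | inj₂ (there j) with lift-edges R (G.next x g d) x' j
  ...   | inj₁ e = inj₁ e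
  ...   | inj₂ k = inj₂ (there k)

  interior-∷ : ∀ u g d R {y'} → C.next u g d ≡ y' → ∀ {z} → z ∈ (y' ∷ interior y' R) → R ≢ [] → z ∈ interior u ((g , d) ∷ R)
  interior-∷ u g d [] e i ne = ⊥-elim (ne refl)
  interior-∷ u g d (s2 ∷ R) e i ne = ≡.subst (λ q → _ ∈ (q ∷ interior q (s2 ∷ R))) (≡.sym e) i

  ∷≢[] : ∀ {A : Set} {x : A} {xs : List A} → Data.List._∷_ x xs ≢ Data.List.[]
  ∷≢[] ()

  -- The only places where the lift of a C-walk from u can use f or pass over w.
  FUsedAt : Fin n → G.Steps → Fin n → Fin n → Set
  FUsedAt u W' x x' = (x ≢ liftStart x W') ⊎ (liftEnd x W' ≢ x') ⊎ (w ∈ interior u W')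

  OverWAt : Fin n → G.Steps → Fin n → Fin n → Fin n → Set
  OverWAt u W' x x' z = ((x ≢ liftStart x W') × (z ≡ liftStart x W')) ⊎ (z ≡ x') ⊎ (z ≡ liftEnd x W') ⊎ (w ∈ interior u W')

  f∈lift : ∀ W' {u z'} → C.IsWalk u W' z' → ∀ {x x'} → merge x ≡ u → merge x' ≡ z' → f ∈ G.edgesOf (lift x W' x') →
           FUsedAt u W' x x'
  f∈lift [] refl {x} {x'} hx hx' i = inj₂ (inj₁ (proj₂ (bridge-edges {x} {x'} i)))
  f∈lift ((g , d) ∷ R) {u} (r' , y' , step' , walk') {x} {x'} hx hx' i with contracted-step⁻¹ step'
  ... | ne , xs , r , y , step , hxs , hr , hy
    with ∈-++⁻ (G.edgesOf (bridge x (departure g d x))) (≡.subst (_ ∈_) (G.edgesOf-++ (bridge x (departure g d x)) ((g , d) ∷ lift (G.next x g d) R x')) i)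
  ... | inj₁ j = inj₁ (proj₂ (bridge-edges {x} {departure g d x} j))
  ... | inj₂ (here e) = ⊥-elim (ne (≡.sym e))
  ... | inj₂ (there j) with f∈lift R walk' {G.next x g d} {x'} (≡.trans (cong merge (G.next-step {x} step)) hy) hx' j
  ...   | inj₂ (inj₁ b) = inj₂ (inj₁ b)
  ...   | inj₂ (inj₂ c) = inj₂ (inj₂ (interior-∷ u g d R (C.next-step {u} {g} {d} step') (there c) (λ { refl → case-empty c })))
    where case-empty : ∀ {z} → z ∈ interior y' [] → ⊥
          case-empty ()
  ...   | inj₁ a with R
  ...     | [] = ⊥-elim (a refl)
  ...     | s2 ∷ R2 = inj₂ (inj₂ (interior-∷ u g d (s2 ∷ R2) (C.next-step {u} {g} {d} step') (here wy') ∷≢[]))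
    where wy' : w ≡ y'
          wy' = ≡.trans (≡.sym (merge-collapse (≡.trans (cong merge (G.next-step {x} step)) (≡.trans hy (≡.sym (merge-liftStart (s2 ∷ R2) walk' (≡.trans (cong merge (G.next-step {x} step)) hy))))) a))
                  (≡.trans (cong merge (G.next-step {x} step)) hy)

  vsTail-lift-∷ : ∀ {g d xs r y} x R x' → merge x ≡ merge xs → stepFrom (ends g) d ≡ just (xs , r , y) →
             G.vsTail x (lift x ((g , d) ∷ R) x') ≡ G.vsTail x (bridge x xs) ++ (y ∷ G.vsTail y (lift y R x'))
  vsTail-lift-∷ {g} {d} {xs} {r} {y} x R x' hc step =
    ≡.trans (cong (G.vsTail x) (lift-∷ x R x' step))
     (≡.trans (G.vsTail-++ x (bridge x xs) ((g , d) ∷ lift y R x'))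
      (≡.trans (cong (λ q → G.vsTail x (bridge x xs) ++ G.vsTail q ((g , d) ∷ lift y R x')) (bridge-end {x} {xs} hc))
        (cong (λ q → G.vsTail x (bridge x xs) ++ (q ∷ G.vsTail q (lift y R x'))) (G.next-step {xs} step))))

  lift-vertex-over-w : ∀ W' {u z'} → C.IsWalk u W' z' → ∀ {x x'} → merge x ≡ u → merge x' ≡ z' → ∀ {z} →
           z ∈ G.vsTail x (lift x W' x') → merge z ≡ w →
           OverWAt u W' x x' z
  lift-vertex-over-w [] refl {x} {x'} hx hx' i hz with bridge-vertices {x} {x'} (≡.trans hx (≡.sym hx'))
  ... | inj₁ (_ , e) rewrite e = ⊥-elim (noMem i)
    where noMem : ∀ {z} → z ∈ Data.List.[] → ⊥
          noMem ()
  ... | inj₂ (_ , e) rewrite e with i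
  ...   | here e' = inj₂ (inj₁ e')
  lift-vertex-over-w ((g , d) ∷ R) {u} (r' , y' , step' , walk') {x} {x'} hx hx' {z} i hz with contracted-step⁻¹ step'
  ... | ne , xs , r , y , step , hxs , hr , hy
    with ∈-++⁻ (G.vsTail x (bridge x xs)) (≡.subst (z ∈_) (vsTail-lift-∷ x R x' hc step) i)
    where hc = ≡.trans hx (≡.sym hxs)
  ... | inj₁ j with bridge-vertices {x} {xs} (≡.trans hx (≡.sym hxs))
  ...   | inj₁ (_ , e) rewrite e = ⊥-elim (noMem j)
    where noMem : ∀ {z} → z ∈ Data.List.[] → ⊥
          noMem ()
  ...   | inj₂ (ne' , e) rewrite e with j
  ...     | here e' = inj₁ ((λ q → ne' (≡.trans q (departure-step {x = x} step))) , ≡.trans e' (≡.sym (departure-step {x = x} step)))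
  lift-vertex-over-w ((g , d) ∷ []) {u} (r' , y' , step' , walk') {x} {x'} hx hx' {z} i hz | ne , xs , r , y , step , hxs , hr , hy | inj₂ (here e') =
    inj₂ (inj₂ (inj₁ (≡.trans e' (≡.sym (G.next-step {x} step)))))
  lift-vertex-over-w ((g , d) ∷ (s2 ∷ R2)) {u} (r' , y' , step' , walk') {x} {x'} hx hx' {z} i hz | ne , xs , r , y , step , hxs , hr , hy | inj₂ (here e') =
    inj₂ (inj₂ (inj₂ (interior-∷ u g d (s2 ∷ R2) (C.next-step {u} {g} {d} step') (here (≡.trans (≡.sym hz) (≡.trans (cong merge e') hy))) ∷≢[])))
  lift-vertex-over-w ((g , d) ∷ R) {u} (r' , y' , step' , walk') {x} {x'} hx hx' {z} i hz | ne , xs , r , y , step , hxs , hr , hy | inj₂ (there j)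
    with lift-vertex-over-w R walk' {y} {x'} hy hx' j hz
  ... | inj₂ (inj₁ a) = inj₂ (inj₁ a)
  ... | inj₂ (inj₂ (inj₁ b)) = inj₂ (inj₂ (inj₁ (≡.trans b (cong (λ q → liftEnd q R) (≡.sym (G.next-step {x} step))))))
  ... | inj₂ (inj₂ (inj₂ c)) = inj₂ (inj₂ (inj₂ (interior-∷ u g d R (C.next-step {u} {g} {d} step') (there c) (λ { refl → noMem c }))))
    where noMem : ∀ {z} → z ∈ interior y' Data.List.[] → ⊥
          noMem ()
  ... | inj₁ (a , _) with R
  ...   | [] = ⊥-elim (a refl)
  ...   | s2 ∷ R2 = inj₂ (inj₂ (inj₂ (interior-∷ u g d (s2 ∷ R2) (C.next-step {u} {g} {d} step') (here wy') ∷≢[])))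
    where wy' : w ≡ y'
          wy' = ≡.trans (≡.sym (merge-collapse (≡.trans hy (≡.sym (merge-liftStart (s2 ∷ R2) walk' hy))) a)) hy

  lift-split-at-end : ∀ y R x' → lift y R x' ≡ lift y R (liftEnd y R) ++ bridge (liftEnd y R) x'
  lift-split-at-end y [] x' rewrite bridge-refl y = refl
  lift-split-at-end y ((g , d) ∷ R) x' =
    ≡.trans (cong (λ L → bridge y (departure g d y) ++ ((g , d) ∷ L)) (lift-split-at-end (G.next y g d) R x'))
      (≡.sym (List.++-assoc (bridge y (departure g d y)) ((g , d) ∷ lift (G.next y g d) R (liftEnd (G.next y g d) R)) (bridge (liftEnd (G.next y g d) R) x')))

  lift-from-departure : ∀ {g d xs r y} R x' → stepFrom (ends g) d ≡ just (xs , r , y) → lift xs ((g , d) ∷ R) x' ≡ (g , d) ∷ lift y R x'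
  lift-from-departure {g} {d} {xs} R x' eq = ≡.trans (lift-∷ xs R x' eq) (cong (_++ _) (bridge-refl xs))

  bridge-++-HeadEdge≢ : ∀ {g} x y B → g ≢ f → G.HeadEdge≢ g B → G.HeadEdge≢ g (bridge x y ++ B)
  bridge-++-HeadEdge≢ x y B ne fn with x ≟ y
  ... | yes _ = fn
  ... | no _ with x ≟ v
  ...   | yes _ = λ e → ne e
  ...   | no _ = λ e → ne e

  lift-HeadEdge≢ : ∀ {g} y R x' → g ≢ f → G.HeadEdge≢ g R → G.HeadEdge≢ g (lift y R x')
  lift-HeadEdge≢ y [] x' ne fn = ≡.subst (G.HeadEdge≢ _) (List.++-identityʳ (bridge y x')) (bridge-++-HeadEdge≢ y x' [] ne tt)
  lift-HeadEdge≢ y ((g2 , d2) ∷ R) x' ne fn = bridge-++-HeadEdge≢ y (departure g2 d2 y) _ ne fn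

  HeadEdge≢⇒NoInitialBacktrack : ∀ e d L → G.HeadEdge≢ e L → G.NoInitialBacktrack ((e , d) ∷ L)
  HeadEdge≢⇒NoInitialBacktrack e d [] _ = tt
  HeadEdge≢⇒NoInitialBacktrack e d (_ ∷ _) fn = fn

  Unique⇒HeadEdge≢ : ∀ g R → Unique (g ∷ G.edgesOf R) → G.HeadEdge≢ g R
  Unique⇒HeadEdge≢ g [] _ = tt
  Unique⇒HeadEdge≢ g ((g2 , _) ∷ R) u = λ e → Unique[x∷xs]⇒x∉xs u (here e)

  just-injective₃ : ∀ {a a' : Fin n} {b b' : Sign} {c c' : Fin n} → _≡_ {A = Maybe (Fin n × Sign × Fin n)} (just (a , b , c)) (just (a' , b' , c')) → (a ≡ a') × (b ≡ b') × (c ≡ c')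
  just-injective₃ refl = refl , refl , refl

  first-step-in-G : ∀ {g d R a z'} → C.IsWalk a ((g , d) ∷ R) z' →
          Σ (Fin n) λ xs → Σ Sign λ r → Σ (Fin n) λ y → stepFrom (ends g) d ≡ just (xs , r , y)
  first-step-in-G (r' , y' , step' , walk') with contracted-step⁻¹ step'
  ... | ne , xs , r , y , step , _ = xs , r , y , step

  first-step-matches : ∀ {g d R a z' xs r y} → C.IsWalk a ((g , d) ∷ R) z' → stepFrom (ends g) d ≡ just (xs , r , y) →
               (g ≢ f) × (merge xs ≡ a) × (C.IsWalk (merge y) R z') × (C.next a g d ≡ merge y)
  first-step-matches {g} {d} {R} {a} (r' , y' , step' , walk') step with just-injective₃ (≡.trans (≡.sym step') (contracted-step (contracted-step⇒≢f step') step))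
  ... | ea , _ , ey = contracted-step⇒≢f step' , ≡.sym ea , ≡.subst (λ q → C.IsWalk q R _) ey walk' , ≡.trans (C.next-step {a} {g} {d} step') ey

  lift-vertices-unique : ∀ g d R {a z' xs r y} → C.IsWalk a ((g , d) ∷ R) z' → stepFrom (ends g) d ≡ just (xs , r , y) →
                  Unique (C.vsTail a ((g , d) ∷ R)) → ∀ {x'} → merge x' ≡ z' → Unique (G.vsTail xs (lift xs ((g , d) ∷ R) x'))
  lift-vertices-unique g d R {a} {z'} {xs} {r} {y} walk step u {x'} hx' with first-step-matches walk step
  ... | ne , hxs , walk₂ , hn rewrite lift-from-departure R x' step | G.next-step {xs} step | hn =
    Expands-unique (lift-expands R walk₂ refl hx') u


  liftEnd-∷ : ∀ {g d xs r y} R x → stepFrom (ends g) d ≡ just (xs , r , y) → liftEnd x ((g , d) ∷ R) ≡ liftEnd y R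
  liftEnd-∷ R x eq = cong (λ q → liftEnd q R) (G.next-step {x} eq)

  lift-from-departure-walk : ∀ g d R {a z' xs r y} → C.IsWalk a ((g , d) ∷ R) z' → stepFrom (ends g) d ≡ just (xs , r , y) →
               ∀ {x'} → merge x' ≡ z' → G.IsWalk xs (lift xs ((g , d) ∷ R) x') x'
  lift-from-departure-walk g d R walk step hx' = lift-walk _ walk (proj₁ (proj₂ (first-step-matches walk step))) hx'

  lift-edges-unique : ∀ g d R {a z' xs r y} → C.IsWalk a ((g , d) ∷ R) z' → stepFrom (ends g) d ≡ just (xs , r , y) →
                Unique (C.vsTail a ((g , d) ∷ R)) → Unique (G.edgesOf ((g , d) ∷ R)) →
                ∀ {x'} → merge x' ≡ z' → Unique (G.edgesOf (lift xs ((g , d) ∷ R) x'))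
  lift-edges-unique g d R {xs = xs} {y = y} walk step uv ue {x'} hx' =
    G.distinctVertices⇒distinctEdges (lift-from-departure-walk g d R walk step hx') (lift-vertices-unique g d R walk step uv hx')
      (≡.subst G.NoInitialBacktrack (≡.sym (lift-from-departure R x' step))
        (HeadEdge≢⇒NoInitialBacktrack g d (lift y R x') (lift-HeadEdge≢ y R x' (proj₁ (first-step-matches walk step)) (Unique⇒HeadEdge≢ g R ue))))

  lift-circle-at-departure : ∀ g d R {a xs r y} → C.IsCircle a ((g , d) ∷ R) → stepFrom (ends g) d ≡ just (xs , r , y) →
                G.IsCircle xs (lift xs ((g , d) ∷ R) xs)
  lift-circle-at-departure g d R {a} {xs} {r} {y} (walk , _ , ue , uv) step =
    lift-from-departure-walk g d R walk step hxs ,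
    (λ e → ∷≢[] (≡.trans (≡.sym (lift-from-departure R xs step)) e)) ,
    lift-edges-unique g d R walk step uv ue hxs ,
    lift-vertices-unique g d R walk step uv hxs
    where hxs = proj₁ (proj₂ (first-step-matches walk step))

  lift-sign-closed : ∀ W' {a} → C.IsWalk a W' a → ∀ {x} → merge x ≡ a → G.walkSign (lift x W' x) ≡ C.walkSign W'
  lift-sign-closed W' walk {x} hx = ≡.trans (≡.sym (a*[b*a]≡b (twist x) (G.walkSign (lift x W' x)))) (≡.sym (Lifts.sign≡ (lift-lifts W' walk {x} {x} hx hx)))

  bridge-≢ : ∀ {x y} → merge x ≡ merge y → x ≢ y → Σ Dir λ dd → bridge x y ≡ [ (f , dd) ]
  bridge-≢ {x} {y} h ne with bridge x y | bridgeView {x} {y} h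
  ... | _ | bv-same e = ⊥-elim (ne e)
  ... | _ | bv-fwd _ _ = fwd , refl
  ... | _ | bv-bwd _ _ = bwd , refl

  lift-circle-at-end : ∀ g d R {a xs r y} → C.IsCircle a ((g , d) ∷ R) → stepFrom (ends g) d ≡ just (xs , r , y) →
                liftEnd y R ≢ xs → G.IsCircle (liftEnd y R) (lift (liftEnd y R) ((g , d) ∷ R) (liftEnd y R))
  lift-circle-at-end g d R {a} {xs} {r} {y} (walk , _ , ue , uv) step ne =
    lift-walk _ walk hxe hxe ,
    (λ e → nonE (≡.trans (≡.sym (lift-∷ xe R xe step)) e)) ,
    uE , uV
    where
      matched = first-step-matches walk step
      hxs = proj₁ (proj₂ matched)
      walk₂ = proj₁ (proj₂ (proj₂ matched))
      xe = liftEnd y R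
      hxe : merge xe ≡ a
      hxe = merge-liftEnd R walk₂ refl
      hc : merge xe ≡ merge xs
      hc = ≡.trans hxe (≡.sym hxs)
      dd = proj₁ (bridge-≢ hc ne)
      cshape : bridge xe xs ≡ [ (f , dd) ]
      cshape = proj₂ (bridge-≢ hc ne)
      L≡ : lift xe ((g , d) ∷ R) xe ≡ (f , dd) ∷ (g , d) ∷ lift y R xe
      L≡ = ≡.trans (lift-∷ xe R xe step) (cong (_++ ((g , d) ∷ lift y R xe)) cshape)
      nonE : bridge xe xs ++ ((g , d) ∷ lift y R xe) ≢ []
      nonE e rewrite cshape with e
      ... | ()
      M = G.vsTail y (lift y R xe)
      fwk : G.IsWalk xe [ (f , dd) ] xs
      fwk = ≡.subst (λ L → G.IsWalk xe L xs) cshape (bridge-walk hc)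
      n1≡ : G.next xe f dd ≡ xs
      n1≡ = G.next-step {xe} (proj₁ (proj₂ (proj₂ fwk))) ⟨ ≡.trans ⟩ proj₂ (proj₂ (proj₂ fwk))
      vsL : G.vsTail xe (lift xe ((g , d) ∷ R) xe) ≡ xs ∷ y ∷ M
      vsL = ≡.trans (cong (G.vsTail xe) L≡)
              (≡.trans (cong (λ q → q ∷ G.vsTail q ((g , d) ∷ lift y R xe)) n1≡)
                (cong (λ q → xs ∷ q ∷ G.vsTail q (lift y R xe)) (G.next-step {xs} step)))
      uS : Unique (G.vsTail xs (lift xs ((g , d) ∷ R) xs))
      uS = lift-vertices-unique g d R walk step uv hxs
      endL : G.walkEnd y (lift y R xe) ≡ xe
      endL = G.walk-end (lift-walk R walk₂ {y} {xe} refl hxe)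
      vsS : G.vsTail xs (lift xs ((g , d) ∷ R) xs) ≡ (y ∷ M) ++ [ xs ]
      vsS = ≡.trans (cong (G.vsTail xs) (lift-from-departure R xs step))
             (≡.trans (cong (λ q → q ∷ G.vsTail q (lift y R xs)) (G.next-step {xs} step))
               (cong (y ∷_) (≡.trans (cong (G.vsTail y) (lift-split-at-end y R xs))
                 (≡.trans (G.vsTail-++ y (lift y R xe) (bridge xe xs))
                   (cong (M ++_) (≡.trans (cong (λ q → G.vsTail q (bridge xe xs)) endL)
                      (≡.trans (cong (G.vsTail xe) cshape) (cong [_] n1≡))))))))
      uV : Unique (G.vsTail xe (lift xe ((g , d) ∷ R) xe))
      uV = ≡.subst Unique (≡.sym vsL) (Unique-resp-↭ (↭-sym (Perm.∷↭∷ʳ xs (y ∷ M))) (≡.subst Unique vsS uS))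
      uE : Unique (G.edgesOf (lift xe ((g , d) ∷ R) xe))
      uE = G.distinctVertices⇒distinctEdges (lift-walk _ walk hxe hxe) uV (≡.subst G.NoInitialBacktrack (≡.sym L≡) (λ e → proj₁ matched (≡.sym e)))

  halfτ-contracted : ∀ {e x r} → e ≢ f → ends e ≡ half x r → halfτ-of (contracted e) ≡ twist x *ₛ r
  halfτ-contracted {e} ne h rewrite contracted-≢f ne | h = refl

  lifts-ultragain : ∀ {ea eb x0 x1 r0 r1 L W'} → ea ≢ f → eb ≢ f → ends ea ≡ half x0 r0 → ends eb ≡ half x1 r1 →
          Lifts x0 L W' x1 → C.ultragain ψ ea W' eb ≈ twist x0 ⊙ G.ultragain ψ ea L eb
  lifts-ultragain {ea} {eb} {x0} {x1} {r0} {r1} {L} {W'} n0 n1 h0 h1 (lifts g1 s1) = begin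
      halfτ-of (contracted ea) ⊙ ψ ea + (C.gain ψ W' + (- (halfτ-of (contracted eb) ⊙ (C.walkSign W' ⊙ ψ eb))))
        ≡⟨ cong₂ (λ a b → a ⊙ ψ ea + (C.gain ψ W' + (- (b ⊙ (C.walkSign W' ⊙ ψ eb))))) (halfτ-contracted n0 h0) (halfτ-contracted n1 h1) ⟩
      (twist x0 *ₛ r0) ⊙ ψ ea + (C.gain ψ W' + (- ((twist x1 *ₛ r1) ⊙ (C.walkSign W' ⊙ ψ eb))))
        ≈⟨ +-cong (≈-sym (⊙-⊙ (twist x0) r0 (ψ ea))) (+-cong g1 (-‿cong endE)) ⟩
      twist x0 ⊙ (r0 ⊙ ψ ea) + (twist x0 ⊙ G.gain ψ L + (- (twist x0 ⊙ (r1 ⊙ (G.walkSign L ⊙ ψ eb)))))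
        ≈⟨ +-congˡ (+-congˡ (≈-sym (⊙-‿comm (twist x0) (r1 ⊙ (G.walkSign L ⊙ ψ eb))))) ⟩
      twist x0 ⊙ (r0 ⊙ ψ ea) + (twist x0 ⊙ G.gain ψ L + twist x0 ⊙ (- (r1 ⊙ (G.walkSign L ⊙ ψ eb))))
        ≈⟨ +-congˡ (≈-sym (⊙-distrib-+ (twist x0) (G.gain ψ L) (- (r1 ⊙ (G.walkSign L ⊙ ψ eb))))) ⟩
      twist x0 ⊙ (r0 ⊙ ψ ea) + twist x0 ⊙ (G.gain ψ L + (- (r1 ⊙ (G.walkSign L ⊙ ψ eb))))
        ≈⟨ ≈-sym (⊙-distrib-+ (twist x0) (r0 ⊙ ψ ea) _) ⟩
      twist x0 ⊙ (r0 ⊙ ψ ea + (G.gain ψ L + (- (r1 ⊙ (G.walkSign L ⊙ ψ eb)))))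
        ≡⟨ cong₂ (λ a b → twist x0 ⊙ (halfτ-of a ⊙ ψ ea + (G.gain ψ L + (- (halfτ-of b ⊙ (G.walkSign L ⊙ ψ eb)))))) (≡.sym h0) (≡.sym h1) ⟩
      twist x0 ⊙ G.ultragain ψ ea L eb ∎
    where
      endE : (twist x1 *ₛ r1) ⊙ (C.walkSign W' ⊙ ψ eb) ≈ twist x0 ⊙ (r1 ⊙ (G.walkSign L ⊙ ψ eb))
      endE = begin
        (twist x1 *ₛ r1) ⊙ (C.walkSign W' ⊙ ψ eb)
          ≡⟨ cong (λ q → (twist x1 *ₛ r1) ⊙ (q ⊙ ψ eb)) s1 ⟩
        (twist x1 *ₛ r1) ⊙ ((twist x0 *ₛ (G.walkSign L *ₛ twist x1)) ⊙ ψ eb)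
          ≈⟨ ⊙-⊙ (twist x1 *ₛ r1) (twist x0 *ₛ (G.walkSign L *ₛ twist x1)) (ψ eb) ⟩
        ((twist x1 *ₛ r1) *ₛ (twist x0 *ₛ (G.walkSign L *ₛ twist x1))) ⊙ ψ eb
          ≡⟨ cong (_⊙ ψ eb) (regroup (twist x0) (G.walkSign L) (twist x1) r1) ⟩
        (twist x0 *ₛ (r1 *ₛ G.walkSign L)) ⊙ ψ eb
          ≈⟨ ≈-sym (≈-trans (⊙-cong (twist x0) (⊙-⊙ r1 (G.walkSign L) (ψ eb))) (⊙-⊙ (twist x0) (r1 *ₛ G.walkSign L) (ψ eb))) ⟩
        twist x0 ⊙ (r1 ⊙ (G.walkSign L ⊙ ψ eb)) ∎
        where regroup : ∀ a b c r → (c *ₛ r) *ₛ (a *ₛ (b *ₛ c)) ≡ a *ₛ (r *ₛ b)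
              regroup = signIdentity 4

  FigLifts : ∀ {a A} → C.NegFig a → G.NegFig A → Set ℓ
  FigLifts {a} {A} (C.halfF e _) (G.halfF e2 _) = Level.Lift ℓ ((e ≡ e2) × (e ≢ f) × (Σ Sign λ r → ends e ≡ half A r))
  FigLifts {a} {A} (C.circF W' _ _) (G.circF L _ _) = Lifts A L W' A × G.IsWalk A L A × C.IsWalk a W' a
  FigLifts _ _ = Level.Lift ℓ ⊥

  cuffgain-lift : ∀ {a1 a2 A1 A2} (F1' : C.NegFig a1) (FG1 : G.NegFig A1) P LP (F2' : C.NegFig a2) (FG2 : G.NegFig A2) →
           merge A1 ≡ a1 → merge A2 ≡ a2 → FigLifts F1' FG1 → FigLifts F2' FG2 → Lifts A1 LP P A2 → G.IsWalk A1 LP A2 → C.IsWalk a1 P a2 →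
           G.cuffgain ψ FG1 LP FG2 ≈ 0# → C.cuffgain ψ F1' P F2' ≈ 0#
  cuffgain-lift {A1 = A1} (C.circF W1 _ _) (G.circF L1 _ _) P LP (C.circF W2 _ _) (G.circF L2 _ _) refl refl (r1 , w1 , _) (r2 , w2 , _) rP wLP wP z =
    ≈-trans (Lifts.gain≈ (lifts-++ r1 (lifts-++ rP (lifts-++ r2 (lifts-rev wLP wP rP))))) (≈0⇒⊙≈0 (twist A1) z)
  cuffgain-lift {A1 = A1} (C.halfF e1 _) (G.halfF e1' _) P LP (C.circF W2 _ _) (G.circF L2 _ _) refl refl (Level.lift (refl , ne , r , h)) (r2 , w2 , _) rP wLP wP z =
    ≈-trans (lifts-ultragain ne ne h h (lifts-++ rP (lifts-++ r2 (lifts-rev wLP wP rP)))) (≈0⇒⊙≈0 (twist A1) z)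
  cuffgain-lift {A2 = A2} (C.circF W1 _ _) (G.circF L1 _ _) P LP (C.halfF e2 _) (G.halfF e2' _) refl refl (r1 , w1 , _) (Level.lift (refl , ne , r , h)) rP wLP wP z =
    ≈-trans (lifts-ultragain ne ne h h (lifts-++ (lifts-rev wLP wP rP) (lifts-++ r1 rP))) (≈0⇒⊙≈0 (twist A2) z)
  cuffgain-lift {A1 = A1} (C.halfF e1 _) (G.halfF e1' _) P LP (C.halfF e2 _) (G.halfF e2' _) refl refl (Level.lift (refl , ne1 , r1 , h1)) (Level.lift (refl , ne2 , r2 , h2)) rP wLP wP z =
    ≈-trans (lifts-ultragain ne1 ne2 h1 h2 rP) (≈0⇒⊙≈0 (twist A1) z)
  cuffgain-lift (C.halfF _ _) (G.circF _ _ _) P LP F2' FG2 _ _ (Level.lift ()) _ _ _ _ _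
  cuffgain-lift (C.circF _ _ _) (G.halfF _ _) P LP F2' FG2 _ _ (Level.lift ()) _ _ _ _ _
  cuffgain-lift (C.halfF _ _) (G.halfF _ _) P LP (C.halfF _ _) (G.circF _ _ _) _ _ _ (Level.lift ()) _ _ _ _
  cuffgain-lift (C.halfF _ _) (G.halfF _ _) P LP (C.circF _ _ _) (G.halfF _ _) _ _ _ (Level.lift ()) _ _ _ _
  cuffgain-lift (C.circF _ _ _) (G.circF _ _ _) P LP (C.halfF _ _) (G.circF _ _ _) _ _ _ (Level.lift ()) _ _ _ _
  cuffgain-lift (C.circF _ _ _) (G.circF _ _ _) P LP (C.circF _ _ _) (G.halfF _ _) _ _ _ (Level.lift ()) _ _ _ _

  reattach-half⁻¹ : ∀ E {a r'} → reattach E ≡ half a r' → Σ (Fin n) λ x → Σ Sign λ r → (E ≡ half x r) × (merge x ≡ a) × (twist x *ₛ r ≡ r')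
  reattach-half⁻¹ (half x r) refl = x , r , refl , refl , refl
  reattach-half⁻¹ (two _ _ _ _) ()
  reattach-half⁻¹ loose ()

  contracted-half⁻¹ : ∀ {e a r'} → contracted e ≡ half a r' →
              (e ≢ f) × (Σ (Fin n) λ x → Σ Sign λ r → (ends e ≡ half x r) × (merge x ≡ a) × (twist x *ₛ r ≡ r'))
  contracted-half⁻¹ {e} h with e ≟ f
  ... | yes refl = ⊥-elim (lh h)
    where lh : ∀ {a r'} → _≡_ {A = Ends n} loose (half a r') → ⊥
          lh ()
  ... | no ne = ne , reattach-half⁻¹ (ends e) h

  halfEdgeVertex : Fin m → Fin n → Fin n
  halfEdgeVertex e a with ends e
  ... | half x _ = x
  ... | _ = a

  halfEdgeVertex-half : ∀ {e x r} a → ends e ≡ half x r → halfEdgeVertex e a ≡ x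
  halfEdgeVertex-half {e} a h with ends e
  halfEdgeVertex-half {e} a refl | .(half _ _) = refl

  walkEnd∈vsTail : ∀ {a W' z'} → C.IsWalk a W' z' → W' ≢ [] → z' ∈ C.vsTail a W'
  walkEnd∈vsTail {W' = []} walk ne = ⊥-elim (ne refl)
  walkEnd∈vsTail {a} {(g , d) ∷ R} {z'} walk ne rewrite vsTail≡interior∷ʳend a g d R = ∈-++⁺ʳ (interior a ((g , d) ∷ R)) (here (≡.sym (C.walk-end {a} {(g , d) ∷ R} walk)))

  interior⊆vsTail : ∀ {a W' z} → z ∈ interior a W' → z ∈ C.vsTail a W'
  interior⊆vsTail {a} {[]} ()
  interior⊆vsTail {a} {(g , d) ∷ R} i rewrite vsTail≡interior∷ʳend a g d R = ∈-++⁺ˡ i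

  end∉interior : ∀ {a W' z'} → C.IsWalk a W' z' → Unique (C.vsTail a W') → z' ∉ interior a W'
  end∉interior {a} {[]} walk u ()
  end∉interior {a} {(g , d) ∷ R} walk u i rewrite vsTail≡interior∷ʳend a g d R = Unique-∷ʳ⇒∉ (interior a ((g , d) ∷ R)) u (≡.subst (_∈ interior a ((g , d) ∷ R)) (≡.sym (C.walk-end {a} {(g , d) ∷ R} walk)) i)

  start∉interior : ∀ {a W'} → Unique (a ∷ C.vsTail a W') → a ∉ interior a W'
  start∉interior {a} {W'} u i = Unique[x∷xs]⇒x∉xs u (interior⊆vsTail {a} {W'} i)

  figStart figEnd : ∀ {a} → C.NegFig a → Fin n
  figStart {a} (C.halfF e _) = halfEdgeVertex e a
  figStart {a} (C.circF [] _ _) = a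
  figStart {a} (C.circF ((g , d) ∷ R) _ _) = departure g d a
  figEnd {a} (C.halfF e _) = halfEdgeVertex e a
  figEnd {a} (C.circF [] _ _) = a
  figEnd {a} (C.circF ((g , d) ∷ R) _ _) = liftEnd (G.next (departure g d a) g d) R

  record LiftedFig {a} (F' : C.NegFig a) (A : Fin n) : Set ℓ where
    field
      fig : G.NegFig A
      merge-anchor : merge A ≡ a
      verts-over : ∀ {z} → z ∈ G.figVerts fig → merge z ∈ C.figVerts F'
      verts-over-w : a ≡ w → ∀ {z} → z ∈ G.figVerts fig → merge z ≡ w → z ≡ figStart F' ⊎ z ≡ figEnd F'
      edges-over : ∀ {e} → e ∈ G.figEdges fig → e ≡ f ⊎ e ∈ C.figEdges F'
      f-through-w : f ∈ G.figEdges fig → w ∈ C.figVerts F'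
      f-absent : figStart F' ≡ figEnd F' → a ≡ w → f ∉ G.figEdges fig
      fig-lifts : FigLifts F' fig

  liftHalf : ∀ {a} e (hr : Σ Sign λ r' → contracted e ≡ half a r') A → A ≡ halfEdgeVertex e a → LiftedFig (C.halfF e hr) A
  liftHalf {a} e (r' , h') A A≡ with contracted-half⁻¹ h'
  ... | ne , x , r , h , merge-x , ζr = ≡.subst (LiftedFig (C.halfF e (r' , h'))) (≡.sym (≡.trans A≡ (halfEdgeVertex-half a h))) rec
    where
      rec : LiftedFig (C.halfF e (r' , h')) x
      rec = record
        { fig = G.halfF e (r , h)
        ; merge-anchor = merge-x
        ; verts-over = λ { (here refl) → here merge-x }
        ; verts-over-w = λ { _ (here refl) _ → inj₁ (≡.sym (halfEdgeVertex-half a h)) }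
        ; edges-over = λ { (here refl) → inj₂ (here refl) }
        ; f-through-w = λ { (here e≡) → ⊥-elim (ne (≡.sym e≡)) }
        ; f-absent = λ { _ _ (here e≡) → ne (≡.sym e≡) }
        ; fig-lifts = Level.lift (refl , ne , r , h)
        }

  ∈-closed-walk : ∀ {a W' z} → C.IsWalk a W' a → W' ≢ [] → z ∈ (a ∷ C.vsTail a W') → z ∈ C.vsTail a W'
  ∈-closed-walk {a} {W'} walk nonempty (here refl) = walkEnd∈vsTail {a} {W'} walk nonempty
  ∈-closed-walk walk nonempty (there z∈)           = z∈

  circleFig : ∀ {a} W' (c : C.IsCircle a W') (sg : C.walkSign W' ≡ neg) A → merge A ≡ a → G.IsCircle A (lift A W' A) →
              (a ≡ w → ∀ {z} → OverWAt a W' A A z → z ≡ figStart (C.circF W' c sg) ⊎ z ≡ figEnd (C.circF W' c sg)) →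
              (FUsedAt a W' A A → w ∈ C.vsTail a W') →
              (figStart (C.circF W' c sg) ≡ figEnd (C.circF W' c sg) → a ≡ w → FUsedAt a W' A A → ⊥) →
              LiftedFig (C.circF W' c sg) A
  circleFig W' c sg A hA circle over-w f-used f-unused = record
    { fig          = G.circF (lift A W' A) circle (≡.trans (lift-sign-closed W' walk hA) sg)
    ; merge-anchor = hA
    ; verts-over   = λ i → ∈-closed-walk walk (proj₁ (proj₂ c)) (Expands-∈ (lift-expands W' walk hA hA) (there i))
    ; verts-over-w = λ aw i hz → over-w aw (lift-vertex-over-w W' walk hA hA i hz)
    ; edges-over   = lift-edges W' A A
    ; f-through-w  = λ i → f-used (f∈lift W' walk hA hA i)
    ; f-absent     = λ pq aw i → f-unused pq aw (f∈lift W' walk hA hA i)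
    ; fig-lifts    = lift-lifts W' walk hA hA , lift-walk W' walk hA hA , walk
    }
    where walk = proj₁ c

  liftCircleFromStart : ∀ {a} g d R (c : C.IsCircle a ((g , d) ∷ R)) (sg : C.walkSign ((g , d) ∷ R) ≡ neg) A →
                        A ≡ departure g d a → LiftedFig (C.circF ((g , d) ∷ R) c sg) A
  liftCircleFromStart {a} g d R c sg A A≡ with first-step-in-G (proj₁ c)
  ... | xs , r , y , step = ≡.subst (LiftedFig F') (≡.sym (≡.trans A≡ p≡))
                             (circleFig W' c sg xs hxs (lift-circle-at-departure g d R c step) over-w used unused)
    where
      F' = C.circF ((g , d) ∷ R) c sg
      W' = (g , d) ∷ R
      walk = proj₁ c
      hxs : merge xs ≡ a
      hxs = proj₁ (proj₂ (first-step-matches walk step))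
      p≡ : figStart F' ≡ xs
      p≡ = departure-step {x = a} step
      q≡ : figEnd F' ≡ liftEnd xs W'
      q≡ = cong (λ q → liftEnd (G.next q g d) R) p≡
      st≡ : liftStart xs W' ≡ xs
      st≡ = departure-step {x = xs} step
      a∉ : a ∉ interior a W'
      a∉ = end∉interior walk (proj₂ (proj₂ (proj₂ c)))
      over-w : a ≡ w → ∀ {z} → OverWAt a W' xs xs z → z ≡ figStart F' ⊎ z ≡ figEnd F'
      over-w aw (inj₁ (_ , e))           = inj₁ (≡.trans e (≡.trans st≡ (≡.sym p≡)))
      over-w aw (inj₂ (inj₁ e))          = inj₁ (≡.trans e (≡.sym p≡))
      over-w aw (inj₂ (inj₂ (inj₁ e)))   = inj₂ (≡.trans e (≡.sym q≡))
      over-w aw (inj₂ (inj₂ (inj₂ i)))   = ⊥-elim (a∉ (≡.subst (_∈ interior a W') (≡.sym aw) i))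
      used : FUsedAt a W' xs xs → w ∈ C.vsTail a W'
      used (inj₁ ne)         = ⊥-elim (ne (≡.sym st≡))
      used (inj₂ (inj₁ ne))  = ≡.subst (_∈ C.vsTail a W') aw (walkEnd∈vsTail {a} {W'} walk ∷≢[])
        where aw : a ≡ w
              aw = ≡.trans (≡.sym (merge-liftEnd W' walk hxs)) (merge-collapse (≡.trans (merge-liftEnd W' walk hxs) (≡.sym hxs)) ne)
      used (inj₂ (inj₂ i))   = interior⊆vsTail {a} {W'} i
      unused : figStart F' ≡ figEnd F' → a ≡ w → FUsedAt a W' xs xs → ⊥
      unused pq aw (inj₁ ne)        = ne (≡.sym st≡)
      unused pq aw (inj₂ (inj₁ ne)) = ne (≡.trans (≡.sym q≡) (≡.trans (≡.sym pq) p≡))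
      unused pq aw (inj₂ (inj₂ i))  = a∉ (≡.subst (_∈ interior a W') (≡.sym aw) i)

  liftCircleFromEnd : ∀ {a} g d R (c : C.IsCircle a ((g , d) ∷ R)) (sg : C.walkSign ((g , d) ∷ R) ≡ neg) A →
                      A ≡ figEnd (C.circF ((g , d) ∷ R) c sg) →
                      figStart (C.circF ((g , d) ∷ R) c sg) ≢ figEnd (C.circF ((g , d) ∷ R) c sg) →
                      LiftedFig (C.circF ((g , d) ∷ R) c sg) A
  liftCircleFromEnd {a} g d R c sg A A≡ pq with first-step-in-G (proj₁ c)
  ... | xs , r , y , step = ≡.subst (LiftedFig F') (≡.sym (≡.trans A≡ q≡))
                             (circleFig W' c sg xe hxe (lift-circle-at-end g d R c step xe≢xs) over-w used (λ pq' _ _ → pq pq'))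
    where
      F' = C.circF ((g , d) ∷ R) c sg
      W' = (g , d) ∷ R
      walk = proj₁ c
      matched = first-step-matches walk step
      hxs : merge xs ≡ a
      hxs = proj₁ (proj₂ matched)
      p≡ : figStart F' ≡ xs
      p≡ = departure-step {x = a} step
      xe = liftEnd y R
      q≡ : figEnd F' ≡ xe
      q≡ = cong (λ q → liftEnd q R) (≡.trans (cong (λ q → G.next q g d) p≡) (G.next-step {xs} step))
      hxe : merge xe ≡ a
      hxe = merge-liftEnd R (proj₁ (proj₂ (proj₂ matched))) refl
      xe≢xs : xe ≢ xs
      xe≢xs e = pq (≡.trans p≡ (≡.trans (≡.sym e) (≡.sym q≡)))
      st≡ : liftStart xe W' ≡ xs
      st≡ = departure-step {x = xe} step
      en≡ : liftEnd xe W' ≡ xe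
      en≡ = cong (λ q → liftEnd q R) (G.next-step {xe} step)
      over-w : a ≡ w → ∀ {z} → OverWAt a W' xe xe z → z ≡ figStart F' ⊎ z ≡ figEnd F'
      over-w aw (inj₁ (_ , e))         = inj₁ (≡.trans e (≡.trans st≡ (≡.sym p≡)))
      over-w aw (inj₂ (inj₁ e))        = inj₂ (≡.trans e (≡.sym q≡))
      over-w aw (inj₂ (inj₂ (inj₁ e))) = inj₂ (≡.trans e (≡.trans en≡ (≡.sym q≡)))
      over-w aw (inj₂ (inj₂ (inj₂ i))) = ⊥-elim (end∉interior walk (proj₂ (proj₂ (proj₂ c))) (≡.subst (_∈ interior a W') (≡.sym aw) i))
      a≡w : a ≡ w
      a≡w = ≡.trans (≡.sym hxe) (merge-collapse (≡.trans hxe (≡.sym hxs)) xe≢xs)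
      used : FUsedAt a W' xe xe → w ∈ C.vsTail a W'
      used (inj₂ (inj₂ i)) = interior⊆vsTail {a} {W'} i
      used _               = ≡.subst (_∈ C.vsTail a W') a≡w (walkEnd∈vsTail {a} {W'} walk ∷≢[])

  liftFig : ∀ {a} (F' : C.NegFig a) A → A ≡ figStart F' ⊎ A ≡ figEnd F' → LiftedFig F' A
  liftFig (C.halfF e hr) A (inj₁ e') = liftHalf e hr A e'
  liftFig (C.halfF e hr) A (inj₂ e') = liftHalf e hr A e'
  liftFig (C.circF [] c sg) A _ = ⊥-elim (proj₁ (proj₂ c) refl)
  liftFig (C.circF ((g , d) ∷ R) c sg) A (inj₁ e') = liftCircleFromStart g d R c sg A e'
  liftFig (C.circF ((g , d) ∷ R) c sg) A (inj₂ e') with figStart (C.circF ((g , d) ∷ R) c sg) ≟ figEnd (C.circF ((g , d) ∷ R) c sg)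
  ... | yes pq = liftCircleFromStart g d R c sg A (≡.trans e' (≡.sym pq))
  ... | no pq = liftCircleFromEnd g d R c sg A e' pq

  merge-figStart : ∀ {a} (F' : C.NegFig a) → merge (figStart F') ≡ a
  merge-figStart F' = LiftedFig.merge-anchor (liftFig F' (figStart F') (inj₁ refl))

  merge-figEnd : ∀ {a} (F' : C.NegFig a) → merge (figEnd F') ≡ a
  merge-figEnd F' = LiftedFig.merge-anchor (liftFig F' (figEnd F') (inj₂ refl))

  opens⇒at-w : ∀ {a} (F' : C.NegFig a) → figStart F' ≢ figEnd F' → a ≡ w
  opens⇒at-w F' ne = ≡.trans (≡.sym (merge-figStart F')) (merge-collapse (≡.trans (merge-figStart F') (≡.sym (merge-figEnd F'))) ne)

  f∉contracted-walk : ∀ {u W z} → C.IsWalk u W z → f ∉ C.edgesOf W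
  f∉contracted-walk {W = []} walk ()
  f∉contracted-walk {W = (g , d) ∷ R} (r' , y' , step' , walk') (here e) = contracted-step⇒≢f step' (≡.sym e)
  f∉contracted-walk {W = (g , d) ∷ R} (r' , y' , step' , walk') (there i) = f∉contracted-walk walk' i

  f∉contracted-fig : ∀ {a} (F' : C.NegFig a) → f ∉ C.figEdges F'
  f∉contracted-fig (C.halfF e (r' , h')) (here e≡) = proj₁ (contracted-half⁻¹ h') (≡.sym e≡)
  f∉contracted-fig (C.circF W c sg) i = f∉contracted-walk (proj₁ c) i

  nonempty-path-ends-distinct : ∀ {a1 P a2} → C.IsPath a1 P a2 → P ≢ [] → a1 ≢ a2
  nonempty-path-ends-distinct {a1} {P} (walk , u) ne refl = Unique[x∷xs]⇒x∉xs u (walkEnd∈vsTail {a1} {P} walk ne)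

  anchored : ∀ {a A z} → merge A ≡ a → merge z ≡ a → (a ≡ w → merge z ≡ w → z ≡ A) → z ≡ A
  anchored {a} hA hz over-w with a ≟ w
  ... | yes a≡w = over-w a≡w (≡.trans hz a≡w)
  ... | no a≢w  = merge-injective (≡.trans hz (≡.sym hA)) (λ e → a≢w (≡.trans (≡.sym hz) e))

  -- Lifted figures and a lifted path still form a handcuff when they meet over w only at their anchors.
  record Attached {a1 a2} (F1' : C.NegFig a1) P (F2' : C.NegFig a2) {A1 A2} (LF1 : LiftedFig F1' A1) (LF2 : LiftedFig F2' A2) : Set where
    constructor attached
    field
      f-once  : f ∈ G.figEdges (LiftedFig.fig LF1) → f ∈ G.figEdges (LiftedFig.fig LF2) → ⊥
      meets₁  : a1 ≡ w → ∀ {z} → z ∈ G.figVerts (LiftedFig.fig LF1) → z ∈ (A1 ∷ G.vsTail A1 (lift A1 P A2)) → merge z ≡ w → z ≡ A1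
      meets₂  : a2 ≡ w → ∀ {z} → z ∈ G.figVerts (LiftedFig.fig LF2) → z ∈ (A1 ∷ G.vsTail A1 (lift A1 P A2)) → merge z ≡ w → z ≡ A2
      meets₁₂ : a1 ≡ w → P ≡ [] → ∀ {z} → z ∈ G.figVerts (LiftedFig.fig LF1) → z ∈ G.figVerts (LiftedFig.fig LF2) → merge z ≡ w →
                z ∈ (A1 ∷ G.vsTail A1 (lift A1 P A2))

  lift-handcuff : ∀ {a1 a2} (F1' : C.NegFig a1) P (F2' : C.NegFig a2) → C.IsHandcuff F1' P F2' →
                  ∀ {A1 A2} (LF1 : LiftedFig F1' A1) (LF2 : LiftedFig F2' A2) → Attached F1' P F2' LF1 LF2 →
                  G.IsHandcuff (LiftedFig.fig LF1) (lift A1 P A2) (LiftedFig.fig LF2)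
  lift-handcuff {a1} {a2} F1' P F2' (path' , edis' , c1' , c2' , c3') {A1} {A2} LF1 LF2 (attached f-used-once c1w c2w c3w) =
    (lift-walk P (proj₁ path') hA1 hA2 , Expands-unique expP (proj₂ path')) , edis , c1 , c2 , c3
    where
      module LF1 = LiftedFig LF1
      module LF2 = LiftedFig LF2
      hA1 = LF1.merge-anchor
      hA2 = LF2.merge-anchor
      expP : Expands (A1 ∷ G.vsTail A1 (lift A1 P A2)) (a1 ∷ C.vsTail a1 P)
      expP = lift-expands P (proj₁ path') hA1 hA2
      edis : ∀ e → e ∈ G.figEdges LF1.fig → e ∉ G.figEdges LF2.fig
      edis e i j with LF1.edges-over i | LF2.edges-over j
      ... | inj₂ i'   | inj₂ j'   = edis' e i' j'
      ... | inj₁ refl | inj₂ j'   = f∉contracted-fig F2' j'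
      ... | inj₂ i'   | inj₁ refl = f∉contracted-fig F1' i'
      ... | inj₁ refl | inj₁ refl = f-used-once i j
      c1 : ∀ z → z ∈ G.figVerts LF1.fig → z ∈ (A1 ∷ G.vsTail A1 (lift A1 P A2)) → z ≡ A1
      c1 z i j = anchored hA1 (c1' (merge z) (LF1.verts-over i) (Expands-∈ expP j)) (λ aw → c1w aw i j)
      c2 : ∀ z → z ∈ G.figVerts LF2.fig → z ∈ (A1 ∷ G.vsTail A1 (lift A1 P A2)) → z ≡ A2
      c2 z i j = anchored hA2 (c2' (merge z) (LF2.verts-over i) (Expands-∈ expP j)) (λ aw → c2w aw i j)
      c3 : ∀ z → z ∈ G.figVerts LF1.fig → z ∈ G.figVerts LF2.fig → z ∈ (A1 ∷ G.vsTail A1 (lift A1 P A2))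
      c3 z i j = path-or-anchor P refl
        where
          on-path = c3' (merge z) (LF1.verts-over i) (LF2.verts-over j)
          hz1 = c1' (merge z) (LF1.verts-over i) on-path
          hz2 = c2' (merge z) (LF2.verts-over j) on-path
          path-or-anchor : ∀ Q → Q ≡ P → z ∈ (A1 ∷ G.vsTail A1 (lift A1 P A2))
          path-or-anchor (_ ∷ _) Q≡P =
            ⊥-elim (nonempty-path-ends-distinct path' (λ P≡[] → ∷≢[] (≡.trans Q≡P P≡[])) (≡.trans (≡.sym hz1) hz2))
          path-or-anchor []      Q≡P with a1 ≟ w
          ... | yes a≡w = c3w a≡w (≡.sym Q≡P) i j (≡.trans hz1 a≡w)
          ... | no a≢w  = here (merge-injective (≡.trans hz1 (≡.sym hA1)) (λ e → a≢w (≡.trans (≡.sym hz1) e)))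

  liftHandcuff : ∀ {a1 a2} (F1' : C.NegFig a1) P (F2' : C.NegFig a2) (H' : C.IsHandcuff F1' P F2') →
                 ∀ {A1 A2} (LF1 : LiftedFig F1' A1) (LF2 : LiftedFig F2' A2) → Attached F1' P F2' LF1 LF2 →
                 C.cuffgain ψ F1' P F2' ≈ 0#
  liftHandcuff F1' P F2' H' {A1} {A2} LF1 LF2 att =
    cuffgain-lift F1' LF1.fig P (lift A1 P A2) F2' LF2.fig LF1.merge-anchor LF2.merge-anchor LF1.fig-lifts LF2.fig-lifts
      (lift-lifts P walk LF1.merge-anchor LF2.merge-anchor) (lift-walk P walk LF1.merge-anchor LF2.merge-anchor) walk
      (handcuff≈0 A1 A2 LF1.fig (lift A1 P A2) LF2.fig (lift-handcuff F1' P F2' H' LF1 LF2 att))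
    where
      module LF1 = LiftedFig LF1
      module LF2 = LiftedFig LF2
      walk = proj₁ (proj₁ H')

  module SeparatedCuff {a1 a2} (F1' : C.NegFig a1) (g0 : Fin m) (d0 : Dir) (P0 : G.Steps) (F2' : C.NegFig a2)
            (H' : C.IsHandcuff F1' ((g0 , d0) ∷ P0) F2') where
    P : G.Steps
    P = (g0 , d0) ∷ P0
    pth' : C.IsPath a1 P a2
    pth' = proj₁ H'
    wkP : C.IsWalk a1 P a2
    wkP = proj₁ pth'
    c1' = proj₁ (proj₂ (proj₂ H'))
    c2' = proj₁ (proj₂ (proj₂ (proj₂ H')))
    c3' = proj₂ (proj₂ (proj₂ (proj₂ H')))
    a1≢a2 : a1 ≢ a2
    a1≢a2 = nonempty-path-ends-distinct {a1} {P} {a2} pth' ∷≢[]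
    p1 = figStart F1'
    q1 = figEnd F1'
    p2 = figStart F2'
    q2 = figEnd F2'
    P-first = first-step-in-G {g0} {d0} {P0} wkP
    P-start = proj₁ P-first
    P-first-step : stepFrom (ends g0) d0 ≡ just (P-start , proj₁ (proj₂ P-first) , proj₁ (proj₂ (proj₂ P-first)))
    P-first-step = proj₂ (proj₂ (proj₂ P-first))
    merge-P-start : merge P-start ≡ a1
    merge-P-start = proj₁ (proj₂ (first-step-matches wkP P-first-step))
    P-end = liftEnd P-start P
    liftStart-P : ∀ x → liftStart x P ≡ P-start
    liftStart-P x = departure-step {x = x} P-first-step
    liftEnd-P : ∀ x → liftEnd x P ≡ P-end
    liftEnd-P x = ≡.trans (liftEnd-∷ P0 x P-first-step) (≡.sym (liftEnd-∷ P0 P-start P-first-step))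
    merge-P-end : merge P-end ≡ a2
    merge-P-end = merge-liftEnd P wkP merge-P-start

    f-used-once : ∀ {A1 A2} (LF1 : LiftedFig F1' A1) (LF2 : LiftedFig F2' A2) → f ∈ G.figEdges (LiftedFig.fig LF1) → f ∈ G.figEdges (LiftedFig.fig LF2) → ⊥
    f-used-once LF1 LF2 i j = a1≢a2 (≡.trans (≡.sym h1) h2)
      where
        w3 = c3' w (LiftedFig.f-through-w LF1 i) (LiftedFig.f-through-w LF2 j)
        h1 = c1' w (LiftedFig.f-through-w LF1 i) w3
        h2 = c2' w (LiftedFig.f-through-w LF2 j) w3

    closed-meets₁ : ∀ (cl : p1 ≡ q1) {A2} (LF1 : LiftedFig F1' p1) → a1 ≡ w → ∀ {z} → z ∈ G.figVerts (LiftedFig.fig LF1) →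
                 z ∈ (p1 ∷ G.vsTail p1 (lift p1 P A2)) → merge z ≡ w → z ≡ p1
    closed-meets₁ cl LF1 aw i j hz with LiftedFig.verts-over-w LF1 aw i hz
    ... | inj₁ e = e
    ... | inj₂ e = ≡.trans e (≡.sym cl)

    open-meets₁ : ∀ {A2} → merge A2 ≡ a2 → (LF1 : LiftedFig F1' P-start) → a1 ≡ w → ∀ {z} → z ∈ G.figVerts (LiftedFig.fig LF1) →
               z ∈ (P-start ∷ G.vsTail P-start (lift P-start P A2)) → merge z ≡ w → z ≡ P-start
    open-meets₁ hA2 LF1 aw i (here e) hz = e
    open-meets₁ {A2} hA2 LF1 aw {z} i (there j) hz with lift-vertex-over-w P wkP {P-start} {A2} merge-P-start hA2 j hz
    ... | inj₁ (ne , _) = ⊥-elim (ne (≡.sym (liftStart-P P-start)))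
    ... | inj₂ (inj₁ e) = ⊥-elim (a1≢a2 (≡.trans aw (≡.trans (≡.sym hz) (≡.trans (cong merge e) hA2))))
    ... | inj₂ (inj₂ (inj₁ e)) = ⊥-elim (a1≢a2 (≡.trans aw (≡.trans (≡.sym hz) (≡.trans (cong merge (≡.trans e (liftEnd-P P-start))) merge-P-end))))
    ... | inj₂ (inj₂ (inj₂ k)) = ⊥-elim (start∉interior {a1} {P} (proj₂ pth') (≡.subst (_∈ interior a1 P) (≡.sym aw) k))

    closed-meets₂ : ∀ (cl : p2 ≡ q2) {A1} (LF2 : LiftedFig F2' p2) → a2 ≡ w → ∀ {z} → z ∈ G.figVerts (LiftedFig.fig LF2) →
                 z ∈ (A1 ∷ G.vsTail A1 (lift A1 P p2)) → merge z ≡ w → z ≡ p2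
    closed-meets₂ cl LF2 aw i j hz with LiftedFig.verts-over-w LF2 aw i hz
    ... | inj₁ e = e
    ... | inj₂ e = ≡.trans e (≡.sym cl)

    open-meets₂ : ∀ {A1} → merge A1 ≡ a1 → (LF2 : LiftedFig F2' P-end) → a2 ≡ w → ∀ {z} → z ∈ G.figVerts (LiftedFig.fig LF2) →
               z ∈ (A1 ∷ G.vsTail A1 (lift A1 P P-end)) → merge z ≡ w → z ≡ P-end
    open-meets₂ hA1 LF2 aw i (here e) hz = ⊥-elim (a1≢a2 (≡.trans (≡.sym hA1) (≡.trans (cong merge (≡.sym e)) (≡.trans hz (≡.sym aw)))))
    open-meets₂ {A1} hA1 LF2 aw {z} i (there j) hz with lift-vertex-over-w P wkP {A1} {P-end} hA1 merge-P-end j hz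
    ... | inj₁ (_ , e) = ⊥-elim (a1≢a2 (≡.trans (≡.sym (merge-liftStart P wkP hA1)) (≡.trans (cong merge (≡.sym e)) (≡.trans hz (≡.sym aw)))))
    ... | inj₂ (inj₁ e) = e
    ... | inj₂ (inj₂ (inj₁ e)) = ≡.trans e (liftEnd-P A1)
    ... | inj₂ (inj₂ (inj₂ k)) = ⊥-elim (end∉interior wkP (Unique-tail (proj₂ pth')) (≡.subst (_∈ interior a1 P) (≡.sym aw) k))

    no-tight-meeting : ∀ {A1 A2} (LF1 : LiftedFig F1' A1) (LF2 : LiftedFig F2' A2) → a1 ≡ w → P ≡ [] → ∀ {z} →
               z ∈ G.figVerts (LiftedFig.fig LF1) → z ∈ G.figVerts (LiftedFig.fig LF2) → merge z ≡ w → z ∈ (A1 ∷ G.vsTail A1 (lift A1 P A2))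
    no-tight-meeting LF1 LF2 aw () i j hz

    start-anchor : p1 ≢ q1 → P-start ≡ p1 ⊎ P-start ≡ q1
    start-anchor ne = third-over-w (≡.trans (merge-figStart F1') aw) (≡.trans (merge-figEnd F1') aw) (≡.trans merge-P-start aw) ne
      where aw = opens⇒at-w F1' ne

    end-anchor : p2 ≢ q2 → P-end ≡ p2 ⊎ P-end ≡ q2
    end-anchor ne = third-over-w (≡.trans (merge-figStart F2') aw) (≡.trans (merge-figEnd F2') aw) (≡.trans merge-P-end aw) ne
      where aw = opens⇒at-w F2' ne

    neutral-cuff : C.cuffgain ψ F1' P F2' ≈ 0#
    neutral-cuff with p1 ≟ q1 | p2 ≟ q2
    ... | yes cl1 | yes cl2 =
      liftHandcuff F1' P F2' H' LF1 LF2 $ attached (f-used-once LF1 LF2) (closed-meets₁ cl1 LF1) (closed-meets₂ cl2 LF2) (no-tight-meeting LF1 LF2)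
      where LF1 = liftFig F1' p1 (inj₁ refl)
            LF2 = liftFig F2' p2 (inj₁ refl)
    ... | no op1 | yes cl2 =
      liftHandcuff F1' P F2' H' LF1 LF2 $ attached (f-used-once LF1 LF2) (open-meets₁ (merge-figStart F2') LF1) (closed-meets₂ cl2 LF2) (no-tight-meeting LF1 LF2)
      where LF1 = liftFig F1' P-start (start-anchor op1)
            LF2 = liftFig F2' p2 (inj₁ refl)
    ... | yes cl1 | no op2 =
      liftHandcuff F1' P F2' H' LF1 LF2 $ attached (f-used-once LF1 LF2) (closed-meets₁ cl1 LF1) (open-meets₂ (merge-figStart F1') LF2) (no-tight-meeting LF1 LF2)
      where LF1 = liftFig F1' p1 (inj₁ refl)
            LF2 = liftFig F2' P-end (end-anchor op2)
    ... | no op1 | no op2 =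
      liftHandcuff F1' P F2' H' LF1 LF2 $ attached (f-used-once LF1 LF2) (open-meets₁ merge-P-end LF1) (open-meets₂ merge-P-start LF2) (no-tight-meeting LF1 LF2)
      where LF1 = liftFig F1' P-start (start-anchor op1)
            LF2 = liftFig F2' P-end (end-anchor op2)

  closed-fig-over-w : ∀ {a} {F' : C.NegFig a} {A} (LF : LiftedFig F' A) → figStart F' ≡ figEnd F' → A ≡ figStart F' → a ≡ w →
             ∀ {z} → z ∈ G.figVerts (LiftedFig.fig LF) → merge z ≡ w → z ≡ A
  closed-fig-over-w LF pq Ap aw i hz with LiftedFig.verts-over-w LF aw i hz
  ... | inj₁ e = ≡.trans e (≡.sym Ap)
  ... | inj₂ e = ≡.trans e (≡.trans (≡.sym pq) (≡.sym Ap))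

  ++-circle : ∀ {x y L1 M} → G.IsWalk x L1 y → G.IsWalk y M x → L1 ≢ [] →
                Unique (G.vsTail x L1) → Unique (G.vsTail y M) → (∀ {z} → z ∈ G.vsTail x L1 → z ∈ G.vsTail y M → ⊥) →
                Unique (G.edgesOf L1) → Unique (G.edgesOf M) → (∀ {e} → e ∈ G.edgesOf L1 → e ∈ G.edgesOf M → ⊥) →
                G.IsCircle x (L1 ++ M)
  ++-circle {x} {y} {L1} {M} w1 w2 ne u1 u2 d uE1 uE2 dE =
    G.walk-++ w1 w2 ,
    (λ e → ne (List.++-conicalˡ L1 M e)) ,
    ≡.subst Unique (≡.sym (G.edgesOf-++ L1 M)) (UP.++⁺ uE1 uE2 (λ { (i , j) → dE i j })) ,
    ≡.subst Unique (≡.sym (≡.trans (G.vsTail-++ x L1 M) (cong (λ q → G.vsTail x L1 ++ G.vsTail q M) (G.walk-end w1))))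
      (UP.++⁺ u1 u2 (λ { (i , j) → d i j }))


  gain-rev-negative : ∀ {a W} → C.IsWalk a W a → C.walkSign W ≡ neg → C.gain ψ (C.revSteps W) ≈ C.gain ψ W
  gain-rev-negative {a} {W} walk sg = ≈-trans (C.gain-rev ψ walk) (≈-trans (-‿cong (≈-reflexive (cong (_⊙ C.gain ψ W) sg))) (-‿involutive _))

  module TightCuff {a} (F1' : C.NegFig a) (F2' : C.NegFig a) (H' : C.IsHandcuff F1' [] F2') where
    c3' = proj₂ (proj₂ (proj₂ (proj₂ H')))
    p1 = figStart F1'
    q1 = figEnd F1'
    p2 = figStart F2'
    q2 = figEnd F2'

    f-used-once : ∀ {A1 A2} (LF1 : LiftedFig F1' A1) (LF2 : LiftedFig F2' A2) → (p1 ≡ q1 ⊎ p2 ≡ q2) →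
            f ∈ G.figEdges (LiftedFig.fig LF1) → f ∈ G.figEdges (LiftedFig.fig LF2) → ⊥
    f-used-once LF1 LF2 cl i j with a ≟ w | cl
    ... | yes aw | inj₁ c = LiftedFig.f-absent LF1 c aw i
    ... | yes aw | inj₂ c = LiftedFig.f-absent LF2 c aw j
    ... | no naw | _ with c3' w (LiftedFig.f-through-w LF1 i) (LiftedFig.f-through-w LF2 j)
    ...   | here e = naw (≡.sym e)

    trivial-lift-vertices : ∀ A → (A ∷ G.vsTail A (lift A [] A)) ≡ [ A ]
    trivial-lift-vertices A = cong (λ L → A ∷ G.vsTail A L) (bridge-refl A)

    ∈-trivial-lift : ∀ {A z} → z ∈ (A ∷ G.vsTail A (lift A [] A)) → z ≡ A
    ∈-trivial-lift {A} {z} j with ≡.subst (z ∈_) (trivial-lift-vertices A) j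
    ... | here e = e

    both-closed : p1 ≡ q1 → p2 ≡ q2 → C.cuffgain ψ F1' [] F2' ≈ 0#
    both-closed cl1 cl2 =
      liftHandcuff F1' [] F2' H' LF1 LF2 $ attached (f-used-once LF1 LF2 (inj₁ cl1))
        (λ aw i j hz → closed-fig-over-w LF1 cl1 refl aw i hz)
        (λ aw i j hz → closed-fig-over-w LF2 cl2 refl aw i hz)
        (λ aw _ i j hz → here (closed-fig-over-w LF1 cl1 refl aw i hz))
      where LF1 = liftFig F1' p1 (inj₁ refl)
            LF2 = liftFig F2' p2 (inj₁ refl)

    first-open : p1 ≢ q1 → p2 ≡ q2 → C.cuffgain ψ F1' [] F2' ≈ 0#
    first-open op1 cl2 =
      liftHandcuff F1' [] F2' H' LF1 LF2 $ attached (f-used-once LF1 LF2 (inj₂ cl2))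
        (λ aw i j hz → ∈-trivial-lift j)
        (λ aw i j hz → closed-fig-over-w LF2 cl2 refl aw i hz)
        (λ aw _ i j hz → here (closed-fig-over-w LF2 cl2 refl aw j hz))
      where aw = opens⇒at-w F1' op1
            LF1 = liftFig F1' p2 (third-over-w (≡.trans (merge-figStart F1') aw) (≡.trans (merge-figEnd F1') aw) (≡.trans (merge-figStart F2') aw) op1)
            LF2 = liftFig F2' p2 (inj₁ refl)

    second-open : p1 ≡ q1 → p2 ≢ q2 → C.cuffgain ψ F1' [] F2' ≈ 0#
    second-open cl1 op2 =
      liftHandcuff F1' [] F2' H' LF1 LF2 $ attached (f-used-once LF1 LF2 (inj₁ cl1))
        (λ aw i j hz → closed-fig-over-w LF1 cl1 refl aw i hz)
        (λ aw i j hz → ∈-trivial-lift j)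
        (λ aw _ i j hz → here (closed-fig-over-w LF1 cl1 refl aw i hz))
      where aw = opens⇒at-w F2' op2
            LF1 = liftFig F1' p1 (inj₁ refl)
            LF2 = liftFig F2' p1 (third-over-w (≡.trans (merge-figStart F2') aw) (≡.trans (merge-figEnd F2') aw) (≡.trans (merge-figStart F1') aw) op2)

  record OpenArc {a} (W : G.Steps) (p q : Fin n) : Set ℓ where
    field
      arc-walk : G.IsWalk p (lift p W q) q
      arc-unique : Unique (G.vsTail p (lift p W q))
      arc-over-w : ∀ {z} → z ∈ G.vsTail p (lift p W q) → merge z ≡ w → z ≡ q
      arc-over : ∀ {z} → z ∈ G.vsTail p (lift p W q) → merge z ∈ C.vsTail a W
      arc-edges : ∀ {e} → e ∈ G.edgesOf (lift p W q) → e ∈ C.edgesOf W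
      arc-edges-unique : Unique (G.edgesOf (lift p W q))
      arc-lifts : Lifts p (lift p W q) W q
      merge-start : merge p ≡ a
      merge-end : merge q ≡ a
      arc-nonempty : lift p W q ≢ []

  openArc : ∀ {a} g d R (c : C.IsCircle a ((g , d) ∷ R)) sg → a ≡ w →
           OpenArc {a} ((g , d) ∷ R) (figStart (C.circF ((g , d) ∷ R) c sg)) (figEnd (C.circF ((g , d) ∷ R) c sg))
  openArc {a} g d R c sg aw with first-step-in-G (proj₁ c)
  ... | xs , r , y , step = record
      { arc-walk = lift-walk W walk hp hq
      ; arc-unique = ≡.subst (λ x → Unique (G.vsTail x (lift x W q))) (≡.sym p≡) (lift-vertices-unique g d R walk step uv hq)
      ; arc-over-w = λ i hz → vw (lift-vertex-over-w W walk hp hq i hz)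
      ; arc-over = λ i → ∈-closed-walk {a} {W} walk ∷≢[] (Expands-∈ (lift-expands W walk hp hq) (there i))
      ; arc-edges = λ i → ee (lift-edges W p q i) i
      ; arc-edges-unique = ≡.subst (λ x → Unique (G.edgesOf (lift x W q))) (≡.sym p≡) (lift-edges-unique g d R walk step uv ue hq)
      ; arc-lifts = lift-lifts W walk hp hq
      ; merge-start = hp
      ; merge-end = hq
      ; arc-nonempty = λ e → ∷≢[] (≡.trans (≡.sym (≡.subst (λ x → lift x W q ≡ (g , d) ∷ lift y R q) (≡.sym p≡) (lift-from-departure R q step))) e)
      }
    where
      W = (g , d) ∷ R
      F' = C.circF W c sg
      walk = proj₁ c
      ue = proj₁ (proj₂ (proj₂ c))
      uv = proj₂ (proj₂ (proj₂ c))
      p = figStart F'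
      q = figEnd F'
      p≡ : p ≡ xs
      p≡ = departure-step {x = a} step
      hp : merge p ≡ a
      hp = merge-figStart F'
      hq : merge q ≡ a
      hq = merge-figEnd F'
      st≡ : liftStart p W ≡ p
      st≡ = ≡.trans (departure-step {x = p} step) (≡.sym p≡)
      en≡ : liftEnd p W ≡ q
      en≡ = cong (λ x → liftEnd x R) (≡.trans (G.next-step {p} step) (≡.sym (G.next-step {departure g d a} step)))
      a∉ : a ∉ interior a W
      a∉ = end∉interior walk uv
      vw : ∀ {z} → OverWAt a W p q z → z ≡ q
      vw (inj₁ (ne , _)) = ⊥-elim (ne (≡.sym st≡))
      vw (inj₂ (inj₁ e)) = e
      vw (inj₂ (inj₂ (inj₁ e))) = ≡.trans e en≡
      vw (inj₂ (inj₂ (inj₂ k))) = ⊥-elim (a∉ (≡.subst (_∈ interior a W) (≡.sym aw) k))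
      ee : ∀ {e} → e ≡ f ⊎ e ∈ C.edgesOf W → e ∈ G.edgesOf (lift p W q) → e ∈ C.edgesOf W
      ee (inj₂ j) _ = j
      ee (inj₁ refl) i with f∈lift W walk hp hq i
      ... | inj₁ ne = ⊥-elim (ne (≡.sym st≡))
      ... | inj₂ (inj₁ ne) = ⊥-elim (ne en≡)
      ... | inj₂ (inj₂ k) = ⊥-elim (a∉ (≡.subst (_∈ interior a W) (≡.sym aw) k))

  -- Two negative circles at w whose lifts both open up into v–w arcs: joined, the arcs form a positive circle.
  module OpenTightCuff {a} g1 d1 R1 (c1 : C.IsCircle a ((g1 , d1) ∷ R1)) (sg1 : C.walkSign ((g1 , d1) ∷ R1) ≡ neg)
                       g2 d2 R2 (c2 : C.IsCircle a ((g2 , d2) ∷ R2)) (sg2 : C.walkSign ((g2 , d2) ∷ R2) ≡ neg)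
                       (H' : C.IsHandcuff (C.circF ((g1 , d1) ∷ R1) c1 sg1) [] (C.circF ((g2 , d2) ∷ R2) c2 sg2))
                       (op1 : figStart (C.circF ((g1 , d1) ∷ R1) c1 sg1) ≢ figEnd (C.circF ((g1 , d1) ∷ R1) c1 sg1))
                       (op2 : figStart (C.circF ((g2 , d2) ∷ R2) c2 sg2) ≢ figEnd (C.circF ((g2 , d2) ∷ R2) c2 sg2)) where
    W1 = (g1 , d1) ∷ R1
    W2 = (g2 , d2) ∷ R2
    F1' = C.circF W1 c1 sg1
    F2' = C.circF W2 c2 sg2
    p1 = figStart F1'
    q1 = figEnd F1'
    p2 = figStart F2'
    q2 = figEnd F2'
    edis' = proj₁ (proj₂ H')
    c3' = proj₂ (proj₂ (proj₂ (proj₂ H')))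
    aw : a ≡ w
    aw = opens⇒at-w F1' op1
    A = openArc g1 d1 R1 c1 sg1 aw
    B = openArc g2 d2 R2 c2 sg2 aw
    module A = OpenArc A
    L1 = lift p1 W1 q1

    over-w : ∀ {x} → merge x ≡ a → merge x ≡ w
    over-w h = ≡.trans h aw

    meet-over-w : ∀ {z} → z ∈ G.vsTail p1 L1 → merge z ∈ C.vsTail a W2 → merge z ≡ w
    meet-over-w i j with c3' _ (A.arc-over i) j
    ... | here e = ≡.trans e aw

    closes : ∀ {M W} → G.IsWalk q1 M p1 → Unique (G.vsTail q1 M) → (∀ {z} → z ∈ G.vsTail p1 L1 → z ∈ G.vsTail q1 M → ⊥) →
             Unique (G.edgesOf M) → (∀ {e} → e ∈ G.edgesOf L1 → e ∈ G.edgesOf M → ⊥) →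
             Lifts q1 M W p1 → C.walkSign W ≡ neg → C.gain ψ (W1 ++ W) ≈ 0#
    closes {M} {W} walk u disjoint ue edisjoint lifted negative =
      ≈-trans (Lifts.gain≈ joined) (≈0⇒⊙≈0 (twist p1) (positive-circle≈0 p1 (L1 ++ M) circle positive))
      where
        joined : Lifts p1 (L1 ++ M) (W1 ++ W) p1
        joined = lifts-++ A.arc-lifts lifted
        circle : G.IsCircle p1 (L1 ++ M)
        circle = ++-circle A.arc-walk walk A.arc-nonempty A.arc-unique u disjoint A.arc-edges-unique ue edisjoint
        positive : G.walkSign (L1 ++ M) ≡ pos
        positive = ≡.trans (≡.sym (a*[b*a]≡b (twist p1) (G.walkSign (L1 ++ M))))
                     (≡.trans (≡.sym (Lifts.sign≡ joined)) (≡.trans (C.walkSign-++ W1 W) (cong₂ _*ₛ_ sg1 negative)))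

    crossing : p2 ≡ q1 → C.gain ψ (W1 ++ W2) ≈ 0#
    crossing p2≡q1 =
      closes B'.arc-walk B'.arc-unique (λ i j → op1 (≡.trans (≡.sym (B'.arc-over-w j (hz i j))) (A.arc-over-w i (hz i j)))) B'.arc-edges-unique
             (λ i j → edis' _ (A.arc-edges i) (B'.arc-edges j)) B'.arc-lifts sg2
      where
        q2≡p1 : q2 ≡ p1
        q2≡p1 with third-over-w (over-w {p1} A.merge-start) (over-w {q1} A.merge-end) (over-w {q2} (OpenArc.merge-end B)) op1
        ... | inj₁ h = h
        ... | inj₂ h = ⊥-elim (op2 (≡.trans p2≡q1 (≡.sym h)))
        B' = ≡.subst₂ (OpenArc W2) p2≡q1 q2≡p1 B
        module B' = OpenArc B'
        hz : ∀ {z} → z ∈ G.vsTail p1 L1 → z ∈ G.vsTail q1 (lift q1 W2 p1) → merge z ≡ w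
        hz i j = meet-over-w i (B'.arc-over j)

    parallel : p2 ≢ q1 → C.gain ψ (W1 ++ W2) ≈ 0#
    parallel p2≢q1 = ≈-trans reversed (closes (G.walk-rev B'.arc-walk) (Unique-tail up) disjoint
                                        (G.edgesOf-rev-unique L2 B'.arc-edges-unique)
                                        (λ i j → edis' _ (A.arc-edges i) (B'.arc-edges (G.∈-edgesOf-rev L2 j)))
                                        (lifts-rev B'.arc-walk walk2 B'.arc-lifts) (≡.trans (C.walkSign-rev W2) sg2))
      where
        p2≡p1 : p2 ≡ p1
        p2≡p1 with third-over-w (over-w {p1} A.merge-start) (over-w {q1} A.merge-end) (over-w {p2} (OpenArc.merge-start B)) op1
        ... | inj₁ h = h
        ... | inj₂ h = ⊥-elim (p2≢q1 h)
        q2≡q1 : q2 ≡ q1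
        q2≡q1 with third-over-w (over-w {p1} A.merge-start) (over-w {q1} A.merge-end) (over-w {q2} (OpenArc.merge-end B)) op1
        ... | inj₁ h = ⊥-elim (op2 (≡.trans p2≡p1 (≡.sym h)))
        ... | inj₂ h = h
        B' = ≡.subst₂ (OpenArc W2) p2≡p1 q2≡q1 B
        module B' = OpenArc B'
        L2 = lift p1 W2 q1
        walk2 : C.IsWalk (merge p1) W2 (merge q1)
        walk2 = ≡.subst₂ (λ x y → C.IsWalk x W2 y) (≡.sym A.merge-start) (≡.sym A.merge-end) (proj₁ c2)
        up : Unique (q1 ∷ G.vsTail q1 (G.revSteps L2))
        up = G.path-rev B'.arc-walk (Unique-∷ (λ i → op1 (B'.arc-over-w i (over-w {p1} A.merge-start))) B'.arc-unique)
        disjoint : ∀ {z} → z ∈ G.vsTail p1 L1 → z ∈ G.vsTail q1 (G.revSteps L2) → ⊥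
        disjoint {z} i j = on-B (G.∈-vsTail-rev B'.arc-walk j)
          where
            on-B : z ∈ (p1 ∷ G.vsTail p1 L2) → ⊥
            on-B (here e)  = op1 (≡.trans (≡.sym e) (A.arc-over-w i (≡.trans (cong merge e) (over-w {p1} A.merge-start))))
            on-B (there k) = Unique[x∷xs]⇒x∉xs up (≡.subst (_∈ G.vsTail q1 (G.revSteps L2)) (A.arc-over-w i (meet-over-w i (B'.arc-over k))) j)
        reversed : C.gain ψ (W1 ++ W2) ≈ C.gain ψ (W1 ++ C.revSteps W2)
        reversed = ≈-trans (C.gain-++ ψ W1 W2)
                     (≈-trans (+-congˡ (⊙-cong (C.walkSign W1) (≈-sym (gain-rev-negative (proj₁ c2) sg2))))
                              (≈-sym (C.gain-++ ψ W1 (C.revSteps W2))))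

    neutral-cuff : C.gain ψ (W1 ++ (W2 ++ [])) ≈ 0#
    neutral-cuff with p2 ≟ q1
    ... | yes p2≡q1 = ≡.subst (λ X → C.gain ψ (W1 ++ X) ≈ 0#) (≡.sym (List.++-identityʳ W2)) (crossing p2≡q1)
    ... | no p2≢q1  = ≡.subst (λ X → C.gain ψ (W1 ++ X) ≈ 0#) (≡.sym (List.++-identityʳ W2)) (parallel p2≢q1)

  tightCuff-neutral : ∀ {a} (F1' F2' : C.NegFig a) → C.IsHandcuff F1' [] F2' → C.cuffgain ψ F1' [] F2' ≈ 0#
  tightCuff-neutral F1' F2' H' with figStart F1' ≟ figEnd F1' | figStart F2' ≟ figEnd F2'
  ... | yes cl1 | yes cl2 = TightCuff.both-closed F1' F2' H' cl1 cl2
  ... | no op1 | yes cl2 = TightCuff.first-open F1' F2' H' op1 cl2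
  ... | yes cl1 | no op2 = TightCuff.second-open F1' F2' H' cl1 op2
  tightCuff-neutral (C.halfF e hr) F2' H' | no op1 | no op2 = ⊥-elim (op1 refl)
  tightCuff-neutral (C.circF [] c1 sg1) F2' H' | no op1 | no op2 = ⊥-elim (proj₁ (proj₂ c1) refl)
  tightCuff-neutral (C.circF (_ ∷ _) c1 sg1) (C.halfF e hr) H' | no op1 | no op2 = ⊥-elim (op2 refl)
  tightCuff-neutral (C.circF (_ ∷ _) c1 sg1) (C.circF [] c2 sg2) H' | no op1 | no op2 = ⊥-elim (proj₁ (proj₂ c2) refl)
  tightCuff-neutral (C.circF ((g1 , d1) ∷ R1) c1 sg1) (C.circF ((g2 , d2) ∷ R2) c2 sg2) H' | no op1 | no op2 =
    OpenTightCuff.neutral-cuff g1 d1 R1 c1 sg1 g2 d2 R2 c2 sg2 H' op1 op2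

  cuff-neutral : ∀ a1 a2 (F1' : C.NegFig a1) P (F2' : C.NegFig a2) → C.IsHandcuff F1' P F2' → C.cuffgain ψ F1' P F2' ≈ 0#
  cuff-neutral a1 a2 F1' [] F2' H' with proj₁ (proj₁ H')
  ... | refl = tightCuff-neutral F1' F2' H'
  cuff-neutral a1 a2 F1' ((g0 , d0) ∷ P0) F2' H' = SeparatedCuff.neutral-cuff F1' g0 d0 P0 F2' H'

  reattach-loose⁻¹ : ∀ E → reattach E ≡ loose → E ≡ loose
  reattach-loose⁻¹ loose _ = refl
  reattach-loose⁻¹ (two _ _ _ _) ()
  reattach-loose⁻¹ (half _ _) ()

  circle-neutral : ∀ u W' → C.IsCircle u W' → C.walkSign W' ≡ pos → C.gain ψ W' ≈ 0#
  circle-neutral u [] c sp = ⊥-elim (proj₁ (proj₂ c) refl)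
  circle-neutral u ((g , d) ∷ R) c sp with first-step-in-G (proj₁ c)
  ... | xs , r , y , step = ≈-trans (Lifts.gain≈ (lift-lifts W' walk {xs} {xs} hxs hxs)) (≈0⇒⊙≈0 (twist xs) (positive-circle≈0 xs (lift xs W' xs) (lift-circle-at-departure g d R c step)
                             (≡.trans (lift-sign-closed W' walk {xs} hxs) sp)))
    where
      W' = (g , d) ∷ R
      walk = proj₁ c
      hxs = proj₁ (proj₂ (first-step-matches walk step))

  contracted-hyperbalanced : GainGraph.Hyperbalanced K contracted ψ
  contracted-hyperbalanced = looseP , (λ u W' c sp → ≈-trans (C.walkGain≈gain W') (circle-neutral u W' c sp)) ,
         (λ a1 a2 F1' P F2' H' → ≈-trans (C.handcuffGain≈cuffgain F1' P F2') (cuff-neutral a1 a2 F1' P F2' H'))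
    where
      looseP : ∀ e → contracted e ≡ loose → ψ e ≈ 0#
      looseP e h with e ≟ f
      ... | yes refl = ψf≈0
      ... | no ne = loose≈0 e (reattach-loose⁻¹ (ends e) h)

-- Induction on the number of non-loose edges

-- Switch at v so that the link f = vw becomes neutral, then contract it.
module ContractLink {c ℓ} (K : Field c ℓ) {n m : ℕ} (ends : Fin m → Ends n) (φ : Fin m → Field.Carrier K)
                    (hyp : GainGraph.Hyperbalanced K ends φ)
                    (f : Fin m) (v w : Fin n) (s t : Sign) (hf : ends f ≡ two v s w t) (v≢w : v ≢ w) where
  open Field K renaming (refl to ≈-refl; sym to ≈-sym; trans to ≈-trans; reflexive to ≈-reflexive)
  open SetoidReasoning setoid
  open Walks K ends φ
  open RingProperties ring using (-0#≈0#; -‿involutive)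

  θ-f : Fin n → Carrier
  θ-f x with x ≟ v
  ... | yes _ = - (s ⊙ φ f)
  ... | no _  = 0#

  θ-f-v : θ-f v ≡ - (s ⊙ φ f)
  θ-f-v with v ≟ v
  ... | yes _  = refl
  ... | no v≢v = ⊥-elim (v≢v refl)

  θ-f-w : θ-f w ≡ 0#
  θ-f-w with w ≟ v
  ... | yes w≡v = ⊥-elim (v≢w (≡.sym w≡v))
  ... | no _    = refl

  ψ : Fin m → Carrier
  ψ = switch φ θ-f

  ψf≈0 : ψ f ≈ 0#
  ψf≈0 = ≡.subst (λ E → switchEnds (φ f) θ-f E ≈ 0#) (≡.sym hf) at-f
    where
      at-f : switchEnds (φ f) θ-f (two v s w t) ≈ 0#
      at-f rewrite θ-f-v | θ-f-w = begin
        (s ⊙ - (s ⊙ φ f) + φ f) + t ⊙ 0#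
          ≈⟨ +-cong (+-congʳ (≈-trans (⊙-‿comm s (s ⊙ φ f)) (-‿cong (⊙-involutive s (φ f))))) (⊙-zero t) ⟩
        (- φ f + φ f) + 0#
          ≈⟨ ≈-trans (+-identityʳ _) (-‿inverseˡ (φ f)) ⟩
        0# ∎

  neutral : CircuitsNeutral ψ
  neutral = Equivalence.to (neutral⇔neutral-switch φ θ-f) (Equivalence.to hyperbalanced⇔neutral hyp)

  open Contraction K ends φ ψ f v w s t hf v≢w ψf≈0 neutral
    using (reattach; merge; twist; ε; merge-v; merge-w; twist-v; twist-w)
  open Contraction K ends φ ψ f v w s t hf v≢w ψf≈0 neutral public
    using (contracted; contracted-f; contracted-≢f; contracted-hyperbalanced)

  -- A switcher θ' of the contraction pulls back along the merge, up to the twist at v.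
  pull-back : (θ' : Fin n → Carrier) → (∀ e → Walks.switch K contracted ψ ψ θ' e ≈ 0#) →
              Σ (Fin n → Carrier) λ θ → ∀ e → switch φ θ e ≈ 0#
  pull-back θ' Z' = (λ z → θ-f z + θ₁ z) , λ e → ≈-trans (≈-sym (switchEnds-+ (φ e) θ-f θ₁ (ends e))) (neutralised e)
    where
      θ₁ : Fin n → Carrier
      θ₁ x = twist x ⊙ θ' (merge x)
      twisted : ∀ a r → r ⊙ θ₁ a ≈ (twist a *ₛ r) ⊙ θ' (merge a)
      twisted a r = ≈-trans (⊙-⊙ r (twist a) _) (≈-reflexive (cong (_⊙ θ' (merge a)) (Sign.*-comm r (twist a))))
      switch-reattach : ∀ E x → switchEnds x θ₁ E ≈ Walks.switchEnds K contracted ψ x θ' (reattach E)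
      switch-reattach (two a r b q) x = +-cong (+-congʳ (twisted a r)) (twisted b q)
      switch-reattach (half a r)    x = +-congʳ (twisted a r)
      switch-reattach loose         x = ≈-refl
      neutralised : ∀ e → switchEnds (ψ e) θ₁ (ends e) ≈ 0#
      neutralised e with e ≟ f
      ... | yes refl = ≡.subst (λ E → switchEnds (ψ f) θ₁ E ≈ 0#) (≡.sym hf) at-f
        where
          at-f : switchEnds (ψ f) θ₁ (two v s w t) ≈ 0#
          at-f rewrite twist-v | merge-v | twist-w | merge-w = begin
            (s ⊙ ε ⊙ θ' w + ψ f) + t ⊙ θ' w
              ≈⟨ +-congʳ (+-cong (≈-trans (⊙-⊙ s ε (θ' w)) (≈-trans (≈-reflexive (cong (_⊙ θ' w) (flip s t)))
                                                                      (⊙-opposite t (θ' w))))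
                                 ψf≈0) ⟩
            (- (t ⊙ θ' w) + 0#) + t ⊙ θ' w
              ≈⟨ ≈-trans (+-congʳ (+-identityʳ _)) (-‿inverseˡ _) ⟩
            0# ∎
            where flip : ∀ s t → s *ₛ opposite (s *ₛ t) ≡ opposite t
                  flip = signIdentity 2
      ... | no e≢f = ≈-trans (switch-reattach (ends e) (ψ e))
                             (≡.subst (λ E → Walks.switchEnds K contracted ψ (ψ e) θ' E ≈ 0#) (contracted-≢f e≢f) (Z' e))

-- Without links every edge is a loop, a half edge or loose, and each vertex can be switched separately.
module Bouquet {c ℓ} (K : Field c ℓ) {n m : ℕ} (ends : Fin m → Ends n) (φ : Fin m → Field.Carrier K)
               (hyp : GainGraph.Hyperbalanced K ends φ)
               (½ : Field.Carrier K) (½-inverse : Field._≈_ K (Field._*_ K (Field._+_ K (Field.1# K) (Field.1# K)) ½) (Field.1# K))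
               (no-link : ∀ e x r y q → ends e ≡ two x r y q → x ≡ y) where
  open Field K renaming (refl to ≈-refl; sym to ≈-sym; trans to ≈-trans; reflexive to ≈-reflexive)
  open SetoidReasoning setoid
  open Walks K ends φ
  open RingProperties ring using (-0#≈0#; -‿involutive)
  open RingSolver (fromCommutativeRing commutativeRing (λ _ → nothing)) using (solve; _⊜_; _⊕_)

  x+x≈0⇒x≈0 : ∀ x → x + x ≈ 0# → x ≈ 0#
  x+x≈0⇒x≈0 x x+x≈0 = begin
    x                        ≈⟨ *-identityˡ x ⟨
    1# * x                   ≈⟨ *-congʳ ½-inverse ⟨
    ((1# + 1#) * ½) * x      ≈⟨ *-congʳ (*-comm _ _) ⟩
    (½ * (1# + 1#)) * x      ≈⟨ *-assoc _ _ _ ⟩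
    ½ * ((1# + 1#) * x)      ≈⟨ *-congˡ (≈-trans (distribʳ x 1# 1#) (+-cong (*-identityˡ x) (*-identityˡ x))) ⟩
    ½ * (x + x)              ≈⟨ *-congˡ x+x≈0 ⟩
    ½ * 0#                   ≈⟨ zeroʳ ½ ⟩
    0#                       ∎

  x≈½x+½x : ∀ x → x ≈ ½ * x + ½ * x
  x≈½x+½x x = begin
    x                    ≈⟨ *-identityˡ x ⟨
    1# * x               ≈⟨ *-congʳ ½-inverse ⟨
    ((1# + 1#) * ½) * x  ≈⟨ *-congʳ (≈-trans (distribʳ ½ 1# 1#) (+-cong (*-identityˡ ½) (*-identityˡ ½))) ⟩
    (½ + ½) * x          ≈⟨ distribʳ x ½ ½ ⟩
    ½ * x + ½ * x        ∎

  NegativeAt : Fin n → Ends n → Set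
  NegativeAt x E = (Σ Sign λ r → E ≡ half x r) ⊎ (Σ Sign λ r → E ≡ two x r x r)

  negativeAt? : ∀ x E → Dec (NegativeAt x E)
  negativeAt? x (half y r) with y ≟ x
  ... | yes refl = yes (inj₁ (r , refl))
  ... | no y≢x   = no λ { (inj₁ (_ , refl)) → y≢x refl ; (inj₂ (_ , ())) }
  negativeAt? x (two y r z q) with y ≟ x | z ≟ x | r Sign.≟ q
  ... | yes refl | yes refl | yes refl = yes (inj₂ (r , refl))
  ... | no y≢x   | _        | _        = no λ { (inj₁ (_ , ())) ; (inj₂ (_ , refl)) → y≢x refl }
  ... | yes _    | no z≢x   | _        = no λ { (inj₁ (_ , ())) ; (inj₂ (_ , refl)) → z≢x refl }
  ... | yes _    | yes _    | no r≢q   = no λ { (inj₁ (_ , ())) ; (inj₂ (_ , refl)) → r≢q refl }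
  negativeAt? x loose = no λ { (inj₁ (_ , ())) ; (inj₂ (_ , ())) }

  negativeEdgeAt? : ∀ x → Dec (∃ λ h → NegativeAt x (ends h))
  negativeEdgeAt? x = any? (λ h → negativeAt? x (ends h))

  -- θ x neutralises the first negative half edge or loop found at x.
  neutralising : ∀ x → Dec (∃ λ h → NegativeAt x (ends h)) → Carrier
  neutralising x (yes (h , inj₁ (r , _))) = - (r ⊙ φ h)
  neutralising x (yes (h , inj₂ (r , _))) = - (r ⊙ (½ * φ h))
  neutralising x (no _)                   = 0#

  θ : Fin n → Carrier
  θ x = neutralising x (negativeEdgeAt? x)

  ψ : Fin m → Carrier
  ψ = switch φ θ

  neutral : CircuitsNeutral ψ
  neutral = Equivalence.to (neutral⇔neutral-switch φ θ) (Equivalence.to hyperbalanced⇔neutral hyp)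

  chosen-neutral : ∀ x h (neg-h : NegativeAt x (ends h)) → θ x ≡ neutralising x (yes (h , neg-h)) → ψ h ≈ 0#
  chosen-neutral x h (inj₁ (r , eq)) θx≡ = ≡.subst (λ E → switchEnds (φ h) θ E ≈ 0#) (≡.sym eq) (begin
    r ⊙ θ x + φ h            ≡⟨ cong (λ q → r ⊙ q + φ h) θx≡ ⟩
    r ⊙ - (r ⊙ φ h) + φ h    ≈⟨ +-congʳ (≈-trans (⊙-‿comm r _) (-‿cong (⊙-involutive r (φ h)))) ⟩
    - φ h + φ h              ≈⟨ -‿inverseˡ (φ h) ⟩
    0#                       ∎)
  chosen-neutral x h (inj₂ (r , eq)) θx≡ = ≡.subst (λ E → switchEnds (φ h) θ E ≈ 0#) (≡.sym eq) (begin
    (r ⊙ θ x + φ h) + r ⊙ θ x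
      ≡⟨ cong (λ q → (r ⊙ q + φ h) + r ⊙ q) θx≡ ⟩
    (r ⊙ - (r ⊙ (½ * φ h)) + φ h) + r ⊙ - (r ⊙ (½ * φ h))
      ≈⟨ +-cong (+-congʳ unsigned) unsigned ⟩
    (- (½ * φ h) + φ h) + - (½ * φ h)
      ≈⟨ +-congʳ (+-congˡ (x≈½x+½x (φ h))) ⟩
    (- (½ * φ h) + (½ * φ h + ½ * φ h)) + - (½ * φ h)
      ≈⟨ solve 2 (λ N I → ((N ⊕ (I ⊕ I)) ⊕ N) ⊜ ((N ⊕ I) ⊕ (N ⊕ I))) ≈-refl (- (½ * φ h)) (½ * φ h) ⟩
    (- (½ * φ h) + ½ * φ h) + (- (½ * φ h) + ½ * φ h)
      ≈⟨ ≈-trans (+-cong (-‿inverseˡ _) (-‿inverseˡ _)) (+-identityˡ 0#) ⟩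
    0# ∎)
    where
      unsigned : r ⊙ - (r ⊙ (½ * φ h)) ≈ - (½ * φ h)
      unsigned = ≈-trans (⊙-‿comm r _) (-‿cong (⊙-involutive r _))

  loop-circle : ∀ {e x r q} → ends e ≡ two x r x q → IsCircle x [ (e , fwd) ]
  loop-circle {e} {x} {r} eq =
    (r , x , cong (λ E → stepFrom E fwd) eq , refl) , (λ ()) , Unique-∷ (λ ()) [] , Unique-∷ (λ ()) []

  loop-negative : ∀ {e x r} → ends e ≡ two x r x r → walkSign [ (e , fwd) ] ≡ neg
  loop-negative {e} {x} {r} eq = ≡.trans (cong (λ E → edgeSign E *ₛ pos) eq) (negative r)
    where negative : ∀ r → opposite (r *ₛ r) *ₛ pos ≡ neg
          negative = signIdentity 1

  loop-positive : ∀ {e x r} → ends e ≡ two x r x (opposite r) → walkSign [ (e , fwd) ] ≡ pos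
  loop-positive {e} {x} {r} eq = ≡.trans (cong (λ E → edgeSign E *ₛ pos) eq) (positive r)
    where positive : ∀ r → opposite (r *ₛ opposite r) *ₛ pos ≡ pos
          positive = signIdentity 1

  loop-vertices : ∀ {e x r q} → ends e ≡ two x r x q → ∀ {z} → z ∈ vsTail x [ (e , fwd) ] → z ≡ x
  loop-vertices {e} {x} eq (here z≡) = ≡.trans z≡ (next-step {x} (cong (λ E → stepFrom E fwd) eq))

  loop-fig : ∀ {e x r} → ends e ≡ two x r x r → NegFig x
  loop-fig eq = circF _ (loop-circle eq) (loop-negative eq)

  half-fig : ∀ {e x r} → ends e ≡ half x r → NegFig x
  half-fig {e} {r = r} eq = halfF e (r , eq)

  half-vertices : ∀ {e x r} (eq : ends e ≡ half x r) → ∀ {z} → z ∈ figVerts (half-fig eq) → z ≡ x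
  half-vertices eq (here z≡x) = z≡x

  single-gain : ∀ e d → gain ψ [ (e , d) ] ≈ 0# → ψ e ≈ 0#
  single-gain e d eq = ⊙≈0⇒≈0 (τdep e d) (⊙≈0⇒≈0 neg (≈-trans (≈-sym (+-identityʳ _))
                                                           (≈-trans (+-congˡ (≈-sym (⊙-zero (σ e)))) eq)))

  single-gain-zero : ∀ e d → ψ e ≈ 0# → gain ψ [ (e , d) ] ≈ 0#
  single-gain-zero e d eq = ≈-trans (+-cong (‿≈0 (≈0⇒⊙≈0 (τdep e d) eq)) (⊙-zero (σ e))) (+-identityʳ 0#)

  tight-cuff : ∀ {x h e} (F₁ F₂ : NegFig x) → figEdges F₁ ≡ [ h ] → figEdges F₂ ≡ [ e ] → h ≢ e →
               (∀ {z} → z ∈ figVerts F₁ → z ≡ x) → cuffgain ψ F₁ [] F₂ ≈ 0#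
  tight-cuff {x} F₁ F₂ edges₁ edges₂ h≢e at-x = proj₂ (proj₂ neutral) x x F₁ [] F₂ handcuff
    where
      at-x′ : ∀ {z} → z ∈ [ x ] → z ≡ x
      at-x′ (here z≡x) = z≡x
      disjoint : ∀ e' → e' ∈ figEdges F₁ → e' ∉ figEdges F₂
      disjoint e' i j rewrite edges₁ | edges₂ with i | j
      ... | here refl | here refl = h≢e refl
      handcuff : IsHandcuff F₁ [] F₂
      handcuff = (refl , Unique-∷ (λ ()) []) , disjoint , (λ _ _ j → at-x′ j) , (λ _ _ j → at-x′ j) ,
                 (λ _ i _ → here (at-x i))

  half-after-half : ∀ {h e x r₁ r} → h ≢ e → ends h ≡ half x r₁ → ends e ≡ half x r → ψ h ≈ 0# → ψ e ≈ 0#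
  half-after-half {h} {e} {x} {r₁} {r} h≢e eqh eqe ψh≈0 = ⊙≈0⇒≈0 r (⊙≈0⇒≈0 neg (begin
    - (r ⊙ ψ e)                           ≈⟨ +-identityˡ _ ⟨
    0# + - (r ⊙ ψ e)                      ≈⟨ +-cong (≈0⇒⊙≈0 r₁ ψh≈0) (+-identityˡ _) ⟨
    r₁ ⊙ ψ h + (0# + - (r ⊙ ψ e))
      ≡⟨ cong₂ (λ a b → a ⊙ ψ h + (0# + - (b ⊙ pos ⊙ ψ e))) (cong halfτ-of (≡.sym eqh)) (cong halfτ-of (≡.sym eqe)) ⟩
    cuffgain ψ (half-fig eqh) [] (half-fig eqe)
      ≈⟨ tight-cuff (half-fig eqh) (half-fig eqe) refl refl h≢e (half-vertices eqh) ⟩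
    0#                                    ∎))

  loop-after-half : ∀ {h e x r₁ r} → h ≢ e → ends h ≡ half x r₁ → ends e ≡ two x r x r → ψ h ≈ 0# → ψ e ≈ 0#
  loop-after-half {h} {e} {x} {r₁} {r} h≢e eqh eqe ψh≈0 = single-gain e fwd (begin
    gain ψ [ (e , fwd) ]                                      ≈⟨ +-identityʳ _ ⟨
    gain ψ [ (e , fwd) ] + 0#                                 ≈⟨ +-congˡ (‿≈0 (≈0⇒⊙≈0 r₁ (≈0⇒⊙≈0 (walkSign [ (e , fwd) ]) ψh≈0))) ⟨
    gain ψ [ (e , fwd) ] + - (r₁ ⊙ walkSign [ (e , fwd) ] ⊙ ψ h)   ≈⟨ +-identityˡ _ ⟨
    0# + (gain ψ [ (e , fwd) ] + - (r₁ ⊙ walkSign [ (e , fwd) ] ⊙ ψ h))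
      ≈⟨ +-congʳ (≈0⇒⊙≈0 r₁ ψh≈0) ⟨
    r₁ ⊙ ψ h + (gain ψ [ (e , fwd) ] + - (r₁ ⊙ walkSign [ (e , fwd) ] ⊙ ψ h))
      ≡⟨ cong (λ a → a ⊙ ψ h + (gain ψ [ (e , fwd) ] + - (a ⊙ walkSign [ (e , fwd) ] ⊙ ψ h))) (cong halfτ-of (≡.sym eqh)) ⟩
    cuffgain ψ (half-fig eqh) [] (loop-fig eqe)
      ≈⟨ tight-cuff (half-fig eqh) (loop-fig eqe) refl refl h≢e (half-vertices eqh) ⟩
    0# ∎)

  loop-after-loop : ∀ {h e x r₁ r} → h ≢ e → ends h ≡ two x r₁ x r₁ → ends e ≡ two x r x r → ψ h ≈ 0# → ψ e ≈ 0#
  loop-after-loop {h} {e} {x} {r₁} {r} h≢e eqh eqe ψh≈0 = single-gain e fwd (⊙≈0⇒≈0 (σ h) (begin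
    σ h ⊙ gain ψ [ (e , fwd) ]                                ≈⟨ +-identityˡ _ ⟨
    0# + σ h ⊙ gain ψ [ (e , fwd) ]                           ≈⟨ +-congʳ (‿≈0 (≈0⇒⊙≈0 (τdep h fwd) ψh≈0)) ⟨
    cuffgain ψ (loop-fig eqh) [] (loop-fig eqe)
      ≈⟨ tight-cuff (loop-fig eqh) (loop-fig eqe) refl refl h≢e (loop-vertices eqh) ⟩
    0# ∎))

  -- Here the handcuff walk runs twice through the half edge e, hence the division by 2.
  half-after-loop : ∀ {h e x r₁ r} → h ≢ e → ends h ≡ two x r₁ x r₁ → ends e ≡ half x r → ψ h ≈ 0# → ψ e ≈ 0#
  half-after-loop {h} {e} {x} {r₁} {r} h≢e eqh eqe ψh≈0 = ⊙≈0⇒≈0 r (x+x≈0⇒x≈0 (r ⊙ ψ e) (begin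
    r ⊙ ψ e + r ⊙ ψ e
      ≈⟨ +-congˡ (≈-trans (+-identityˡ _) (≈-trans (-‿cong (⊙-‿comm r (ψ e))) (-‿involutive _))) ⟨
    r ⊙ ψ e + (0# + - (r ⊙ - ψ e))
      ≈⟨ +-congˡ (+-congʳ (single-gain-zero h fwd ψh≈0)) ⟨
    r ⊙ ψ e + (gain ψ [ (h , fwd) ] + - (r ⊙ - ψ e))
      ≡⟨ cong₂ (λ a b → a ⊙ ψ e + (gain ψ [ (h , fwd) ] + - (a ⊙ b ⊙ ψ e)))
               (cong halfτ-of (≡.sym eqe)) (≡.sym (≡.trans (cong (λ W → walkSign W) (List.++-identityʳ [ (h , fwd) ]))
                                                          (loop-negative eqh))) ⟩
    cuffgain ψ (loop-fig eqh) [] (half-fig eqe)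
      ≈⟨ tight-cuff (loop-fig eqh) (half-fig eqe) refl refl h≢e (loop-vertices eqh) ⟩
    0# ∎))

  neutral-at : ∀ e E → ends e ≡ E → ψ e ≈ 0#
  neutral-at e loose eq = proj₁ neutral e eq
  neutral-at e (half x r) eq with negativeEdgeAt? x in found
  ... | no none = ⊥-elim (none (e , inj₁ (r , eq)))
  ... | yes (h , neg-h) with h ≟ e
  ...   | yes refl = chosen-neutral x h neg-h (cong (neutralising x) found)
  ...   | no h≢e   = after neg-h (chosen-neutral x h neg-h (cong (neutralising x) found))
    where after : NegativeAt x (ends h) → ψ h ≈ 0# → ψ e ≈ 0#
          after (inj₁ (_ , eqh)) = half-after-half h≢e eqh eq
          after (inj₂ (_ , eqh)) = half-after-loop h≢e eqh eq
  neutral-at e (two x r y q) eq with no-link e x r y q eq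
  ... | refl with r Sign.≟ q
  ...   | yes refl = negative-loop
    where
      negative-loop : ψ e ≈ 0#
      negative-loop with negativeEdgeAt? x in found
      ... | no none = ⊥-elim (none (e , inj₂ (r , eq)))
      ... | yes (h , neg-h) with h ≟ e
      ...   | yes refl = chosen-neutral x h neg-h (cong (neutralising x) found)
      ...   | no h≢e   = after neg-h (chosen-neutral x h neg-h (cong (neutralising x) found))
        where after : NegativeAt x (ends h) → ψ h ≈ 0# → ψ e ≈ 0#
              after (inj₁ (_ , eqh)) = loop-after-half h≢e eqh eq
              after (inj₂ (_ , eqh)) = loop-after-loop h≢e eqh eq
  ...   | no r≢q = single-gain e fwd (proj₁ (proj₂ neutral) x [ (e , fwd) ] (loop-circle eq) (loop-positive eq′))
    where
      q≡opposite : ∀ r q → r ≢ q → q ≡ opposite r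
      q≡opposite pos pos r≢q = ⊥-elim (r≢q refl)
      q≡opposite pos neg _   = refl
      q≡opposite neg pos _   = refl
      q≡opposite neg neg r≢q = ⊥-elim (r≢q refl)
      eq′ : ends e ≡ two x r x (opposite r)
      eq′ = ≡.trans eq (cong (two x r x) (q≡opposite r q r≢q))

  switcher : ∀ e → switch φ θ e ≈ 0#
  switcher e = neutral-at e (ends e) refl

nonLoose : ∀ {n} → Ends n → ℕ
nonLoose loose         = 0
nonLoose (two _ _ _ _) = 1
nonLoose (half _ _)    = 1

nonLooseCount : ∀ {n m} → (Fin m → Ends n) → ℕ
nonLooseCount {m = zero}  E = 0
nonLooseCount {m = suc m} E = nonLoose (E Fin.zero) +ℕ nonLooseCount (λ e → E (Fin.suc e))

nonLooseCount-cong : ∀ {n m} (E E' : Fin m → Ends n) → (∀ e → nonLoose (E' e) ≡ nonLoose (E e)) →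
                     nonLooseCount E' ≡ nonLooseCount E
nonLooseCount-cong {m = zero}  E E' same = refl
nonLooseCount-cong {m = suc m} E E' same =
  cong₂ _+ℕ_ (same Fin.zero) (nonLooseCount-cong (λ e → E (Fin.suc e)) (λ e → E' (Fin.suc e)) (λ e → same (Fin.suc e)))

nonLooseCount-< : ∀ {n m} (E E' : Fin m → Ends n) (f : Fin m) → nonLoose (E f) ≡ 1 → nonLoose (E' f) ≡ 0 →
                  (∀ e → e ≢ f → nonLoose (E' e) ≡ nonLoose (E e)) → nonLooseCount E' < nonLooseCount E
nonLooseCount-< {m = suc m} E E' Fin.zero Ef E'f same
  rewrite Ef | E'f | nonLooseCount-cong (λ e → E (Fin.suc e)) (λ e → E' (Fin.suc e)) (λ e → same (Fin.suc e) (λ ())) =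
  ℕ.≤-refl
nonLooseCount-< {m = suc m} E E' (Fin.suc f) Ef E'f same rewrite same Fin.zero (λ ()) =
  ℕ.+-monoʳ-< (nonLoose (E Fin.zero))
    (nonLooseCount-< (λ e → E (Fin.suc e)) (λ e → E' (Fin.suc e)) f Ef E'f (λ e e≢f → same (Fin.suc e) (e≢f ∘ suc-injective)))

IsLink : ∀ {n} → Ends n → Set
IsLink E = Σ _ λ x → Σ Sign λ r → Σ _ λ y → Σ Sign λ q → (E ≡ two x r y q) × (x ≢ y)

isLink? : ∀ {n} (E : Ends n) → Dec (IsLink E)
isLink? (two x r y q) with x ≟ y
... | yes x≡y = no λ { (_ , _ , _ , _ , refl , x≢y) → x≢y x≡y }
... | no x≢y  = yes (x , r , y , q , refl , x≢y)
isLink? (half _ _) = no λ { (_ , _ , _ , _ , () , _) }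
isLink? loose      = no λ { (_ , _ , _ , _ , () , _) }

-- Contracting a link makes it loose, so the number of non-loose edges decreases.
hyperbalanced⇒switcher : ∀ {c ℓ} (K : Field c ℓ) (½ : Field.Carrier K) →
                         Field._≈_ K (Field._*_ K (Field._+_ K (Field.1# K) (Field.1# K)) ½) (Field.1# K) →
                         ∀ k {n m} (ends : Fin m → Ends n) (φ : Fin m → Field.Carrier K) → nonLooseCount ends ≤ k →
                         GainGraph.Hyperbalanced K ends φ →
                         Σ (Fin n → Field.Carrier K) λ θ → ∀ e → Field._≈_ K (Walks.switch K ends φ φ θ e) (Field.0# K)
hyperbalanced⇒switcher K ½ ½-inverse k ends φ count≤k hyp with any? (λ e → isLink? (ends e))
... | no no-link = Bouquet.θ K ends φ hyp ½ ½-inverse loops , Bouquet.switcher K ends φ hyp ½ ½-inverse loops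
  where
    loops : ∀ e x r y q → ends e ≡ two x r y q → x ≡ y
    loops e x r y q eq with x ≟ y
    ... | yes x≡y = x≡y
    ... | no x≢y  = ⊥-elim (no-link (e , x , r , y , q , eq , x≢y))
... | yes (f , v , s , w , t , hf , v≢w) = recurse k count≤k
  where
    open ContractLink K ends φ hyp f v w s t hf v≢w
    fewer : nonLooseCount contracted < nonLooseCount ends
    fewer = nonLooseCount-< ends contracted f (cong nonLoose hf) (cong nonLoose contracted-f) kept
      where
        kept : ∀ e → e ≢ f → nonLoose (contracted e) ≡ nonLoose (ends e)
        kept e e≢f rewrite contracted-≢f e≢f with ends e
        ... | two _ _ _ _ = refl
        ... | half _ _    = refl
        ... | loose       = refl
    recurse : ∀ k → nonLooseCount ends ≤ k → Σ (Fin _ → Field.Carrier K) λ θ → ∀ e → Field._≈_ K (Walks.switch K ends φ φ θ e) (Field.0# K)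
    recurse zero    count≤0 = ⊥-elim (ℕ.n≮0 (ℕ.<-≤-trans fewer count≤0))
    recurse (suc k) count≤k with hyperbalanced⇒switcher K ½ ½-inverse k contracted ψ
                                   (ℕ.≤-pred (ℕ.<-≤-trans fewer count≤k)) contracted-hyperbalanced
    ... | θ' , Z' = pull-back θ' Z'

theorem2p13 : ∀ {c ℓ} (K : Field c ℓ) → ¬ (Field._≈_ K (Field._+_ K (Field.1# K) (Field.1# K)) (Field.0# K))
              → ∀ {n m : ℕ} (ends : Fin m → Ends n) (φ : Fin m → Field.Carrier K)
              → GainGraph.Hyperbalanced K ends φ
                ⇔ Σ (Fin n → Field.Carrier K) (λ θ → ∀ e → Field._≈_ K (GainGraph.switched K ends φ θ e) (Field.0# K))
theorem2p13 K 2≉0 ends φ = mk⇔ switcher-exists hyperbalanced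
  where
    open Field K using (_≈_; 0#; inverse; trans; sym)
    open Walks K ends φ using (switch; switched≈switch; hyperbalanced⇔neutral; neutral⇔neutral-switch; zero⇒neutral)
    switcher-exists : GainGraph.Hyperbalanced K ends φ → Σ _ λ θ → ∀ e → GainGraph.switched K ends φ θ e ≈ 0#
    switcher-exists hyp with inverse _ 2≉0
    ... | ½ , ½-inverse with hyperbalanced⇒switcher K ½ ½-inverse _ ends φ ℕ.≤-refl hyp
    ...   | θ , neutralised = θ , λ e → trans (switched≈switch θ e) (neutralised e)
    hyperbalanced : Σ _ (λ θ → ∀ e → GainGraph.switched K ends φ θ e ≈ 0#) → GainGraph.Hyperbalanced K ends φ
    hyperbalanced (θ , switched≈0) =
      Equivalence.from hyperbalanced⇔neutral
        (Equivalence.from (neutral⇔neutral-switch φ θ)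
          (zero⇒neutral (switch φ θ) λ e → trans (sym (switched≈switch θ e)) (switched≈0 e)))
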